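{- Let $P$ be a register machine program using only one register, with one read statement at the beginning and one write statement at the end, and let $f$ be the (possibly partial) function from integers to integers that it computes. Then $f$ is automatic, and there are integer constants $k,h,i,j,i',j'$ with $k,h>0$ and $i,i'$ powers of $2$ such that: (1) either $f(x)=f(x+h)$ for all $x\geq k$, or $f(x)=ix+j$ for all $x\geq k$, or $f(x)=-ix+j$ for all $x\geq k$; (2) either $f(x)=f(x-h)$ for all $x\leq -k$, or $f(x)=i'x+j'$ for all $x\leq -k$, or $f(x)=-i'x+j'$ for all $x\leq -k$. Here $f(x)=f(x+h)$ means that either $f$ is undefined on both arguments or both values are defined and equal. In the second and third alternatives of each item the computation time is constant; in the first alternative it is either constant, or exponential in the number $n$ of binary digits of $x$, or the computation does not terminate.
   Context: Model (addition machine): finitely many registers holding arbitrary integers; unit-cost commands $x=y+z$, $x=y+c$, $x=y-z$, $x=y-c$, $x=c-y$, $x=c$ (registers $x,y,z$, integer constants $c$), read/write of a whole integer, conditionals comparing a register with a register or a constant via $<,=,>,\neq,\leq,\geq$, and goto; finitely many variables with a fixed finite range of values may also be used and do not count as registers. The function computed maps the input read to the output written; it is undefined where the program does not halt. A function $f$ on numbers is automatic if for some base $b\geq 2$ there is a deterministic finite automaton which reads the base-$b$ representation of $x$ and of a candidate $y$ in parallel symbol by symbol (padded with leading zeros, aligned at the least significant digit; signs encoded by an extra symbol) and accepts exactly when $y=f(x)$. -}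

module Defs where

open import Data.Nat as ℕ using (ℕ; zero; suc)
open import Data.Nat.DivMod using (_/_; _mod_)
open import Data.Nat.Logarithm using (⌊log₂_⌋)
open import Data.Integer as ℤ using (ℤ; +_; -[1+_]; _+_; _-_; -_; _*_; ∣_∣)
import Data.Integer.Properties as ℤP
open import Data.Fin using (Fin)
open import Data.Bool using (Bool; true; false; not; if_then_else_)
open import Data.List using (List; []; _∷_; _++_; [_]; zip; map)
open import Data.Product using (Σ; _×_; _,_; proj₁; proj₂)
open import Data.Sum using (_⊎_)
open import Relation.Nullary using (¬_)
open import Relation.Nullary.Decidable using (⌊_⌋)
open import Relation.Binary.PropositionalEquality using (_≡_)

-- The control part of a program is a
-- finite set of labels Fin size; finitely many finite-range variables
-- are absorbed into the labels (a label encodes program point together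
-- with the values of the finite variables).  The read statement is
-- executed once before the start label; the write statement is the
-- unique kind of terminal instruction (write r and halt).

data Op : Set where
  r:=r+r : Op
  r:=r+c : ℤ → Op
  r:=r-r : Op
  r:=r-c : ℤ → Op
  r:=c-r : ℤ → Op
  r:=c   : ℤ → Op

applyOp : Op → ℤ → ℤ
applyOp r:=r+r     r = r + r
applyOp (r:=r+c c) r = r + c
applyOp r:=r-r     r = r - r
applyOp (r:=r-c c) r = r - c
applyOp (r:=c-r c) r = c - r
applyOp (r:=c c)   r = c

data Rel : Set where
  lt eq gt ne le ge : Rel

data Operand : Set where
  reg : Operand
  con : ℤ → Operand

operand : Operand → ℤ → ℤ
operand reg     r = r
operand (con c) r = c

holds : Rel → ℤ → ℤ → Bool
holds lt a b = ⌊ a ℤ.<? b ⌋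
holds eq a b = ⌊ a ℤ.≟ b ⌋
holds gt a b = ⌊ b ℤ.<? a ⌋
holds ne a b = not ⌊ a ℤ.≟ b ⌋
holds le a b = ⌊ a ℤ.≤? b ⌋
holds ge a b = ⌊ b ℤ.≤? a ⌋

data Instr (n : ℕ) : Set where
  assign : Op → Fin n → Instr n
  test   : Rel → Operand → Fin n → Fin n → Instr n
  goto   : Fin n → Instr n
  write  : Instr n

record Program : Set where
  field
    size  : ℕ
    code  : Fin size → Instr size
    start : Fin size
open Program public

Config : Program → Set
Config P = Fin (size P) × ℤ

step : (P : Program) → Config P → Config P
step P (l , r) with code P l
... | assign o l'      = l' , applyOp o r
... | test ρ o l₁ l₂   = (if holds ρ r (operand o r) then l₁ else l₂) , r
... | goto l'          = l' , r
... | write            = l , r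

run : (P : Program) → ℕ → ℤ → Config P
run P zero    x = start P , x
run P (suc t) x = step P (run P t x)

data IsWrite {n : ℕ} : Instr n → Set where
  isWrite : IsWrite write

Halted : (P : Program) → Config P → Set
Halted P c = IsWrite (code P (proj₁ c))

HaltsAt : Program → ℤ → ℕ → ℤ → Set
HaltsAt P x t y =
  Halted P (run P t x) × proj₂ (run P t x) ≡ y ×
  ((t' : ℕ) → t' ℕ.< t → ¬ Halted P (run P t' x))

-- graph of the partial function computed by P:  Computes P x y  ⇔  f(x) = y
Computes : Program → ℤ → ℤ → Set
Computes P x y = Σ ℕ λ t → HaltsAt P x t y

Undefined : Program → ℤ → Set
Undefined P x = ¬ (Σ ℤ λ y → Computes P x y)

-- Base b = 2 + b'.
-- An integer z is written, for a padding length m with ∣z∣ < b^m, as its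
-- sign symbol followed by the m base-b digits of ∣z∣ (most significant
-- first, padded with leading zeros).  The automaton reads the
-- convolution of x and y (pairs of symbols), both padded to the same
-- length m, hence aligned at the least significant digit.

data Sym (b : ℕ) : Set where
  dig   : Fin b → Sym b
  plus  : Sym b
  minus : Sym b

sign : {b : ℕ} → ℤ → Sym b
sign (+ _)    = plus
sign -[1+ _ ] = minus

digitsPad : (b' m n : ℕ) → List (Fin (suc (suc b')))
digitsPad b' zero    n = []
digitsPad b' (suc m) n = digitsPad b' m (n / suc (suc b')) ++ [ n mod suc (suc b') ]

conv : (b' m : ℕ) → ℤ → ℤ → List (Sym (suc (suc b')) × Sym (suc (suc b')))
conv b' m x y =
  (sign x , sign y) ∷
  map (λ p → dig (proj₁ p) , dig (proj₂ p)) (zip (digitsPad b' m ∣ x ∣) (digitsPad b' m ∣ y ∣))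

record DFA (A : Set) : Set where
  field
    states : ℕ
    δ      : Fin states → A → Fin states
    q₀     : Fin states
    final  : Fin states → Bool

runDFA : {A : Set} (M : DFA A) → Fin (DFA.states M) → List A → Fin (DFA.states M)
runDFA M q []       = q
runDFA M q (a ∷ w) = runDFA M (DFA.δ M q a) w

accepts : {A : Set} → DFA A → List A → Bool
accepts M w = DFA.final M (runDFA M (DFA.q₀ M) w)

Automatic : (ℤ → ℤ → Set) → Set
Automatic F =
  Σ ℕ λ b' → Σ (DFA (Sym (suc (suc b')) × Sym (suc (suc b')))) λ M →
    (m : ℕ) (x y : ℤ) →
    ∣ x ∣ ℕ.< suc (suc b') ℕ.^ m → ∣ y ∣ ℕ.< suc (suc b') ℕ.^ m →
    ((accepts M (conv b' m x y) ≡ true → F x y) × (F x y → accepts M (conv b' m x y) ≡ true))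

-- Eventual behaviour on a region R (x ≥ k, resp. x ≤ -k) with shift
-- x ↦ x + h (resp. x ↦ x - h).

SameValue : Program → ℤ → ℤ → Set
SameValue P x x' =
  (Undefined P x × Undefined P x') ⊎ (Σ ℤ λ y → Computes P x y × Computes P x' y)

-- number of binary digits of ∣x∣ (x ≠ 0)
bitLength : ℤ → ℕ
bitLength x = suc ⌊log₂ ∣ x ∣ ⌋

ConstantTime : Program → (ℤ → Set) → Set
ConstantTime P R =
  Σ ℕ λ T → (x : ℤ) → R x → Σ ℕ λ t → t ℕ.≤ T × Σ ℤ λ y → HaltsAt P x t y

ConstExpOrDiverge : Program → (ℤ → Set) → Set
ConstExpOrDiverge P R =
  Σ ℕ λ C → Σ ℕ λ d → 1 ℕ.≤ d × ((x : ℤ) → R x →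
    (Σ ℕ λ t → t ℕ.≤ C × Σ ℤ λ y → HaltsAt P x t y)
    ⊎ (Σ ℕ λ t → (2 ℕ.^ bitLength x ℕ.≤ d ℕ.* t) × (t ℕ.≤ d ℕ.* 2 ℕ.^ bitLength x)
                 × Σ ℤ λ y → HaltsAt P x t y)
    ⊎ Undefined P x)

Behaviour : Program → (ℤ → Set) → (ℤ → ℤ) → ℤ → ℤ → Set
Behaviour P R shift i j =
  (((x : ℤ) → R x → SameValue P x (shift x)) × ConstExpOrDiverge P R)
  ⊎ (((x : ℤ) → R x → Computes P x (i * x + j)) × ConstantTime P R)
  ⊎ (((x : ℤ) → R x → Computes P x (- i * x + j)) × ConstantTime P R)

{-# OPTIONS --safe #-}

-- Let M bound the constants of P.  While |r| > M, no test distinguishes r from r + δ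
-- when δ points away from 0, and every instruction multiplies such a displacement by
-- its slope 0, ±1 or 2.  Hence a run halts, diverges or returns to |r| ≤ M: among large
-- configurations a repeated label and sign closes a cycle that either pushes the
-- register outwards forever or pulls it inwards.  This decides halting and bounds the
-- halting time uniformly on bounded registers.
--
-- For inputs ±u with u ≥ X, compare with the run from ±X.  Within N steps its path
-- slope vanishes (all inputs merge, f is eventually periodic), or it halts with slope
-- ±2^e (f is affine, in constant time), or it runs into a cycle.  An outward cycle
-- makes f undefined; an inward one has slope 1 and moves the register by a fixed d
-- per pass, so f(u + d) = f(u) and the time is linear in u, i.e. exponential in the
-- number of digits.  The function is automatic: a finite table below X and, on each
-- side, an automaton for residues modulo the period or for a linear equation.

module Submission where

open import Defs hiding (lt; eq; gt; ne; le; ge)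
open import Data.Nat as ℕ using (ℕ; zero; suc; _∸_; _⊔_; _^_; ⌊_/2⌋; ⌈_/2⌉)
import Data.Nat.Properties as ℕP
open import Data.Nat.DivMod using (_/_; _%_; _mod_)
import Data.Nat.DivMod as DM
open import Data.Nat.Logarithm
import Data.Nat.Tactic.RingSolver as ℕSolver
open import Data.Integer as ℤ using (ℤ; +_; -[1+_]; _+_; _-_; -_; _*_; ∣_∣; _≤_; _<_; +≤+; -≤+; -≤-; +<+; -<+; -<-)
import Data.Integer.Properties as ℤP
open import Data.Integer.Tactic.RingSolver
open import Data.Fin as F using (Fin; toℕ; combine; remQuot)
import Data.Fin.Properties as FP
open import Data.List using (List; []; _∷_; _++_; [_]; zip; map; length)
import Data.List.Properties as LP
open import Data.Product using (Σ; _×_; _,_; proj₁; proj₂)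
open import Data.Sum using (_⊎_; inj₁; inj₂; [_,_]′)
open import Data.Empty using (⊥-elim)
open import Data.Bool using (Bool; true; false; _∧_; _∨_; not; if_then_else_)
import Data.Bool.Properties as BP
open import Function using (_∘_)
open import Relation.Nullary
open import Relation.Nullary.Decidable using (⌊_⌋)
open import Relation.Binary.PropositionalEquality hiding ([_])

isYes-false : ∀ {A : Set} (a? : Dec A) → ¬ A → ⌊ a? ⌋ ≡ false
isYes-false (yes a) ¬a = ⊥-elim (¬a a)
isYes-false (no _)  ¬a = refl

isYes-true : ∀ {A : Set} (a? : Dec A) → A → ⌊ a? ⌋ ≡ true
isYes-true (yes _) _ = refl
isYes-true (no ¬a) a = ⊥-elim (¬a a)

isYes-witness : ∀ {A : Set} (a? : Dec A) → ⌊ a? ⌋ ≡ true → A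
isYes-witness (yes a) _ = a

isYes-cong : ∀ {A B : Set} (a? : Dec A) (b? : Dec B) → (A → B) → (B → A) → ⌊ a? ⌋ ≡ ⌊ b? ⌋
isYes-cong (yes a) (yes b) f g = refl
isYes-cong (yes a) (no ¬b) f g = ⊥-elim (¬b (f a))
isYes-cong (no ¬a) (yes b) f g = ⊥-elim (¬a (g b))
isYes-cong (no ¬a) (no ¬b) f g = refl

i≤∣i∣ : ∀ i → i ≤ + ∣ i ∣
i≤∣i∣ (+ n)    = ℤP.≤-refl
i≤∣i∣ -[1+ n ] = -≤+

-∣i∣≤i : ∀ i → - (+ ∣ i ∣) ≤ i
-∣i∣≤i i = subst (λ z → - + ∣ i ∣ ≤ z) (ℤP.neg-involutive i)
             (ℤP.neg-mono-≤ (subst (λ k → - i ≤ + k) (ℤP.∣-i∣≡∣i∣ i) (i≤∣i∣ (- i))))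

i≢0⇒1≤∣i∣ : ∀ {i} → i ≢ + 0 → 1 ℕ.≤ ∣ i ∣
i≢0⇒1≤∣i∣ {+ zero}    i≢0 = ⊥-elim (i≢0 refl)
i≢0⇒1≤∣i∣ {+ suc k}   _   = ℕ.s≤s ℕ.z≤n
i≢0⇒1≤∣i∣ { -[1+ k ]} _   = ℕ.s≤s ℕ.z≤n

0<∣i∣⇒i≢0 : ∀ {i} → 0 ℕ.< ∣ i ∣ → i ≢ + 0
0<∣i∣⇒i≢0 {+ zero} () refl

∣i∣<∣j∣⇒i<j : ∀ {i j} → ∣ i ∣ ℕ.< ∣ j ∣ → + 0 ≤ j → i < j
∣i∣<∣j∣⇒i<j {i} {+ a} lt _ = ℤP.≤-<-trans (i≤∣i∣ i) (+<+ lt)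

∣i∣<∣j∣⇒j<i : ∀ {i j} → ∣ i ∣ ℕ.< ∣ j ∣ → j ≤ + 0 → j < i
∣i∣<∣j∣⇒j<i {i} { -[1+ a ]} lt _ = ℤP.<-≤-trans (-[1+a]<-k ∣ i ∣ lt) (-∣i∣≤i i)
  where
  -[1+a]<-k : ∀ k → k ℕ.< suc a → -[1+ a ] < - (+ k)
  -[1+a]<-k zero    _             = -<+
  -[1+a]<-k (suc k) (ℕ.s≤s k<a) = -<- k<a
∣i∣<∣j∣⇒j<i {i} {+ zero}  () _
∣i∣<∣j∣⇒j<i {i} {+ suc n} _  (+≤+ ())

∣i∣<∣j∣⇒0≤j+i : ∀ {i j} → ∣ i ∣ ℕ.< ∣ j ∣ → + 0 ≤ j → + 0 ≤ j + i
∣i∣<∣j∣⇒0≤j+i {+ b}      {+ a} lt _ = +≤+ ℕ.z≤n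
∣i∣<∣j∣⇒0≤j+i { -[1+ b ]} {+ a} lt _ = subst (+ 0 ≤_) (sym (ℤP.⊖-≥ (ℕP.<⇒≤ lt))) (+≤+ ℕ.z≤n)

∣i∣<∣j∣⇒j+i≤0 : ∀ {i j} → ∣ i ∣ ℕ.< ∣ j ∣ → j ≤ + 0 → j + i ≤ + 0
∣i∣<∣j∣⇒j+i≤0 {+ b}      { -[1+ a ]} lt _ = subst (_≤ + 0) (sym (ℤP.⊖-< lt)) ℤP.neg-≤-pos
∣i∣<∣j∣⇒j+i≤0 { -[1+ b ]} { -[1+ a ]} lt _ = -≤+
∣i∣<∣j∣⇒j+i≤0 {i} {+ zero}  () _
∣i∣<∣j∣⇒j+i≤0 {i} {+ suc n} _  (+≤+ ())

IsUnit : ℤ → Set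
IsUnit s = s ≡ + 1 ⊎ s ≡ - + 1

∣s*n∣≡n : ∀ {s} → IsUnit s → ∀ n → ∣ s * + n ∣ ≡ n
∣s*n∣≡n (inj₁ refl) n = cong ∣_∣ (ℤP.*-identityˡ (+ n))
∣s*n∣≡n (inj₂ refl) n = trans (cong ∣_∣ (ℤP.-1*i≡-i (+ n))) (ℤP.∣-i∣≡∣i∣ (+ n))

s*m-s*n≡s*[m∸n] : ∀ s m n → n ℕ.≤ m → s * + m + - (s * + n) ≡ s * + (m ∸ n)
s*m-s*n≡s*[m∸n] s m n n≤m = trans (factor s (+ m) (+ n)) (cong (s *_) (trans (ℤP.m-n≡m⊖n m n) (ℤP.⊖-≥ n≤m)))
  where factor : ∀ s a b → s * a + - (s * b) ≡ s * (a + - b)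
        factor = solve-∀

-- Outward r δ: moving from r by δ does not move towards 0.  While the
-- register is large, such displacements are invisible to every test.
Outward : ℤ → ℤ → Set
Outward r δ = (+ 0 ≤ r × + 0 ≤ δ) ⊎ (r ≤ + 0 × δ ≤ + 0)

outward? : ∀ r δ → Dec (Outward r δ)
outward? r δ with + 0 ℤP.≤? r | + 0 ℤP.≤? δ | r ℤP.≤? + 0 | δ ℤP.≤? + 0
... | yes a | yes b | _     | _     = yes (inj₁ (a , b))
... | _     | _     | yes a | yes b = yes (inj₂ (a , b))
... | no a  | _     | no c  | _     = no λ { (inj₁ (x , _)) → a x ; (inj₂ (x , _)) → c x }
... | no a  | _     | yes c | no d  = no λ { (inj₁ (x , _)) → a x ; (inj₂ (_ , y)) → d y }
... | yes a | no b  | no c  | _     = no λ { (inj₁ (_ , y)) → b y ; (inj₂ (x , _)) → c x }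
... | yes a | no b  | yes c | no d  = no λ { (inj₁ (_ , y)) → b y ; (inj₂ (_ , y)) → d y }

outward-0 : ∀ r → Outward r (+ 0)
outward-0 r with ℤP.≤-total (+ 0) r
... | inj₁ 0≤r = inj₁ (0≤r , ℤP.≤-refl)
... | inj₂ r≤0 = inj₂ (r≤0 , ℤP.≤-refl)

outward-+ : ∀ {r d e} → r ≢ + 0 → Outward r d → Outward r e → Outward r (d + e)
outward-+ r≢0 (inj₁ (a , b)) (inj₁ (_ , c)) = inj₁ (a , ℤP.+-mono-≤ b c)
outward-+ r≢0 (inj₂ (a , b)) (inj₂ (_ , c)) = inj₂ (a , ℤP.+-mono-≤ b c)
outward-+ r≢0 (inj₁ (a , b)) (inj₂ (c , d)) = ⊥-elim (r≢0 (ℤP.≤-antisym c a))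
outward-+ r≢0 (inj₂ (a , b)) (inj₁ (c , d)) = ⊥-elim (r≢0 (ℤP.≤-antisym a c))

outward-1* : ∀ {r δ} → Outward r δ → Outward r (+ 1 * δ)
outward-1* {r} {δ} = subst (Outward r) (sym (ℤP.*-identityˡ δ))

outward-scale : ∀ {r e} k → + 0 ≤ k → Outward r e → Outward r (k * e)
outward-scale {r} {e} k (+≤+ _) (inj₁ (a , b)) = inj₁ (a , subst (_≤ k * e) (ℤP.*-zeroʳ k) (ℤP.*-monoˡ-≤-nonNeg k b))
outward-scale {r} {e} k (+≤+ _) (inj₂ (a , b)) = inj₂ (a , subst (k * e ≤_) (ℤP.*-zeroʳ k) (ℤP.*-monoˡ-≤-nonNeg k b))

outward-forward : ∀ {r e x} → r ≢ + 0 → Outward r e → Outward r x → Outward (r + e) x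
outward-forward r≢0 (inj₁ (a , b)) (inj₁ (_ , d)) = inj₁ (ℤP.+-mono-≤ a b , d)
outward-forward r≢0 (inj₂ (a , b)) (inj₂ (_ , d)) = inj₂ (ℤP.+-mono-≤ a b , d)
outward-forward r≢0 (inj₁ (a , b)) (inj₂ (c , d)) = ⊥-elim (r≢0 (ℤP.≤-antisym c a))
outward-forward r≢0 (inj₂ (a , b)) (inj₁ (c , d)) = ⊥-elim (r≢0 (ℤP.≤-antisym a c))

outward-backward : ∀ {r D e} → r ≢ + 0 → Outward r D → Outward (r + D) e → Outward r e
outward-backward r≢0 (inj₁ (a , b)) (inj₁ (_ , d)) = inj₁ (a , d)
outward-backward r≢0 (inj₂ (a , b)) (inj₂ (_ , d)) = inj₂ (a , d)
outward-backward {r} r≢0 (inj₁ (a , b)) (inj₂ (c , d)) =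
  ⊥-elim (r≢0 (ℤP.≤-antisym (ℤP.≤-trans (ℤP.≤-trans (ℤP.≤-reflexive (sym (ℤP.+-identityʳ r))) (ℤP.+-monoʳ-≤ r b)) c) a))
outward-backward {r} r≢0 (inj₂ (a , b)) (inj₁ (c , d)) =
  ⊥-elim (r≢0 (ℤP.≤-antisym a (ℤP.≤-trans c (ℤP.≤-trans (ℤP.+-monoʳ-≤ r b) (ℤP.≤-reflexive (ℤP.+-identityʳ r))))))

outward⇒∣r∣≤∣r+e∣ : ∀ {r e} → Outward r e → ∣ r ∣ ℕ.≤ ∣ r + e ∣
outward⇒∣r∣≤∣r+e∣ {+ m}      {+ k}      _ = ℕP.m≤m+n m k
outward⇒∣r∣≤∣r+e∣ {+ zero}   { -[1+ k ]} _ = ℕ.z≤n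
outward⇒∣r∣≤∣r+e∣ {+ suc m}  { -[1+ k ]} (inj₁ (_ , ()))
outward⇒∣r∣≤∣r+e∣ {+ suc m}  { -[1+ k ]} (inj₂ (+≤+ () , _))
outward⇒∣r∣≤∣r+e∣ { -[1+ m ]} { -[1+ k ]} _ = ℕ.s≤s (ℕP.≤-trans (ℕP.m≤m+n m k) (ℕP.n≤1+n _))
outward⇒∣r∣≤∣r+e∣ { -[1+ m ]} {+ zero}   _ = subst (λ z → suc m ℕ.≤ ∣ z ∣) (sym (ℤP.+-identityʳ -[1+ m ])) ℕP.≤-refl
outward⇒∣r∣≤∣r+e∣ { -[1+ m ]} {+ suc k}  (inj₁ (() , _))
outward⇒∣r∣≤∣r+e∣ { -[1+ m ]} {+ suc k}  (inj₂ (_ , +≤+ ()))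

outward⇒∣r∣<∣r+e∣ : ∀ {r e} → Outward r e → e ≢ + 0 → ∣ r ∣ ℕ.< ∣ r + e ∣
outward⇒∣r∣<∣r+e∣ {+ m}      {+ zero}   _ e≢0 = ⊥-elim (e≢0 refl)
outward⇒∣r∣<∣r+e∣ {+ m}      {+ suc k}  _ _   = ℕP.m<m+n m {suc k} (ℕ.s≤s ℕ.z≤n)
outward⇒∣r∣<∣r+e∣ {+ zero}   { -[1+ k ]} _ _   = ℕ.s≤s ℕ.z≤n
outward⇒∣r∣<∣r+e∣ {+ suc m}  { -[1+ k ]} (inj₁ (_ , ())) _
outward⇒∣r∣<∣r+e∣ {+ suc m}  { -[1+ k ]} (inj₂ (+≤+ () , _)) _
outward⇒∣r∣<∣r+e∣ { -[1+ m ]} { -[1+ k ]} _ _   = ℕ.s≤s (ℕ.s≤s (ℕP.m≤m+n m k))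
outward⇒∣r∣<∣r+e∣ { -[1+ m ]} {+ zero}   _ e≢0 = ⊥-elim (e≢0 refl)
outward⇒∣r∣<∣r+e∣ { -[1+ m ]} {+ suc k}  (inj₁ (() , _)) _
outward⇒∣r∣<∣r+e∣ { -[1+ m ]} {+ suc k}  (inj₂ (_ , +≤+ ())) _

outward-+-small : ∀ {r a b} → Outward r a → ∣ b ∣ ℕ.< ∣ a ∣ → Outward r (a + b)
outward-+-small (inj₁ (x , y)) ∣b∣<∣a∣ = inj₁ (x , ∣i∣<∣j∣⇒0≤j+i ∣b∣<∣a∣ y)
outward-+-small (inj₂ (x , y)) ∣b∣<∣a∣ = inj₂ (x , ∣i∣<∣j∣⇒j+i≤0 ∣b∣<∣a∣ y)

outward-*⇒1≤ : ∀ {r e} G → r ≢ + 0 → Outward r e → e ≢ + 0 → Outward r (G * e) → G ≢ + 0 → + 1 ≤ G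
outward-*⇒1≤ (+ zero)  _ _ _ _ G≢0 = ⊥-elim (G≢0 refl)
outward-*⇒1≤ (+ suc g) _ _ _ _ _   = +≤+ (ℕ.s≤s ℕ.z≤n)
outward-*⇒1≤ {e = + zero} -[1+ g ] _ _ e≢0 _ _ = ⊥-elim (e≢0 refl)
outward-*⇒1≤ {e = + suc k} -[1+ g ] _ (inj₁ _) _ (inj₁ (_ , ())) _
outward-*⇒1≤ {e = + suc k} -[1+ g ] r≢0 (inj₁ (a , _)) _ (inj₂ (c , _)) _ = ⊥-elim (r≢0 (ℤP.≤-antisym c a))
outward-*⇒1≤ {e = + suc k} -[1+ g ] _ (inj₂ (_ , +≤+ ())) _ _ _
outward-*⇒1≤ {e = -[1+ k ]} -[1+ g ] _ (inj₁ (_ , ())) _ _ _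
outward-*⇒1≤ {e = -[1+ k ]} -[1+ g ] r≢0 (inj₂ (a , _)) _ (inj₁ (c , _)) _ = ⊥-elim (r≢0 (ℤP.≤-antisym a c))
outward-*⇒1≤ {e = -[1+ k ]} -[1+ g ] _ (inj₂ _) _ (inj₂ (_ , +≤+ ())) _

signBit : ℤ → Fin 2
signBit (+ _)    = F.zero
signBit -[1+ _ ] = F.suc F.zero

¬outward⇒outward-neg : ∀ a b D → signBit a ≡ signBit b → ¬ Outward a D → Outward b (- D)
¬outward⇒outward-neg (+ a) (+ b) D _ ¬o =
  inj₁ (+≤+ ℕ.z≤n , ℤP.neg-mono-≤ (ℤP.<⇒≤ (ℤP.≰⇒> λ D≥0 → ¬o (inj₁ (+≤+ ℕ.z≤n , D≥0)))))
¬outward⇒outward-neg -[1+ a ] -[1+ b ] D _ ¬o =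
  inj₂ (-≤+ , ℤP.neg-mono-≤ (ℤP.<⇒≤ (ℤP.≰⇒> λ D≤0 → ¬o (inj₂ (-≤+ , D≤0)))))
¬outward⇒outward-neg (+ a) -[1+ b ] D () ¬o
¬outward⇒outward-neg -[1+ a ] (+ b) D () ¬o

outward-signBit : ∀ a b x → signBit a ≡ signBit b → b ≢ + 0 → Outward b x → Outward a x
outward-signBit (+ m) (+ k) x _ _ (inj₁ (_ , d)) = inj₁ (+≤+ ℕ.z≤n , d)
outward-signBit (+ m) (+ k) x _ b≢0 (inj₂ (c , _)) = ⊥-elim (b≢0 (ℤP.≤-antisym c (+≤+ ℕ.z≤n)))
outward-signBit -[1+ m ] -[1+ k ] x _ _ (inj₂ (_ , d)) = inj₂ (-≤+ , d)
outward-signBit -[1+ m ] -[1+ k ] x _ _ (inj₁ (() , _))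
outward-signBit (+ m) -[1+ k ] x () _ _
outward-signBit -[1+ m ] (+ k) x () _ _

outward-s*m-s*n : ∀ {s} → IsUnit s → ∀ m n → Outward (s * + m) (s * + n)
outward-s*m-s*n (inj₁ refl) m n =
  inj₁ (subst (+ 0 ≤_) (sym (ℤP.*-identityˡ (+ m))) (+≤+ ℕ.z≤n) , subst (+ 0 ≤_) (sym (ℤP.*-identityˡ (+ n))) (+≤+ ℕ.z≤n))
outward-s*m-s*n (inj₂ refl) m n =
  inj₂ (subst (_≤ + 0) (sym (ℤP.-1*i≡-i (+ m))) ℤP.neg-≤-pos , subst (_≤ + 0) (sym (ℤP.-1*i≡-i (+ n))) ℤP.neg-≤-pos)

-- The sign s of r, with s = +1 at r = 0.
SignOf : ℤ → ℤ → Set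
SignOf r s = (+ 0 ≤ r × s ≡ + 1) ⊎ (r ≤ + 0 × s ≡ - + 1)

signOf : ∀ r → Σ ℤ (SignOf r)
signOf r with ℤP.≤-total (+ 0) r
... | inj₁ 0≤r = + 1 , inj₁ (0≤r , refl)
... | inj₂ r≤0 = - + 1 , inj₂ (r≤0 , refl)

SignOf⇒IsUnit : ∀ {r s} → SignOf r s → IsUnit s
SignOf⇒IsUnit (inj₁ (_ , e)) = inj₁ e
SignOf⇒IsUnit (inj₂ (_ , e)) = inj₂ e

outward-s*n : ∀ {r s} n → SignOf r s → Outward r (s * + n)
outward-s*n n (inj₁ (a , refl)) = inj₁ (a , subst (+ 0 ≤_) (sym (ℤP.*-identityˡ (+ n))) (+≤+ ℕ.z≤n))
outward-s*n n (inj₂ (a , refl)) = inj₂ (a , subst (_≤ + 0) (sym (ℤP.-1*i≡-i (+ n))) ℤP.neg-≤-pos)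

outward⇒≡s*∣e∣ : ∀ {r s e} → r ≢ + 0 → SignOf r s → Outward r e → e ≡ s * + ∣ e ∣
outward⇒≡s*∣e∣ _ (inj₁ (_ , refl)) (inj₁ (_ , b)) = trans (sym (ℤP.0≤i⇒+∣i∣≡i b)) (sym (ℤP.*-identityˡ _))
outward⇒≡s*∣e∣ r≢0 (inj₁ (a , refl)) (inj₂ (c , _)) = ⊥-elim (r≢0 (ℤP.≤-antisym c a))
outward⇒≡s*∣e∣ {e = e} _ (inj₂ (_ , refl)) (inj₂ (_ , b)) =
  trans (sym (ℤP.neg-involutive e))
    (trans (cong -_ (trans (sym (ℤP.0≤i⇒+∣i∣≡i (ℤP.neg-mono-≤ b))) (cong +_ (ℤP.∣-i∣≡∣i∣ e)))) (sym (ℤP.-1*i≡-i _)))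
outward⇒≡s*∣e∣ r≢0 (inj₂ (a , refl)) (inj₁ (c , _)) = ⊥-elim (r≢0 (ℤP.≤-antisym a c))

¬outward⇒≡-s*∣D∣ : ∀ {r s D} → SignOf r s → ¬ Outward r D → D ≡ - (s * + ∣ D ∣) × 1 ℕ.≤ ∣ D ∣
¬outward⇒≡-s*∣D∣ {D = D} (inj₁ (a , refl)) ¬o =
  trans (sym (ℤP.neg-involutive D))
    (cong -_ (trans (sym (ℤP.0≤i⇒+∣i∣≡i (ℤP.neg-mono-≤ (ℤP.<⇒≤ D<0))))
             (trans (cong +_ (ℤP.∣-i∣≡∣i∣ D)) (sym (ℤP.*-identityˡ _))))) ,
  i≢0⇒1≤∣i∣ λ D≡0 → ℤP.<-irrefl D≡0 D<0
  where
  D<0 : D < + 0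
  D<0 = ℤP.≰⇒> λ D≥0 → ¬o (inj₁ (a , D≥0))
¬outward⇒≡-s*∣D∣ {D = D} (inj₂ (a , refl)) ¬o =
  trans (sym (ℤP.0≤i⇒+∣i∣≡i (ℤP.<⇒≤ D>0))) (trans (sym (ℤP.neg-involutive _)) (cong -_ (sym (ℤP.-1*i≡-i _)))) ,
  i≢0⇒1≤∣i∣ λ D≡0 → ℤP.<-irrefl (sym D≡0) D>0
  where
  D>0 : + 0 < D
  D>0 = ℤP.≰⇒> λ D≤0 → ¬o (inj₂ (a , D≤0))


-- Instructions acting on a large register

opSlope : Op → ℤ
opSlope r:=r+r     = + 2
opSlope (r:=r+c c) = + 1
opSlope r:=r-r     = + 0
opSlope (r:=r-c c) = + 1
opSlope (r:=c-r c) = - + 1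
opSlope (r:=c c)   = + 0

opOffset : Op → ℤ
opOffset r:=r+r     = + 0
opOffset (r:=r+c c) = c
opOffset r:=r-r     = + 0
opOffset (r:=r-c c) = - c
opOffset (r:=c-r c) = c
opOffset (r:=c c)   = c

applyOp≡affine : ∀ o r → applyOp o r ≡ opSlope o * r + opOffset o
applyOp≡affine r:=r+r     r = solve-∀′ r
  where solve-∀′ : ∀ r → r + r ≡ + 2 * r + + 0
        solve-∀′ = solve-∀
applyOp≡affine (r:=r+c c) r = cong (_+ c) (sym (ℤP.*-identityˡ r))
applyOp≡affine r:=r-r     r = ℤP.+-inverseʳ r
applyOp≡affine (r:=r-c c) r = cong (_- c) (sym (ℤP.*-identityˡ r))
applyOp≡affine (r:=c-r c) r = trans (ℤP.+-comm c (- r)) (cong (_+ c) (sym (ℤP.-1*i≡-i r)))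
applyOp≡affine (r:=c c)   r = sym (ℤP.+-identityˡ c)

applyOp-+ : ∀ o r δ → applyOp o (r + δ) ≡ applyOp o r + opSlope o * δ
applyOp-+ o r δ = begin
  applyOp o (r + δ)                            ≡⟨ applyOp≡affine o (r + δ) ⟩
  opSlope o * (r + δ) + opOffset o             ≡⟨ regroup (opSlope o) r δ (opOffset o) ⟩
  (opSlope o * r + opOffset o) + opSlope o * δ ≡⟨ cong (_+ opSlope o * δ) (sym (applyOp≡affine o r)) ⟩
  applyOp o r + opSlope o * δ                  ∎
  where
  open ≡-Reasoning
  regroup : ∀ a r δ c → a * (r + δ) + c ≡ (a * r + c) + a * δ
  regroup = solve-∀

∣opSlope∣≤2 : ∀ o → ∣ opSlope o ∣ ℕ.≤ 2
∣opSlope∣≤2 r:=r+r     = ℕP.≤-refl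
∣opSlope∣≤2 (r:=r+c _) = ℕ.s≤s ℕ.z≤n
∣opSlope∣≤2 r:=r-r     = ℕ.z≤n
∣opSlope∣≤2 (r:=r-c _) = ℕ.s≤s ℕ.z≤n
∣opSlope∣≤2 (r:=c-r _) = ℕ.s≤s ℕ.z≤n
∣opSlope∣≤2 (r:=c _)   = ℕ.z≤n

slope : ∀ {n} → Instr n → ℤ
slope (assign o _) = opSlope o
slope _            = + 1

constantOf : ∀ {n} → Instr n → ℕ
constantOf (assign o _)          = ∣ opOffset o ∣
constantOf (test _ reg _ _)     = 0
constantOf (test _ (con c) _ _) = ∣ c ∣
constantOf (goto _)              = 0
constantOf write                 = 0

holdsAbove holdsBelow holdsAt : Rel → Bool
holdsAbove Rel.lt = false
holdsAbove Rel.eq = false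
holdsAbove Rel.gt = true
holdsAbove Rel.ne = true
holdsAbove Rel.le = false
holdsAbove Rel.ge = true
holdsBelow Rel.lt = true
holdsBelow Rel.eq = false
holdsBelow Rel.gt = false
holdsBelow Rel.ne = true
holdsBelow Rel.le = true
holdsBelow Rel.ge = false
holdsAt Rel.lt = false
holdsAt Rel.eq = true
holdsAt Rel.gt = false
holdsAt Rel.ne = false
holdsAt Rel.le = true
holdsAt Rel.ge = true

holds-above : ∀ ρ {a b} → b < a → holds ρ a b ≡ holdsAbove ρ
holds-above Rel.lt {a} {b} b<a = isYes-false (a ℤP.<? b) (ℤP.<-asym b<a)
holds-above Rel.eq {a} {b} b<a = isYes-false (a ℤP.≟ b) λ a≡b → ℤP.<-irrefl (sym a≡b) b<a
holds-above Rel.gt {a} {b} b<a = isYes-true (b ℤP.<? a) b<a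
holds-above Rel.ne {a} {b} b<a = cong not (isYes-false (a ℤP.≟ b) λ a≡b → ℤP.<-irrefl (sym a≡b) b<a)
holds-above Rel.le {a} {b} b<a = isYes-false (a ℤP.≤? b) (ℤP.<⇒≱ b<a)
holds-above Rel.ge {a} {b} b<a = isYes-true (b ℤP.≤? a) (ℤP.<⇒≤ b<a)

holds-below : ∀ ρ {a b} → a < b → holds ρ a b ≡ holdsBelow ρ
holds-below Rel.lt {a} {b} a<b = isYes-true (a ℤP.<? b) a<b
holds-below Rel.eq {a} {b} a<b = isYes-false (a ℤP.≟ b) λ a≡b → ℤP.<-irrefl a≡b a<b
holds-below Rel.gt {a} {b} a<b = isYes-false (b ℤP.<? a) (ℤP.<-asym a<b)
holds-below Rel.ne {a} {b} a<b = cong not (isYes-false (a ℤP.≟ b) λ a≡b → ℤP.<-irrefl a≡b a<b)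
holds-below Rel.le {a} {b} a<b = isYes-true (a ℤP.≤? b) (ℤP.<⇒≤ a<b)
holds-below Rel.ge {a} {b} a<b = isYes-false (b ℤP.≤? a) (ℤP.<⇒≱ a<b)

holds-refl : ∀ ρ a → holds ρ a a ≡ holdsAt ρ
holds-refl Rel.lt a = isYes-false (a ℤP.<? a) (ℤP.<-irrefl refl)
holds-refl Rel.eq a = isYes-true (a ℤP.≟ a) refl
holds-refl Rel.gt a = isYes-false (a ℤP.<? a) (ℤP.<-irrefl refl)
holds-refl Rel.ne a = cong not (isYes-true (a ℤP.≟ a) refl)
holds-refl Rel.le a = isYes-true (a ℤP.≤? a) ℤP.≤-refl
holds-refl Rel.ge a = isYes-true (a ℤP.≤? a) ℤP.≤-refl

holds-outward : ∀ ρ o {r δ M} → (∀ c → o ≡ con c → ∣ c ∣ ℕ.≤ M) → M ℕ.< ∣ r ∣ → Outward r δ →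
                holds ρ (r + δ) (operand o (r + δ)) ≡ holds ρ r (operand o r)
holds-outward ρ reg {r} {δ} _ _ _ = trans (holds-refl ρ (r + δ)) (sym (holds-refl ρ r))
holds-outward ρ (con c) {r} {δ} ∣c∣≤M M<∣r∣ (inj₁ (0≤r , 0≤δ)) =
  trans (holds-above ρ (ℤP.<-≤-trans c<r (ℤP.≤-trans (ℤP.≤-reflexive (sym (ℤP.+-identityʳ r))) (ℤP.+-monoʳ-≤ r 0≤δ))))
        (sym (holds-above ρ c<r))
  where c<r = ∣i∣<∣j∣⇒i<j (ℕP.≤-<-trans (∣c∣≤M c refl) M<∣r∣) 0≤r
holds-outward ρ (con c) {r} {δ} ∣c∣≤M M<∣r∣ (inj₂ (r≤0 , δ≤0)) =
  trans (holds-below ρ (ℤP.≤-<-trans (ℤP.≤-trans (ℤP.+-monoʳ-≤ r δ≤0) (ℤP.≤-reflexive (ℤP.+-identityʳ r))) r<c))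
        (sym (holds-below ρ r<c))
  where r<c = ∣i∣<∣j∣⇒j<i (ℕP.≤-<-trans (∣c∣≤M c refl) M<∣r∣) r≤0

outward-applyOp : ∀ o {r δ} → ∣ opOffset o ∣ ℕ.< ∣ r ∣ → Outward r δ → Outward (applyOp o r) (opSlope o * δ)
outward-applyOp r:=r+r {r} {δ} _ o =
  subst (Outward (r + r)) (double δ) (Data.Sum.map (λ (a , b) → ℤP.+-mono-≤ a a , ℤP.+-mono-≤ b b)
                                                   (λ (a , b) → ℤP.+-mono-≤ a a , ℤP.+-mono-≤ b b) o)
  where double : ∀ δ → δ + δ ≡ + 2 * δ
        double = solve-∀
outward-applyOp (r:=r+c c) lt (inj₁ (a , b)) = outward-1* (inj₁ (∣i∣<∣j∣⇒0≤j+i lt a , b))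
outward-applyOp (r:=r+c c) lt (inj₂ (a , b)) = outward-1* (inj₂ (∣i∣<∣j∣⇒j+i≤0 lt a , b))
outward-applyOp r:=r-r     {r} _ _ = outward-0 (r - r)
outward-applyOp (r:=r-c c) lt (inj₁ (a , b)) = outward-1* (inj₁ (∣i∣<∣j∣⇒0≤j+i lt a , b))
outward-applyOp (r:=r-c c) lt (inj₂ (a , b)) = outward-1* (inj₂ (∣i∣<∣j∣⇒j+i≤0 lt a , b))
outward-applyOp (r:=c-r c) {r} {δ} lt o = subst (Outward (c - r)) (sym (ℤP.-1*i≡-i δ)) (flip o)
  where
  ∣-c∣<∣r∣ : ∣ - c ∣ ℕ.< ∣ r ∣
  ∣-c∣<∣r∣ = subst (ℕ._< ∣ r ∣) (sym (ℤP.∣-i∣≡∣i∣ c)) lt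
  negate : - (r + - c) ≡ c - r
  negate = solve-∀′ r c
    where solve-∀′ : ∀ r c → - (r + - c) ≡ c - r
          solve-∀′ = solve-∀
  flip : Outward r δ → Outward (c - r) (- δ)
  flip (inj₁ (a , b)) = inj₂ (subst (_≤ + 0) negate (ℤP.neg-mono-≤ (∣i∣<∣j∣⇒0≤j+i ∣-c∣<∣r∣ a)) , ℤP.neg-mono-≤ b)
  flip (inj₂ (a , b)) = inj₁ (subst (+ 0 ≤_) negate (ℤP.neg-mono-≤ (∣i∣<∣j∣⇒j+i≤0 ∣-c∣<∣r∣ a)) , ℤP.neg-mono-≤ b)
outward-applyOp (r:=c c)   _ _ = outward-0 c

displace : ∀ {A : Set} → A × ℤ → ℤ → A × ℤ
displace c δ = proj₁ c , proj₂ c + δ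

displace-displace : ∀ {A : Set} (c : A × ℤ) a b → displace (displace c a) b ≡ displace c (a + b)
displace-displace c a b = cong (proj₁ c ,_) (ℤP.+-assoc (proj₂ c) a b)

displace-0 : ∀ {A : Set} (c : A × ℤ) → displace c (+ 0) ≡ c
displace-0 c = cong (proj₁ c ,_) (ℤP.+-identityʳ (proj₂ c))

execute : ∀ {n} → Instr n → Fin n → ℤ → Fin n × ℤ
execute (assign o l′)     l r = l′ , applyOp o r
execute (test ρ o l₁ l₂) l r = (if holds ρ r (operand o r) then l₁ else l₂) , r
execute (goto l′)         l r = l′ , r
execute write             l r = l , r

step≡execute : ∀ P l r → step P (l , r) ≡ execute (code P l) l r
step≡execute P l r with code P l
... | assign o l′     = refl
... | test ρ o l₁ l₂ = refl
... | goto l′         = refl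
... | write           = refl

displace-1* : ∀ {A : Set} (c : A) r δ → (c , r + δ) ≡ displace (c , r) (+ 1 * δ)
displace-1* c r δ = cong (λ z → c , r + z) (sym (ℤP.*-identityˡ δ))

-- Above the constants of the program, an instruction cannot tell r from r + δ
-- for outward δ: it acts on the displacement by multiplication with its slope.
execute-outward : ∀ {n} (i : Instr n) l r δ {M} → constantOf i ℕ.≤ M → M ℕ.< ∣ r ∣ → Outward r δ →
                  execute i l (r + δ) ≡ displace (execute i l r) (slope i * δ) ×
                  Outward (proj₂ (execute i l r)) (slope i * δ)
execute-outward (assign o l′) l r δ ∣c∣≤M M<∣r∣ out =
  cong (l′ ,_) (applyOp-+ o r δ) , outward-applyOp o (ℕP.≤-<-trans ∣c∣≤M M<∣r∣) out
execute-outward (test ρ o l₁ l₂) l r δ ∣c∣≤M M<∣r∣ out =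
  trans (cong (λ b → (if b then l₁ else l₂) , r + δ) (holds-outward ρ o bound M<∣r∣ out)) (displace-1* _ r δ) ,
  outward-1* out
  where bound : ∀ c → o ≡ con c → ∣ c ∣ ℕ.≤ _
        bound c refl = ∣c∣≤M
execute-outward (goto l′) l r δ _ _ out = displace-1* l′ r δ , outward-1* out
execute-outward write     l r δ _ _ out = displace-1* l r δ , outward-1* out

∣v-1*w∣≤ : ∀ v w M → ∣ v - + 1 * w ∣ ℕ.≤ (∣ v - w ∣ ℕ.+ ∣ v - w ∣) ℕ.+ M
∣v-1*w∣≤ v w M rewrite ℤP.*-identityˡ w = ℕP.≤-trans (ℕP.m≤m+n ∣ v - w ∣ ∣ v - w ∣) (ℕP.m≤m+n _ M)

execute-drift : ∀ {n} (i : Instr n) l v w M → constantOf i ℕ.≤ M →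
                ∣ proj₂ (execute i l v) - slope i * w ∣ ℕ.≤ (∣ v - w ∣ ℕ.+ ∣ v - w ∣) ℕ.+ M
execute-drift (assign o l′) l v w M ∣c∣≤M = begin
  ∣ applyOp o v - opSlope o * w ∣                 ≡⟨ cong (λ z → ∣ z - opSlope o * w ∣) (applyOp≡affine o v) ⟩
  ∣ opSlope o * v + opOffset o - opSlope o * w ∣ ≡⟨ cong ∣_∣ (regroup (opSlope o) v w (opOffset o)) ⟩
  ∣ opSlope o * (v - w) + opOffset o ∣           ≤⟨ ℤP.∣i+j∣≤∣i∣+∣j∣ (opSlope o * (v - w)) (opOffset o) ⟩
  ∣ opSlope o * (v - w) ∣ ℕ.+ ∣ opOffset o ∣    ≤⟨ ℕP.+-mono-≤ ∣a*[v-w]∣≤ ∣c∣≤M ⟩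
  (∣ v - w ∣ ℕ.+ ∣ v - w ∣) ℕ.+ M                ∎
  where
  open ℕP.≤-Reasoning
  regroup : ∀ a v w c → a * v + c - a * w ≡ a * (v - w) + c
  regroup = solve-∀
  ∣a*[v-w]∣≤ : ∣ opSlope o * (v - w) ∣ ℕ.≤ ∣ v - w ∣ ℕ.+ ∣ v - w ∣
  ∣a*[v-w]∣≤ = ℕP.≤-trans (ℕP.≤-reflexive (ℤP.∣i*j∣≡∣i∣*∣j∣ (opSlope o) (v - w)))
                 (ℕP.≤-trans (ℕP.*-monoˡ-≤ ∣ v - w ∣ (∣opSlope∣≤2 o))
                   (ℕP.≤-reflexive (cong (∣ v - w ∣ ℕ.+_) (ℕP.+-identityʳ ∣ v - w ∣))))
execute-drift (test ρ o l₁ l₂) l v w M _ = ∣v-1*w∣≤ v w M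
execute-drift (goto l′)         l v w M _ = ∣v-1*w∣≤ v w M
execute-drift write             l v w M _ = ∣v-1*w∣≤ v w M

SignedPow2 : ℤ → Set
SignedPow2 z = z ≡ + 0 ⊎ Σ ℕ (λ e → z ≡ + (2 ^ e) ⊎ z ≡ - + (2 ^ e))

SignedPow2-1* : ∀ {z} → SignedPow2 z → SignedPow2 (+ 1 * z)
SignedPow2-1* {z} = subst SignedPow2 (sym (ℤP.*-identityˡ z))

SignedPow2-neg : ∀ {z} → SignedPow2 z → SignedPow2 (- z)
SignedPow2-neg (inj₁ refl)             = inj₁ refl
SignedPow2-neg (inj₂ (e , inj₁ refl)) = inj₂ (e , inj₂ refl)
SignedPow2-neg (inj₂ (e , inj₂ refl)) = inj₂ (e , inj₁ (ℤP.neg-involutive _))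

opSlope-pow2 : ∀ o z → SignedPow2 z → SignedPow2 (opSlope o * z)
opSlope-pow2 r:=r+r z (inj₁ refl) = inj₁ refl
opSlope-pow2 r:=r+r z (inj₂ (e , inj₁ refl)) = inj₂ (suc e , inj₁ (sym (ℤP.pos-* 2 (2 ^ e))))
opSlope-pow2 r:=r+r z (inj₂ (e , inj₂ refl)) =
  inj₂ (suc e , inj₂ (trans (sym (ℤP.neg-distribʳ-* (+ 2) (+ (2 ^ e)))) (cong -_ (sym (ℤP.pos-* 2 (2 ^ e))))))
opSlope-pow2 (r:=r+c c) z p = SignedPow2-1* p
opSlope-pow2 r:=r-r     z p = inj₁ refl
opSlope-pow2 (r:=r-c c) z p = SignedPow2-1* p
opSlope-pow2 (r:=c-r c) z p = subst SignedPow2 (sym (ℤP.-1*i≡-i z)) (SignedPow2-neg p)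
opSlope-pow2 (r:=c c)   z p = inj₁ refl

slope-pow2 : ∀ {n} (i : Instr n) z → SignedPow2 z → SignedPow2 (slope i * z)
slope-pow2 (assign o _)     z p = opSlope-pow2 o z p
slope-pow2 (test _ _ _ _) z p = SignedPow2-1* p
slope-pow2 (goto _)         z p = SignedPow2-1* p
slope-pow2 write            z p = SignedPow2-1* p


maxOver : (n : ℕ) → (Fin n → ℕ) → ℕ
maxOver zero    f = 0
maxOver (suc n) f = f F.zero ⊔ maxOver n (λ i → f (F.suc i))

≤-maxOver : ∀ n f i → f i ℕ.≤ maxOver n f
≤-maxOver (suc n) f F.zero    = ℕP.m≤m⊔n _ _
≤-maxOver (suc n) f (F.suc i) = ℕP.≤-trans (≤-maxOver n (λ j → f (F.suc j)) i) (ℕP.m≤n⊔m _ _)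

searchFirst : ∀ {Q R : ℕ → Set} → (∀ s → Q s ⊎ R s) → ∀ p →
              (∀ s → s ℕ.< p → Q s) ⊎ Σ ℕ (λ s → s ℕ.< p × (∀ s′ → s′ ℕ.< s → Q s′) × R s)
searchFirst d zero = inj₁ λ s ()
searchFirst d (suc p) with searchFirst d p
... | inj₂ (s , s<p , before , r) = inj₂ (s , ℕP.m≤n⇒m≤1+n s<p , before , r)
... | inj₁ below with d p
...   | inj₂ r = inj₂ (p , ℕP.≤-refl , below , r)
...   | inj₁ q = inj₁ λ s s<1+p → extend s (ℕP.m≤n⇒m<n∨m≡n (ℕP.≤-pred s<1+p))
  where extend : ∀ s → s ℕ.< p ⊎ s ≡ p → _
        extend s (inj₁ s<p)  = below s s<p
        extend s (inj₂ refl) = q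

encodeℤ : (W : ℕ) → ℤ → Fin (suc (W ℕ.+ W))
encodeℤ W r = F.fromℕ< (ℕ.s≤s (ℕP.m⊓n≤m (W ℕ.+ W) ∣ r + + W ∣))

decodeℤ : (W : ℕ) → Fin (suc (W ℕ.+ W)) → ℤ
decodeℤ W i = + toℕ i - + W

decode-encode : ∀ W r → ∣ r ∣ ℕ.≤ W → decodeℤ W (encodeℤ W r) ≡ r
decode-encode W r ∣r∣≤W = begin
  + toℕ (encodeℤ W r) - + W         ≡⟨ cong (λ n → + n - + W) (FP.toℕ-fromℕ< _) ⟩
  + ((W ℕ.+ W) ℕ.⊓ ∣ r + + W ∣) - + W ≡⟨ cong (λ n → + n - + W) (ℕP.m≥n⇒m⊓n≡n ∣r+W∣≤2W) ⟩
  + ∣ r + + W ∣ - + W                ≡⟨ cong (_- + W) (ℤP.0≤i⇒+∣i∣≡i 0≤r+W) ⟩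
  r + + W - + W                      ≡⟨ cancel r (+ W) ⟩
  r                                  ∎
  where
  open ≡-Reasoning
  cancel : ∀ r w → r + w - w ≡ r
  cancel = solve-∀
  0≤r+W : + 0 ≤ r + + W
  0≤r+W = ℤP.≤-trans (ℤP.≤-reflexive (sym (ℤP.+-inverseʳ (+ W))))
            (ℤP.≤-trans (ℤP.+-monoʳ-≤ (+ W) (ℤP.neg-mono-≤ (+≤+ ∣r∣≤W)))
              (ℤP.≤-trans (ℤP.+-monoʳ-≤ (+ W) (-∣i∣≤i r)) (ℤP.≤-reflexive (ℤP.+-comm (+ W) r))))
  ∣r+W∣≤2W : ∣ r + + W ∣ ℕ.≤ W ℕ.+ W
  ∣r+W∣≤2W = ℕP.≤-trans (ℤP.∣i+j∣≤∣i∣+∣j∣ r (+ W)) (ℕP.+-monoˡ-≤ W ∣r∣≤W)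

bits : ℕ → ℕ
bits n = suc ⌊log₂ n ⌋

n<2^bits : ∀ n → n ℕ.< 2 ^ bits n
n<2^bits n = ℕP.≰⇒> λ 2^bits≤n →
  ℕP.<-irrefl refl (subst (ℕ._≤ ⌊log₂ n ⌋) (⌊log₂[2^n]⌋≡n (bits n)) (⌊log₂⌋-mono-≤ 2^bits≤n))

2^⌊log₂n⌋≤n : ∀ n → 1 ℕ.≤ n → 2 ^ ⌊log₂ n ⌋ ℕ.≤ n
2^⌊log₂n⌋≤n n = bounded (suc n) n ℕP.≤-refl
  where
  bounded : ∀ fuel n → n ℕ.< fuel → 1 ℕ.≤ n → 2 ^ ⌊log₂ n ⌋ ℕ.≤ n
  bounded (suc f) (suc zero) _ _ = subst (λ k → 2 ^ k ℕ.≤ 1) (sym (⌊log₂[2^n]⌋≡n 0)) ℕP.≤-refl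
  bounded (suc f) n@(suc (suc m)) n<f _ =
    subst (λ k → 2 ^ k ℕ.≤ n) (sym log-half) (ℕP.≤-trans (ℕP.*-monoʳ-≤ 2 ih) 2*half≤n)
    where
    1≤log : 1 ℕ.≤ ⌊log₂ n ⌋
    1≤log = subst (ℕ._≤ ⌊log₂ n ⌋) (⌊log₂[2^n]⌋≡n 1) (⌊log₂⌋-mono-≤ {2} {n} (ℕ.s≤s (ℕ.s≤s ℕ.z≤n)))
    log-half : ⌊log₂ n ⌋ ≡ suc ⌊log₂ ⌊ n /2⌋ ⌋
    log-half = trans (sym (ℕP.m+[n∸m]≡n 1≤log)) (cong suc (sym (⌊log₂⌊n/2⌋⌋≡⌊log₂n⌋∸1 n)))
    ih : 2 ^ ⌊log₂ ⌊ n /2⌋ ⌋ ℕ.≤ ⌊ n /2⌋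
    ih = bounded f ⌊ n /2⌋ (ℕP.<-≤-trans (ℕP.⌊n/2⌋<n (suc m)) (ℕP.≤-pred n<f)) (ℕ.s≤s ℕ.z≤n)
    2*half≤n : 2 ℕ.* ⌊ n /2⌋ ℕ.≤ n
    2*half≤n = subst (2 ℕ.* ⌊ n /2⌋ ℕ.≤_) (ℕP.⌊n/2⌋+⌈n/2⌉≡n n)
                 (subst (ℕ._≤ ⌊ n /2⌋ ℕ.+ ⌈ n /2⌉) (cong (⌊ n /2⌋ ℕ.+_) (sym (ℕP.+-identityʳ _)))
                   (ℕP.+-monoʳ-≤ ⌊ n /2⌋ (ℕP.⌊n/2⌋≤⌈n/2⌉ n)))

2^bits≤2*n : ∀ n → 1 ℕ.≤ n → 2 ^ bits n ℕ.≤ 2 ℕ.* n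
2^bits≤2*n n 1≤n = ℕP.*-monoʳ-≤ 2 (2^⌊log₂n⌋≤n n 1≤n)

a+a≤u≤a+b⇒u≤b+b : ∀ a u b → a ℕ.+ a ℕ.≤ u → u ℕ.≤ a ℕ.+ b → u ℕ.≤ b ℕ.+ b
a+a≤u≤a+b⇒u≤b+b a u b a+a≤u u≤a+b = ℕP.≤-trans u≤a+b (ℕP.+-monoˡ-≤ b (ℕP.+-cancelˡ-≤ a a b (ℕP.≤-trans a+a≤u u≤a+b)))

e∸d≤d*[1+t∸p]⇒e≤d*[1+t] : ∀ d e t p → 1 ℕ.≤ p → p ℕ.≤ t → d ℕ.≤ e → e ∸ d ℕ.≤ d ℕ.* suc (t ∸ p) → e ℕ.≤ d ℕ.* suc t
e∸d≤d*[1+t∸p]⇒e≤d*[1+t] d e t p 1≤p p≤t d≤e ih =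
  ℕP.≤-trans (ℕP.≤-reflexive (sym (ℕP.m+[n∸m]≡n d≤e)))
  (ℕP.≤-trans (ℕP.+-monoʳ-≤ d ih)
  (ℕP.≤-trans (ℕP.≤-reflexive (sym (ℕP.*-suc d (suc (t ∸ p)))))
  (ℕP.*-monoʳ-≤ d (ℕ.s≤s (ℕP.∸-monoʳ-< 1≤p p≤t)))))

t≤p*[1+e∸d]+T⇒t+p≤p*[1+e]+T : ∀ p e d t T → 1 ℕ.≤ d → d ℕ.≤ e → t ℕ.≤ p ℕ.* suc (e ∸ d) ℕ.+ T → t ℕ.+ p ℕ.≤ p ℕ.* suc e ℕ.+ T
t≤p*[1+e∸d]+T⇒t+p≤p*[1+e]+T p e d t T 1≤d d≤e h =
  ℕP.≤-trans (ℕP.+-monoˡ-≤ p h)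
  (ℕP.≤-trans (ℕP.≤-reflexive (regroup p (e ∸ d) T))
  (ℕP.+-monoˡ-≤ T (ℕP.*-monoʳ-≤ p (ℕ.s≤s (ℕP.∸-monoʳ-< 1≤d d≤e)))))
  where
  regroup : ∀ p k T → p ℕ.* suc k ℕ.+ T ℕ.+ p ≡ p ℕ.* suc (suc k) ℕ.+ T
  regroup = ℕSolver.solve-∀

t≤T⇒t+p≤p*[1+e]+T : ∀ p e t T → t ℕ.≤ T → t ℕ.+ p ℕ.≤ p ℕ.* suc e ℕ.+ T
t≤T⇒t+p≤p*[1+e]+T p e t T h = ℕP.≤-trans (ℕP.+-mono-≤ h (ℕP.m≤m*n p (suc e))) (ℕP.≤-reflexive (ℕP.+-comm T (p ℕ.* suc e)))

i+[p*[1+q*u]+T]≤K*u : ∀ i p q u T → 1 ℕ.≤ u → i ℕ.+ (p ℕ.* suc (q ℕ.* u) ℕ.+ T) ℕ.≤ (i ℕ.+ (p ℕ.+ (p ℕ.* q ℕ.+ T))) ℕ.* u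
i+[p*[1+q*u]+T]≤K*u i p q u@(suc _) T _ =
  ℕP.≤-trans (ℕP.≤-reflexive (expand i p q u T))
  (ℕP.≤-trans (ℕP.+-mono-≤ (ℕP.m≤m*n i u) (ℕP.+-mono-≤ (ℕP.m≤m*n p u) (ℕP.+-monoʳ-≤ (p ℕ.* q ℕ.* u) (ℕP.m≤m*n T u))))
  (ℕP.≤-reflexive (factor i p q u T)))
  where
  expand : ∀ i p q u T → i ℕ.+ (p ℕ.* suc (q ℕ.* u) ℕ.+ T) ≡ i ℕ.+ (p ℕ.+ (p ℕ.* q ℕ.* u ℕ.+ T))
  expand = ℕSolver.solve-∀
  factor : ∀ i p q u T → i ℕ.* u ℕ.+ (p ℕ.* u ℕ.+ (p ℕ.* q ℕ.* u ℕ.+ T ℕ.* u)) ≡ (i ℕ.+ (p ℕ.+ (p ℕ.* q ℕ.+ T))) ℕ.* u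
  factor = ℕSolver.solve-∀

≡-mod⇒≡+* : ∀ u v H → .{{_ : ℕ.NonZero H}} → u ℕ.≤ v → u % H ≡ v % H → v ≡ u ℕ.+ (v / H ∸ u / H) ℕ.* H
≡-mod⇒≡+* u v H u≤v u%H≡v%H = trans (sym (ℕP.m+[n∸m]≡n u≤v)) (cong (u ℕ.+_) difference)
  where
  difference : v ∸ u ≡ (v / H ∸ u / H) ℕ.* H
  difference = begin
    v ∸ u                                                      ≡⟨ cong₂ _∸_ (DM.m≡m%n+[m/n]*n v H) (DM.m≡m%n+[m/n]*n u H) ⟩
    (v % H ℕ.+ (v / H) ℕ.* H) ∸ (u % H ℕ.+ (u / H) ℕ.* H) ≡⟨ cong (λ z → (z ℕ.+ (v / H) ℕ.* H) ∸ (u % H ℕ.+ (u / H) ℕ.* H)) (sym u%H≡v%H) ⟩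
    (u % H ℕ.+ (v / H) ℕ.* H) ∸ (u % H ℕ.+ (u / H) ℕ.* H) ≡⟨ ℕP.[m+n]∸[m+o]≡n∸o (u % H) ((v / H) ℕ.* H) ((u / H) ℕ.* H) ⟩
    (v / H) ℕ.* H ∸ (u / H) ℕ.* H                             ≡⟨ sym (ℕP.*-distribʳ-∸ H (v / H) (u / H)) ⟩
    (v / H ∸ u / H) ℕ.* H                                      ∎
    where open ≡-Reasoning

[m+n%k]%k≡[m+n]%k : ∀ m n k → .{{_ : ℕ.NonZero k}} → (m ℕ.+ n % k) % k ≡ (m ℕ.+ n) % k
[m+n%k]%k≡[m+n]%k m n k =
  trans (DM.%-distribˡ-+ m (n % k) k) (trans (cong (λ z → (m % k ℕ.+ z) % k) (DM.m%n%n≡m%n n k)) (sym (DM.%-distribˡ-+ m n k)))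

n≡n%2+[n/2]*2 : ∀ n → n ≡ n % 2 ℕ.+ (n / 2) ℕ.* 2
n≡n%2+[n/2]*2 n = DM.m≡m%n+[m/n]*n n 2

n<2k⇒n/2<k : ∀ n k → n ℕ.< 2 ℕ.* k → n / 2 ℕ.< k
n<2k⇒n/2<k n k n<2k = ℕP.≰⇒> λ k≤n/2 → ℕP.<-irrefl refl (ℕP.<-≤-trans n<2k
  (ℕP.≤-trans (ℕP.*-monoʳ-≤ 2 k≤n/2) (ℕP.≤-trans (ℕP.≤-reflexive (ℕP.*-comm 2 (n / 2)))
    (ℕP.≤-trans (ℕP.m≤n+m _ (n % 2)) (ℕP.≤-reflexive (sym (n≡n%2+[n/2]*2 n)))))))

toℕ-mod : ∀ n k .{{_ : ℕ.NonZero k}} → toℕ (n mod k) ≡ n % k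
toℕ-mod n k = FP.toℕ-fromℕ< (DM.m%n<n n k)

∧-elim : ∀ {a b} → a ∧ b ≡ true → a ≡ true × b ≡ true
∧-elim {true} {true} _ = refl , refl

∧-intro : ∀ {a b} → a ≡ true → b ≡ true → a ∧ b ≡ true
∧-intro refl refl = refl

∨-elim : ∀ {a b} → a ∨ b ≡ true → a ≡ true ⊎ b ≡ true
∨-elim {true}  _ = inj₁ refl
∨-elim {false} e = inj₂ e

∨-introˡ : ∀ {a b} → a ≡ true → a ∨ b ≡ true
∨-introˡ refl = refl

∨-introʳ : ∀ {a b} → b ≡ true → a ∨ b ≡ true
∨-introʳ {true}  _ = refl
∨-introʳ {false} e = e

anyBelow : ℕ → (ℕ → Bool) → Bool
anyBelow zero    f = false
anyBelow (suc n) f = f n ∨ anyBelow n f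

anyBelow-elim : ∀ n f → anyBelow n f ≡ true → Σ ℕ λ k → k ℕ.< n × f k ≡ true
anyBelow-elim (suc n) f e with ∨-elim {f n} e
... | inj₁ fn = n , ℕP.≤-refl , fn
... | inj₂ rest = let (k , k<n , fk) = anyBelow-elim n f rest in k , ℕP.m≤n⇒m≤1+n k<n , fk

anyBelow-intro : ∀ n f k → k ℕ.< n → f k ≡ true → anyBelow n f ≡ true
anyBelow-intro (suc n) f k k<1+n fk with ℕP.m≤n⇒m<n∨m≡n (ℕP.≤-pred k<1+n)
... | inj₁ k<n  = ∨-introʳ {f n} (anyBelow-intro n f k k<n fk)
... | inj₂ refl = ∨-introˡ fk

-- Binary automata

Letter : Set
Letter = Sym 2 × Sym 2

Recognisable : (ℤ → ℤ → Bool) → Set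
Recognisable g = Σ (DFA Letter) λ A → ∀ m x y → ∣ x ∣ ℕ.< 2 ^ m → ∣ y ∣ ℕ.< 2 ^ m → accepts A (conv 0 m x y) ≡ g x y

Recognisable-cong : ∀ {g g′} → (∀ x y → g x y ≡ g′ x y) → Recognisable g → Recognisable g′
Recognisable-cong g≗g′ (A , ok) = A , λ m x y ∣x∣< ∣y∣< → trans (ok m x y ∣x∣< ∣y∣<) (g≗g′ x y)

runDFA-++ : ∀ {Σ₀} (A : DFA Σ₀) q xs ys → runDFA A q (xs ++ ys) ≡ runDFA A (runDFA A q xs) ys
runDFA-++ A q []       ys = refl
runDFA-++ A q (x ∷ xs) ys = runDFA-++ A (DFA.δ A q x) xs ys

productDFA : DFA Letter → DFA Letter → (Bool → Bool → Bool) → DFA Letter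
productDFA A B op = record
  { states = DFA.states A ℕ.* DFA.states B
  ; δ      = λ k a → combine (DFA.δ A (proj₁ (split k)) a) (DFA.δ B (proj₂ (split k)) a)
  ; q₀     = combine (DFA.q₀ A) (DFA.q₀ B)
  ; final  = λ k → op (DFA.final A (proj₁ (split k))) (DFA.final B (proj₂ (split k)))
  }
  where split = remQuot {DFA.states A} (DFA.states B)

runDFA-product : ∀ A B op i j w →
                 runDFA (productDFA A B op) (combine i j) w ≡ combine (runDFA A i w) (runDFA B j w)
runDFA-product A B op i j []      = refl
runDFA-product A B op i j (a ∷ w) =
  trans (cong (λ ij → runDFA (productDFA A B op) (combine (DFA.δ A (proj₁ ij) a) (DFA.δ B (proj₂ ij) a)) w)
              (FP.remQuot-combine {DFA.states A} {DFA.states B} i j))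
        (runDFA-product A B op (DFA.δ A i a) (DFA.δ B j a) w)

Recognisable-op : ∀ {g h} (op : Bool → Bool → Bool) → Recognisable g → Recognisable h →
                  Recognisable (λ x y → op (g x y) (h x y))
Recognisable-op {g} {h} op (A , okA) (B , okB) = productDFA A B op , λ m x y ∣x∣< ∣y∣< →
  let w = conv 0 m x y
      finals = λ (ij : Fin (DFA.states A) × Fin (DFA.states B)) → op (DFA.final A (proj₁ ij)) (DFA.final B (proj₂ ij))
  in begin
    accepts (productDFA A B op) w
      ≡⟨ cong (λ k → finals (remQuot {DFA.states A} (DFA.states B) k)) (runDFA-product A B op _ _ w) ⟩
    finals (remQuot {DFA.states A} (DFA.states B) (combine (runDFA A (DFA.q₀ A) w) (runDFA B (DFA.q₀ B) w)))
      ≡⟨ cong finals (FP.remQuot-combine {DFA.states A} {DFA.states B} _ _) ⟩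
    op (accepts A w) (accepts B w)
      ≡⟨ cong₂ op (okA m x y ∣x∣< ∣y∣<) (okB m x y ∣x∣< ∣y∣<) ⟩
    op (g x y) (h x y) ∎
  where open ≡-Reasoning

Recognisable-false : Recognisable (λ x y → false)
Recognisable-false = record { states = 1 ; δ = λ q _ → q ; q₀ = F.zero ; final = λ _ → false } , λ _ _ _ _ _ → refl

Recognisable-not : ∀ {g} → Recognisable g → Recognisable (λ x y → not (g x y))
Recognisable-not r = Recognisable-op (λ a _ → not a) r Recognisable-false

Recognisable-∧ : ∀ {g h} → Recognisable g → Recognisable h → Recognisable (λ x y → g x y ∧ h x y)
Recognisable-∧ = Recognisable-op _∧_

Recognisable-∨ : ∀ {g h} → Recognisable g → Recognisable h → Recognisable (λ x y → g x y ∨ h x y)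
Recognisable-∨ = Recognisable-op _∨_

Recognisable-anyBelow : ∀ n (g : ℕ → ℤ → ℤ → Bool) → (∀ k → Recognisable (g k)) →
                        Recognisable (λ x y → anyBelow n (λ k → g k x y))
Recognisable-anyBelow zero    g r = Recognisable-false
Recognisable-anyBelow (suc n) g r = Recognisable-∨ (r n) (Recognisable-anyBelow n g r)

digitDFA : (s : ℕ) → (Fin s → Fin 2 → Fin 2 → Fin s) → Fin s → (Fin s → Bool) → DFA Letter
digitDFA s update q₀ final = record { states = s ; δ = δ ; q₀ = q₀ ; final = final }
  where
  δ : Fin s → Letter → Fin s
  δ q (dig a , dig b) = update q a b
  δ q (dig _ , plus)  = q
  δ q (dig _ , minus) = q
  δ q (plus , _)      = q
  δ q (minus , _)     = q

runDigits : ∀ {s} → (Fin s → Fin 2 → Fin 2 → Fin s) → Fin s → ℕ → ℕ → ℕ → Fin s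
runDigits update q zero    a b = q
runDigits update q (suc m) a b = update (runDigits update q m (a / 2) (b / 2)) (a mod 2) (b mod 2)

length-digitsPad : ∀ m n → length (digitsPad 0 m n) ≡ m
length-digitsPad zero    n = refl
length-digitsPad (suc m) n =
  trans (LP.length-++ (digitsPad 0 m (n / 2))) (trans (cong (ℕ._+ 1) (length-digitsPad m (n / 2))) (ℕP.+-comm m 1))

zip-∷ʳ : ∀ {A B : Set} (xs : List A) (ys : List B) x y → length xs ≡ length ys →
         zip (xs ++ [ x ]) (ys ++ [ y ]) ≡ zip xs ys ++ [ (x , y) ]
zip-∷ʳ []       []       x y _ = refl
zip-∷ʳ (a ∷ xs) (b ∷ ys) x y e = cong ((a , b) ∷_) (zip-∷ʳ xs ys x y (ℕP.suc-injective e))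

digitLetter : Fin 2 × Fin 2 → Letter
digitLetter (a , b) = dig a , dig b

runDFA-digits : ∀ s update q₀ final m a b →
                runDFA (digitDFA s update q₀ final) q₀ (map digitLetter (zip (digitsPad 0 m a) (digitsPad 0 m b)))
                ≡ runDigits update q₀ m a b
runDFA-digits s update q₀ final zero    a b = refl
runDFA-digits s update q₀ final (suc m) a b = begin
  runDFA A q₀ (map digitLetter (zip (high a ++ [ a mod 2 ]) (high b ++ [ b mod 2 ])))
    ≡⟨ cong (λ w → runDFA A q₀ (map digitLetter w))
            (zip-∷ʳ (high a) (high b) (a mod 2) (b mod 2) (trans (length-digitsPad m (a / 2)) (sym (length-digitsPad m (b / 2))))) ⟩
  runDFA A q₀ (map digitLetter (zip (high a) (high b) ++ [ (a mod 2 , b mod 2) ]))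
    ≡⟨ cong (runDFA A q₀) (LP.map-++ digitLetter (zip (high a) (high b)) [ (a mod 2 , b mod 2) ]) ⟩
  runDFA A q₀ (map digitLetter (zip (high a) (high b)) ++ [ digitLetter (a mod 2 , b mod 2) ])
    ≡⟨ runDFA-++ A q₀ (map digitLetter (zip (high a) (high b))) [ digitLetter (a mod 2 , b mod 2) ] ⟩
  update (runDFA A q₀ (map digitLetter (zip (high a) (high b)))) (a mod 2) (b mod 2)
    ≡⟨ cong (λ q → update q (a mod 2) (b mod 2)) (runDFA-digits s update q₀ final m (a / 2) (b / 2)) ⟩
  runDigits update q₀ (suc m) a b ∎
  where
  open ≡-Reasoning
  A = digitDFA s update q₀ final
  high : ℕ → List (Fin 2)
  high n = digitsPad 0 m (n / 2)

digitWord : ℕ → ℤ → ℤ → List Letter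
digitWord m x y = map digitLetter (zip (digitsPad 0 m ∣ x ∣) (digitsPad 0 m ∣ y ∣))

runDFA-digitDFA : ∀ s update q₀ final m x y →
                  runDFA (digitDFA s update q₀ final) q₀ (conv 0 m x y) ≡ runDigits update q₀ m ∣ x ∣ ∣ y ∣
runDFA-digitDFA s update q₀ final m x y =
  trans (cong (λ q → runDFA (digitDFA s update q₀ final) q (digitWord m x y)) (sign-ignored x y)) (runDFA-digits s update q₀ final m ∣ x ∣ ∣ y ∣)
  where
  sign-ignored : ∀ (x y : ℤ) → DFA.δ (digitDFA s update q₀ final) q₀ (sign x , sign y) ≡ q₀
  sign-ignored (+ _)    _ = refl
  sign-ignored -[1+ _ ] _ = refl

isNonNeg : ℤ → Bool
isNonNeg (+ _)    = true
isNonNeg -[1+ _ ] = false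

signDFA : Bool → DFA Letter
signDFA ofX = record { states = 3 ; δ = δ ; q₀ = F.zero ; final = isPlusState }
  where
  plusState minusState : Fin 3
  plusState  = F.suc F.zero
  minusState = F.suc (F.suc F.zero)
  classify : Sym 2 → Fin 3
  classify plus    = plusState
  classify minus   = minusState
  classify (dig _) = F.zero
  isPlusState : Fin 3 → Bool
  isPlusState (F.suc F.zero) = true
  isPlusState _              = false
  δ : Fin 3 → Letter → Fin 3
  δ F.zero    (a , b) = classify (if ofX then a else b)
  δ (F.suc k) _       = F.suc k

signDFA-absorbing : ∀ ofX k w → runDFA (signDFA ofX) (F.suc k) w ≡ F.suc k
signDFA-absorbing ofX k []      = refl
signDFA-absorbing ofX k (_ ∷ w) = signDFA-absorbing ofX k w

Recognisable-nonNegˣ : Recognisable (λ x y → isNonNeg x)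
Recognisable-nonNegˣ = signDFA true , λ where
  m (+ n)    y _ _ → cong (DFA.final (signDFA true)) (signDFA-absorbing true F.zero (digitWord m (+ n) y))
  m -[1+ n ] y _ _ → cong (DFA.final (signDFA true)) (signDFA-absorbing true (F.suc F.zero) (digitWord m -[1+ n ] y))

Recognisable-nonNegʸ : Recognisable (λ x y → isNonNeg y)
Recognisable-nonNegʸ = signDFA false , λ where
  m x (+ n)    _ _ → cong (DFA.final (signDFA false)) (signDFA-absorbing false F.zero (digitWord m x (+ n)))
  m x -[1+ n ] _ _ → cong (DFA.final (signDFA false)) (signDFA-absorbing false (F.suc F.zero) (digitWord m x -[1+ n ]))

sideBit : ∀ {σ : ℤ} → IsUnit σ → ℤ → Bool
sideBit (inj₁ _) x = isNonNeg x
sideBit (inj₂ _) x = not (isNonNeg x)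

Recognisable-sideBit : ∀ {σ} (σ±1 : IsUnit σ) → Recognisable (λ x y → sideBit σ±1 x)
Recognisable-sideBit (inj₁ _) = Recognisable-nonNegˣ
Recognisable-sideBit (inj₂ _) = Recognisable-not Recognisable-nonNegˣ

sideBit-sound : ∀ σ (σ±1 : IsUnit σ) x → sideBit σ±1 x ≡ true → x ≡ σ * + ∣ x ∣
sideBit-sound σ (inj₁ refl) (+ n)    _ = sym (ℤP.*-identityˡ (+ n))
sideBit-sound σ (inj₁ refl) -[1+ n ] ()
sideBit-sound σ (inj₂ refl) (+ n)    ()
sideBit-sound σ (inj₂ refl) -[1+ n ] _ = sym (ℤP.-1*i≡-i (+ suc n))

-- Reading binary digits most significant first, the residue evolves by q ↦ 2q + a mod h.
residueStep : ∀ h → .{{_ : ℕ.NonZero h}} → Fin h → Fin 2 → Fin 2 → Fin h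
residueStep h q a _ = (2 ℕ.* toℕ q ℕ.+ toℕ a) mod h

[2[k%h]+e]%h : ∀ k e h → .{{_ : ℕ.NonZero h}} → (2 ℕ.* (k % h) ℕ.+ e) % h ≡ (2 ℕ.* k ℕ.+ e) % h
[2[k%h]+e]%h k e h = begin
  (2 ℕ.* (k % h) ℕ.+ e) % h                ≡⟨ DM.%-distribˡ-+ (2 ℕ.* (k % h)) e h ⟩
  ((2 ℕ.* (k % h)) % h ℕ.+ e % h) % h      ≡⟨ cong (λ z → (z ℕ.+ e % h) % h) (DM.%-distribˡ-* 2 (k % h) h) ⟩
  (((2 % h) ℕ.* (k % h % h)) % h ℕ.+ e % h) % h ≡⟨ cong (λ z → (((2 % h) ℕ.* z) % h ℕ.+ e % h) % h) (DM.m%n%n≡m%n k h) ⟩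
  (((2 % h) ℕ.* (k % h)) % h ℕ.+ e % h) % h ≡⟨ cong (λ z → (z ℕ.+ e % h) % h) (sym (DM.%-distribˡ-* 2 k h)) ⟩
  ((2 ℕ.* k) % h ℕ.+ e % h) % h            ≡⟨ sym (DM.%-distribˡ-+ (2 ℕ.* k) e h) ⟩
  (2 ℕ.* k ℕ.+ e) % h                      ∎
  where open ≡-Reasoning

runDigits-residue : ∀ h → .{{_ : ℕ.NonZero h}} → ∀ m a b → a ℕ.< 2 ^ m →
                    toℕ (runDigits (residueStep h) (0 mod h) m a b) ≡ a % h
runDigits-residue h zero    zero    b _ = toℕ-mod 0 h
runDigits-residue h zero    (suc a) b (ℕ.s≤s ())
runDigits-residue h (suc m) a b a<2^1+m = begin
  toℕ (residueStep h (runDigits (residueStep h) (0 mod h) m (a / 2) (b / 2)) (a mod 2) (b mod 2))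
    ≡⟨ toℕ-mod _ h ⟩
  (2 ℕ.* toℕ (runDigits (residueStep h) (0 mod h) m (a / 2) (b / 2)) ℕ.+ toℕ (a mod 2)) % h
    ≡⟨ cong₂ (λ u v → (2 ℕ.* u ℕ.+ v) % h) (runDigits-residue h m (a / 2) (b / 2) (n<2k⇒n/2<k a (2 ^ m) a<2^1+m)) (toℕ-mod a 2) ⟩
  (2 ℕ.* ((a / 2) % h) ℕ.+ a % 2) % h
    ≡⟨ [2[k%h]+e]%h (a / 2) (a % 2) h ⟩
  (2 ℕ.* (a / 2) ℕ.+ a % 2) % h
    ≡⟨ cong (_% h) (trans (ℕP.+-comm (2 ℕ.* (a / 2)) (a % 2)) (cong (a % 2 ℕ.+_) (ℕP.*-comm 2 (a / 2)))) ⟩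
  (a % 2 ℕ.+ (a / 2) ℕ.* 2) % h
    ≡⟨ cong (_% h) (sym (n≡n%2+[n/2]*2 a)) ⟩
  a % h ∎
  where open ≡-Reasoning

Recognisable-residue : ∀ h → .{{_ : ℕ.NonZero h}} → ∀ r → Recognisable (λ x y → ⌊ ∣ x ∣ % h ℕP.≟ r ⌋)
Recognisable-residue h r = digitDFA h (residueStep h) (0 mod h) accept , λ m x y ∣x∣< _ →
  trans (cong accept (runDFA-digitDFA h (residueStep h) (0 mod h) accept m x y))
        (cong (λ n → ⌊ n ℕP.≟ r ⌋) (runDigits-residue h m ∣ x ∣ ∣ y ∣ ∣x∣<))
  where accept : Fin h → Bool
        accept q = ⌊ toℕ q ℕP.≟ r ⌋


clamp : ℕ → ℤ → ℤ
clamp W z with z ℤP.≤? - + W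
... | yes _ = - + W
... | no _ with + W ℤP.≤? z
...   | yes _ = + W
...   | no _  = z

clamp-low : ∀ W z → z ≤ - + W → clamp W z ≡ - + W
clamp-low W z z≤-W with z ℤP.≤? - + W
... | yes _ = refl
... | no z≰-W = ⊥-elim (z≰-W z≤-W)

clamp-high : ∀ W z → + W ≤ z → clamp W z ≡ + W
clamp-high W z W≤z with z ℤP.≤? - + W
... | yes z≤-W = W≤-W⇒-W≡W W (ℤP.≤-trans W≤z z≤-W)
  where
  W≤-W⇒-W≡W : ∀ W → + W ≤ - + W → - + W ≡ + W
  W≤-W⇒-W≡W zero    _  = refl
  W≤-W⇒-W≡W (suc W) ()
... | no _ with + W ℤP.≤? z
...   | yes _   = refl
...   | no W≰z = ⊥-elim (W≰z W≤z)

clamp-mid : ∀ W z → ¬ (z ≤ - + W) → ¬ (+ W ≤ z) → clamp W z ≡ z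
clamp-mid W z z≰-W W≰z with z ℤP.≤? - + W
... | yes z≤-W = ⊥-elim (z≰-W z≤-W)
... | no _ with + W ℤP.≤? z
...   | yes W≤z = ⊥-elim (W≰z W≤z)
...   | no _    = refl

∣clamp∣≤W : ∀ W z → ∣ clamp W z ∣ ℕ.≤ W
∣clamp∣≤W W z with z ℤP.≤? - + W
... | yes _ = ℕP.≤-reflexive (ℤP.∣-i∣≡∣i∣ (+ W))
... | no z≰-W with + W ℤP.≤? z
...   | yes _   = ℕP.≤-refl
...   | no W≰z = between z (ℤP.≰⇒> z≰-W) (ℤP.≰⇒> W≰z)
  where
  between : ∀ z → - + W < z → z < + W → ∣ z ∣ ℕ.≤ W
  between (+ n)    _     (ℤ.+<+ n<W) = ℕP.<⇒≤ n<W
  between -[1+ n ] -W<z _           = 1+n≤W W -W<z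
    where
    1+n≤W : ∀ W → - + W < -[1+ n ] → suc n ℕ.≤ W
    1+n≤W zero    ()
    1+n≤W (suc W) (ℤ.-<- n<W) = ℕ.s≤s (ℕP.<⇒≤ n<W)

clamp-small : ∀ W z → ∣ z ∣ ℕ.≤ W → clamp W z ≡ z
clamp-small W z ∣z∣≤W = cases (z ℤP.≤? - + W) (+ W ℤP.≤? z)
  where
  cases : Dec (z ≤ - + W) → Dec (+ W ≤ z) → clamp W z ≡ z
  cases (yes z≤-W) _ = trans (clamp-low W z z≤-W) (ℤP.≤-antisym (ℤP.≤-trans (ℤP.neg-mono-≤ (+≤+ ∣z∣≤W)) (-∣i∣≤i z)) z≤-W)
  cases (no _) (yes W≤z) = trans (clamp-high W z W≤z) (ℤP.≤-antisym W≤z (ℤP.≤-trans (i≤∣i∣ z) (+≤+ ∣z∣≤W)))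
  cases (no z≰-W) (no W≰z) = clamp-mid W z z≰-W W≰z

-- Once |v| ≥ W, every later value 2v + d with |d| < W stays beyond W on the same
-- side, so a state clamped to [-W, W] loses nothing about the final comparison.
clamp-2*+ : ∀ W z d → ∣ d ∣ ℕ.< W → clamp W (+ 2 * clamp W z + d) ≡ clamp W (+ 2 * z + d)
clamp-2*+ W z d ∣d∣<W = cases (z ℤP.≤? - + W) (+ W ℤP.≤? z)
  where
  regroup₋ : ∀ w e → + 2 * (- w) + e ≡ - w + (e - w)
  regroup₋ = solve-∀
  stays-low : ∀ u → u ≤ - + W → + 2 * u + d ≤ - + W
  stays-low u u≤-W =
    ℤP.≤-trans (ℤP.+-mono-≤ (ℤP.*-monoˡ-≤-nonNeg (+ 2) u≤-W) (i≤∣i∣ d))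
      (ℤP.≤-trans (ℤP.≤-reflexive (regroup₋ (+ W) (+ ∣ d ∣)))
        (ℤP.≤-trans (ℤP.+-monoʳ-≤ (- + W) (ℤP.i≤j⇒i-j≤0 (+≤+ (ℕP.<⇒≤ ∣d∣<W)))) (ℤP.≤-reflexive (ℤP.+-identityʳ _))))
  regroup₊ : ∀ w e → + 2 * w + (- e) ≡ w + (w - e)
  regroup₊ = solve-∀
  stays-high : ∀ u → + W ≤ u → + W ≤ + 2 * u + d
  stays-high u W≤u =
    ℤP.≤-trans (ℤP.≤-reflexive (sym (ℤP.+-identityʳ _)))
      (ℤP.≤-trans (ℤP.+-monoʳ-≤ (+ W) (ℤP.i≤j⇒0≤j-i (+≤+ (ℕP.<⇒≤ ∣d∣<W))))
        (ℤP.≤-trans (ℤP.≤-reflexive (sym (regroup₊ (+ W) (+ ∣ d ∣))))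
          (ℤP.+-mono-≤ (ℤP.*-monoˡ-≤-nonNeg (+ 2) W≤u) (-∣i∣≤i d))))
  cases : Dec (z ≤ - + W) → Dec (+ W ≤ z) → clamp W (+ 2 * clamp W z + d) ≡ clamp W (+ 2 * z + d)
  cases (yes z≤-W) _ =
    trans (cong (λ c → clamp W (+ 2 * c + d)) (clamp-low W z z≤-W))
          (trans (clamp-low W _ (stays-low (- + W) ℤP.≤-refl)) (sym (clamp-low W _ (stays-low z z≤-W))))
  cases (no _) (yes W≤z) =
    trans (cong (λ c → clamp W (+ 2 * c + d)) (clamp-high W z W≤z))
          (trans (clamp-high W _ (stays-high (+ W) ℤP.≤-refl)) (sym (clamp-high W _ (stays-high z W≤z))))
  cases (no z≰-W) (no W≰z) = cong (λ c → clamp W (+ 2 * c + d)) (clamp-mid W z z≰-W W≰z)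

isYes-clamp-≟ : ∀ W v w → ∣ w ∣ ℕ.< W → ⌊ clamp W v ℤP.≟ w ⌋ ≡ ⌊ v ℤP.≟ w ⌋
isYes-clamp-≟ W v w ∣w∣<W = isYes-cong (clamp W v ℤP.≟ w) (v ℤP.≟ w) unclamp
  (λ v≡w → trans (clamp-small W v (subst (λ z → ∣ z ∣ ℕ.≤ W) (sym v≡w) (ℕP.<⇒≤ ∣w∣<W))) v≡w)
  where
  unclamp : clamp W v ≡ w → v ≡ w
  unclamp c≡w = cases (v ℤP.≤? - + W) (+ W ℤP.≤? v)
    where
    cases : Dec (v ≤ - + W) → Dec (+ W ≤ v) → v ≡ w
    cases (yes v≤-W) _ =
      ⊥-elim (ℕP.<-irrefl (trans (cong ∣_∣ (trans (sym c≡w) (clamp-low W v v≤-W))) (ℤP.∣-i∣≡∣i∣ (+ W))) ∣w∣<W)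
    cases (no _) (yes W≤v) = ⊥-elim (ℕP.<-irrefl (cong ∣_∣ (trans (sym c≡w) (clamp-high W v W≤v))) ∣w∣<W)
    cases (no v≰-W) (no W≰v) = trans (sym (clamp-mid W v v≰-W W≰v)) c≡w

isYes-≤-clamp : ∀ W v X → 1 ℕ.≤ W → X ℕ.≤ W → ⌊ + X ℤP.≤? clamp W v ⌋ ≡ ⌊ + X ℤP.≤? v ⌋
isYes-≤-clamp W v X 1≤W X≤W = isYes-cong (+ X ℤP.≤? clamp W v) (+ X ℤP.≤? v) unclamp clamp′
  where
  X≰-W : ∀ {A : Set} → + X ≤ - + W → A
  X≰-W X≤-W = ⊥-elim (impossible W 1≤W X≤-W)
    where impossible : ∀ W → 1 ℕ.≤ W → ¬ (+ X ≤ - + W)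
          impossible (suc W) _ ()
  unclamp : + X ≤ clamp W v → + X ≤ v
  unclamp X≤c = cases (v ℤP.≤? - + W) (+ W ℤP.≤? v)
    where
    cases : Dec (v ≤ - + W) → Dec (+ W ≤ v) → + X ≤ v
    cases (yes v≤-W) _ = X≰-W (subst (+ X ≤_) (clamp-low W v v≤-W) X≤c)
    cases (no _) (yes W≤v) = ℤP.≤-trans (+≤+ X≤W) W≤v
    cases (no v≰-W) (no W≰v) = subst (+ X ≤_) (clamp-mid W v v≰-W W≰v) X≤c
  clamp′ : + X ≤ v → + X ≤ clamp W v
  clamp′ X≤v = cases (v ℤP.≤? - + W) (+ W ℤP.≤? v)
    where
    cases : Dec (v ≤ - + W) → Dec (+ W ≤ v) → + X ≤ clamp W v
    cases (yes v≤-W) _ = X≰-W (ℤP.≤-trans X≤v v≤-W)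
    cases (no _) (yes W≤v) = subst (+ X ≤_) (sym (clamp-high W v W≤v)) (+≤+ X≤W)
    cases (no v≰-W) (no W≰v) = subst (+ X ≤_) (sym (clamp-mid W v v≰-W W≰v)) X≤v

∣c*bit∣≤∣c∣ : ∀ c (a : Fin 2) → ∣ c * + toℕ a ∣ ℕ.≤ ∣ c ∣
∣c*bit∣≤∣c∣ c a = ℕP.≤-trans (ℕP.≤-reflexive (ℤP.∣i*j∣≡∣i∣*∣j∣ c (+ toℕ a)))
                   (ℕP.≤-trans (ℕP.*-monoʳ-≤ ∣ c ∣ (toℕ-bit≤1 a)) (ℕP.≤-reflexive (ℕP.*-identityʳ ∣ c ∣)))
  where toℕ-bit≤1 : ∀ (a : Fin 2) → toℕ a ℕ.≤ 1
        toℕ-bit≤1 F.zero         = ℕ.z≤n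
        toℕ-bit≤1 (F.suc F.zero) = ℕP.≤-refl

module LinearDFA (W : ℕ) (c₁ c₂ : ℤ) (∣c₁∣+∣c₂∣<W : ∣ c₁ ∣ ℕ.+ ∣ c₂ ∣ ℕ.< W) where

  digitTerm : Fin 2 → Fin 2 → ℤ
  digitTerm a b = c₁ * + toℕ a + c₂ * + toℕ b

  update : Fin (suc (W ℕ.+ W)) → Fin 2 → Fin 2 → Fin (suc (W ℕ.+ W))
  update q a b = encodeℤ W (clamp W (+ 2 * decodeℤ W q + digitTerm a b))

  initial : Fin (suc (W ℕ.+ W))
  initial = encodeℤ W (+ 0)

  ∣digitTerm∣<W : ∀ a b → ∣ digitTerm a b ∣ ℕ.< W
  ∣digitTerm∣<W a b = ℕP.≤-<-trans (ℕP.≤-trans (ℤP.∣i+j∣≤∣i∣+∣j∣ (c₁ * + toℕ a) (c₂ * + toℕ b))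
                                                (ℕP.+-mono-≤ (∣c*bit∣≤∣c∣ c₁ a) (∣c*bit∣≤∣c∣ c₂ b))) ∣c₁∣+∣c₂∣<W

  n≡[n%2]+[n/2]*2 : ∀ n → + toℕ (n mod 2) + + (n / 2) * + 2 ≡ + n
  n≡[n%2]+[n/2]*2 n = trans (cong₂ _+_ (cong +_ (toℕ-mod n 2)) (sym (ℤP.pos-* (n / 2) 2)))
                            (trans (sym (ℤP.pos-+ (n % 2) ((n / 2) ℕ.* 2))) (cong +_ (sym (n≡n%2+[n/2]*2 n))))

  runDigits-linear : ∀ m a b → a ℕ.< 2 ^ m → b ℕ.< 2 ^ m →
                     decodeℤ W (runDigits update initial m a b) ≡ clamp W (c₁ * + a + c₂ * + b)
  runDigits-linear zero zero zero _ _ =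
    trans (decode-encode W (+ 0) ℕ.z≤n) (sym (trans (cong (clamp W) (zero-term c₁ c₂)) (clamp-small W (+ 0) ℕ.z≤n)))
    where zero-term : ∀ c₁ c₂ → c₁ * + 0 + c₂ * + 0 ≡ + 0
          zero-term = solve-∀
  runDigits-linear zero zero    (suc b) _ (ℕ.s≤s ())
  runDigits-linear zero (suc a) b (ℕ.s≤s ()) _
  runDigits-linear (suc m) a b a< b< = begin
    decodeℤ W (encodeℤ W (clamp W (+ 2 * decodeℤ W q + d)))
      ≡⟨ decode-encode W _ (∣clamp∣≤W W (+ 2 * decodeℤ W q + d)) ⟩
    clamp W (+ 2 * decodeℤ W q + d)
      ≡⟨ cong (λ z → clamp W (+ 2 * z + d)) (runDigits-linear m (a / 2) (b / 2) (n<2k⇒n/2<k a (2 ^ m) a<) (n<2k⇒n/2<k b (2 ^ m) b<)) ⟩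
    clamp W (+ 2 * clamp W (c₁ * + (a / 2) + c₂ * + (b / 2)) + d)
      ≡⟨ clamp-2*+ W (c₁ * + (a / 2) + c₂ * + (b / 2)) d (∣digitTerm∣<W (a mod 2) (b mod 2)) ⟩
    clamp W (+ 2 * (c₁ * + (a / 2) + c₂ * + (b / 2)) + d)
      ≡⟨ cong (clamp W) (regroup c₁ c₂ (+ (a / 2)) (+ (b / 2)) (+ toℕ (a mod 2)) (+ toℕ (b mod 2))) ⟩
    clamp W (c₁ * (+ toℕ (a mod 2) + + (a / 2) * + 2) + c₂ * (+ toℕ (b mod 2) + + (b / 2) * + 2))
      ≡⟨ cong₂ (λ u v → clamp W (c₁ * u + c₂ * v)) (n≡[n%2]+[n/2]*2 a) (n≡[n%2]+[n/2]*2 b) ⟩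
    clamp W (c₁ * + a + c₂ * + b) ∎
    where
    open ≡-Reasoning
    d = digitTerm (a mod 2) (b mod 2)
    q = runDigits update initial m (a / 2) (b / 2)
    regroup : ∀ c₁ c₂ a′ b′ ra rb → + 2 * (c₁ * a′ + c₂ * b′) + (c₁ * ra + c₂ * rb) ≡ c₁ * (ra + a′ * + 2) + c₂ * (rb + b′ * + 2)
    regroup = solve-∀

  Recognisable-clamp : (accept : ℤ → Bool) → Recognisable (λ x y → accept (clamp W (c₁ * + ∣ x ∣ + c₂ * + ∣ y ∣)))
  Recognisable-clamp accept = digitDFA (suc (W ℕ.+ W)) update initial (accept ∘ decodeℤ W) , λ m x y ∣x∣< ∣y∣< →
    trans (cong (accept ∘ decodeℤ W) (runDFA-digitDFA (suc (W ℕ.+ W)) update initial (accept ∘ decodeℤ W) m x y))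
          (cong accept (runDigits-linear m ∣ x ∣ ∣ y ∣ ∣x∣< ∣y∣<))

Recognisable-linear : ∀ c₁ c₂ w → Recognisable (λ x y → ⌊ c₁ * + ∣ x ∣ + c₂ * + ∣ y ∣ ℤP.≟ w ⌋)
Recognisable-linear c₁ c₂ w =
  Recognisable-cong (λ x y → isYes-clamp-≟ W _ w ∣w∣<W) (LinearDFA.Recognisable-clamp W c₁ c₂ ∣c∣<W (λ v → ⌊ v ℤP.≟ w ⌋))
  where
  W = suc ((∣ c₁ ∣ ℕ.+ ∣ c₂ ∣) ℕ.+ ∣ w ∣)
  ∣c∣<W : ∣ c₁ ∣ ℕ.+ ∣ c₂ ∣ ℕ.< W
  ∣c∣<W = ℕ.s≤s (ℕP.m≤m+n _ _)
  ∣w∣<W : ∣ w ∣ ℕ.< W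
  ∣w∣<W = ℕ.s≤s (ℕP.m≤n+m _ _)

Recognisable-≥ˣ : ∀ X → Recognisable (λ x y → ⌊ X ℕP.≤? ∣ x ∣ ⌋)
Recognisable-≥ˣ X = Recognisable-cong agree (LinearDFA.Recognisable-clamp W (+ 1) (+ 0) (ℕ.s≤s (ℕ.s≤s ℕ.z≤n)) (λ v → ⌊ + X ℤP.≤? v ⌋))
  where
  W = suc (suc X)
  project : ∀ a b → + 1 * a + + 0 * b ≡ a
  project = solve-∀
  agree : ∀ x y → ⌊ + X ℤP.≤? clamp W (+ 1 * + ∣ x ∣ + + 0 * + ∣ y ∣) ⌋ ≡ ⌊ X ℕP.≤? ∣ x ∣ ⌋
  agree x y = trans (isYes-≤-clamp W v X (ℕ.s≤s ℕ.z≤n) (ℕP.≤-trans (ℕP.n≤1+n X) (ℕP.n≤1+n (suc X))))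
                    (isYes-cong (+ X ℤP.≤? v) (X ℕP.≤? ∣ x ∣)
                      (λ X≤v → ℤP.drop‿+≤+ (subst (+ X ≤_) (project (+ ∣ x ∣) (+ ∣ y ∣)) X≤v))
                      (λ X≤∣x∣ → subst (+ X ≤_) (sym (project (+ ∣ x ∣) (+ ∣ y ∣))) (+≤+ X≤∣x∣)))
    where v = + 1 * + ∣ x ∣ + + 0 * + ∣ y ∣

affineGraph : ℤ → ℤ → ℤ → ℤ → Bool
affineGraph a b x y = ⌊ y ℤP.≟ a * + ∣ x ∣ + b ⌋

-- Split on the sign of y: y = a|x| + b  iff  -a|x| ± |y| = b.
Recognisable-affineGraph : ∀ a b → Recognisable (affineGraph a b)
Recognisable-affineGraph a b = Recognisable-cong agree
  (Recognisable-∨ (Recognisable-∧ Recognisable-nonNegʸ (Recognisable-linear (- a) (+ 1) b))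
                  (Recognisable-∧ (Recognisable-not Recognisable-nonNegʸ) (Recognisable-linear (- a) (- + 1) b)))
  where
  r₁ : ∀ a X y → (- a * X + + 1 * y) + a * X ≡ y
  r₁ = solve-∀
  r₂ : ∀ a X b → - a * X + + 1 * (a * X + b) ≡ b
  r₂ = solve-∀
  r₃ : ∀ a X y → (- a * X + (- + 1) * y) + a * X ≡ - y
  r₃ = solve-∀
  r₄ : ∀ a X b → - a * X + (- + 1) * (- (a * X + b)) ≡ b
  r₄ = solve-∀
  agree : ∀ x y → (isNonNeg y ∧ ⌊ - a * + ∣ x ∣ + + 1 * + ∣ y ∣ ℤP.≟ b ⌋) ∨
                  (not (isNonNeg y) ∧ ⌊ - a * + ∣ x ∣ + (- + 1) * + ∣ y ∣ ℤP.≟ b ⌋) ≡ affineGraph a b x y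
  agree x (+ n) = trans (BP.∨-identityʳ _) (isYes-cong _ _
    (λ e → trans (sym (r₁ a (+ ∣ x ∣) (+ n))) (trans (cong (_+ a * + ∣ x ∣) e) (ℤP.+-comm b _)))
    (λ e → trans (cong (λ z → - a * + ∣ x ∣ + + 1 * z) e) (r₂ a (+ ∣ x ∣) b)))
  agree x -[1+ n ] = isYes-cong _ _
    (λ e → trans (sym (r₃ a (+ ∣ x ∣) (+ suc n))) (trans (cong (_+ a * + ∣ x ∣) e) (ℤP.+-comm b _)))
    (λ e → trans (cong (λ z → - a * + ∣ x ∣ + (- + 1) * (- z)) e) (r₄ a (+ ∣ x ∣) b))

inputIs : ℤ → ℤ → ℤ → Bool
inputIs c x y = ⌊ x ℤP.≟ c ⌋

Recognisable-inputIs : ∀ c → Recognisable (inputIs c)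
Recognisable-inputIs c = Recognisable-cong agree
  (Recognisable-∨ (Recognisable-∧ Recognisable-nonNegˣ (Recognisable-linear (+ 1) (+ 0) c))
                  (Recognisable-∧ (Recognisable-not Recognisable-nonNegˣ) (Recognisable-linear (- + 1) (+ 0) c)))
  where
  r₊ : ∀ X Y → + 1 * X + + 0 * Y ≡ X
  r₊ = solve-∀
  r₋ : ∀ X Y → (- + 1) * X + + 0 * Y ≡ - X
  r₋ = solve-∀
  agree : ∀ x y → (isNonNeg x ∧ ⌊ + 1 * + ∣ x ∣ + + 0 * + ∣ y ∣ ℤP.≟ c ⌋) ∨
                  (not (isNonNeg x) ∧ ⌊ (- + 1) * + ∣ x ∣ + + 0 * + ∣ y ∣ ℤP.≟ c ⌋) ≡ inputIs c x y
  agree (+ n) y = trans (BP.∨-identityʳ _)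
    (isYes-cong _ _ (λ e → trans (sym (r₊ (+ n) (+ ∣ y ∣))) e) (λ e → trans (r₊ (+ n) (+ ∣ y ∣)) e))
  agree -[1+ n ] y =
    isYes-cong _ _ (λ e → trans (sym (r₋ (+ suc n) (+ ∣ y ∣))) e) (λ e → trans (r₋ (+ suc n) (+ ∣ y ∣)) e)


-- Runs of a one-register program

module Machine (P : Program) where

  steps : ℕ → Config P → Config P
  steps zero    c = c
  steps (suc t) c = step P (steps t c)

  run≡steps : ∀ t x → run P t x ≡ steps t (start P , x)
  run≡steps zero    x = refl
  run≡steps (suc t) x = cong (step P) (run≡steps t x)

  steps-+ : ∀ a b c → steps (a ℕ.+ b) c ≡ steps a (steps b c)
  steps-+ zero    b c = refl
  steps-+ (suc a) b c = cong (step P) (steps-+ a b c)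

  steps-suc : ∀ a c → steps (suc a) c ≡ steps a (step P c)
  steps-suc a c = trans (cong (λ k → steps k c) (ℕP.+-comm 1 a)) (steps-+ a 1 c)

  steps-∸ : ∀ {a t} c → a ℕ.≤ t → steps t c ≡ steps (t ∸ a) (steps a c)
  steps-∸ {a} {t} c a≤t = trans (cong (λ k → steps k c) (sym (ℕP.m∸n+n≡m a≤t))) (steps-+ (t ∸ a) a c)

  halted? : ∀ c → Dec (Halted P c)
  halted? c = isWrite? (code P (proj₁ c))
    where
    isWrite? : ∀ {n} (i : Instr n) → Dec (IsWrite i)
    isWrite? (assign _ _)     = no λ ()
    isWrite? (test _ _ _ _) = no λ ()
    isWrite? (goto _)         = no λ ()
    isWrite? write            = yes isWrite

  step-halted : ∀ c → Halted P c → step P c ≡ c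
  step-halted (l , r) h with code P l | h
  ... | .write | isWrite = refl

  steps-halted : ∀ b a c → Halted P (steps a c) → steps (b ℕ.+ a) c ≡ steps a c
  steps-halted zero    a c h = refl
  steps-halted (suc b) a c h = trans (cong (step P) (steps-halted b a c h)) (step-halted _ h)

  steps-after-halt : ∀ a b c → a ℕ.≤ b → Halted P (steps a c) → steps b c ≡ steps a c
  steps-after-halt a b c a≤b h = trans (cong (λ k → steps k c) (sym (ℕP.m∸n+n≡m a≤b))) (steps-halted (b ∸ a) a c h)

  halted-mono : ∀ a b c → a ℕ.≤ b → Halted P (steps a c) → Halted P (steps b c)
  halted-mono a b c a≤b h = subst (Halted P) (sym (steps-after-halt a b c a≤b h)) h

  HaltsWith : Config P → ℤ → Set
  HaltsWith c y = Σ ℕ λ t → Halted P (steps t c) × proj₂ (steps t c) ≡ y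

  SameOutcome : Config P → Config P → Set
  SameOutcome c c′ = ∀ y → (HaltsWith c′ y → HaltsWith c y) × (HaltsWith c y → HaltsWith c′ y)

  Halts : Config P → Set
  Halts c = Σ ℕ λ t → Halted P (steps t c)

  Diverges : Config P → Set
  Diverges c = ∀ t → ¬ Halted P (steps t c)

  FirstHalt : Config P → ℕ → Set
  FirstHalt c t = Halted P (steps t c) × (∀ t′ → t′ ℕ.< t → ¬ Halted P (steps t′ c))

  firstHalt : ∀ c t → Halted P (steps t c) → Σ ℕ λ t₀ → t₀ ℕ.≤ t × FirstHalt c t₀
  firstHalt c zero h = zero , ℕ.z≤n , h , λ t′ ()
  firstHalt c (suc t) h with halted? (steps t c)
  ... | yes h′ = let (t₀ , t₀≤t , first) = firstHalt c t h′ in t₀ , ℕP.m≤n⇒m≤1+n t₀≤t , first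
  ... | no ¬h  = suc t , ℕP.≤-refl , h , λ t′ t′<1+t h′ → ¬h (halted-mono t′ t c (ℕP.≤-pred t′<1+t) h′)

  HaltsWith⇒Halts : ∀ {c y} → HaltsWith c y → Halts c
  HaltsWith⇒Halts (t , h , _) = t , h

  Halts⇒HaltsWith : ∀ {c} → (h : Halts c) → HaltsWith c (proj₂ (steps (proj₁ h) c))
  Halts⇒HaltsWith (t , h) = t , h , refl

  HaltsWith-functional : ∀ {c y y′} → HaltsWith c y → HaltsWith c y′ → y ≡ y′
  HaltsWith-functional {c} (t , h , e) (t′ , h′ , e′) with ℕP.≤-total t t′
  ... | inj₁ t≤t′ = trans (sym e) (trans (cong proj₂ (sym (steps-after-halt t t′ c t≤t′ h))) e′)
  ... | inj₂ t′≤t = trans (sym e) (trans (cong proj₂ (steps-after-halt t′ t c t′≤t h′)) e′)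

  Computes⇒HaltsWith : ∀ {x y} → Computes P x y → HaltsWith (start P , x) y
  Computes⇒HaltsWith {x} (t , h , e , _) =
    t , subst (Halted P) (run≡steps t x) h , trans (cong proj₂ (sym (run≡steps t x))) e

  FirstHalt⇒HaltsAt : ∀ {x t} → FirstHalt (start P , x) t → HaltsAt P x t (proj₂ (steps t (start P , x)))
  FirstHalt⇒HaltsAt {x} {t} (h , first) =
    subst (Halted P) (sym (run≡steps t x)) h , cong proj₂ (run≡steps t x) ,
    λ t′ t′<t h′ → first t′ t′<t (subst (Halted P) (run≡steps t′ x) h′)

  HaltsWith⇒Computes : ∀ {x y} → HaltsWith (start P , x) y → Computes P x y
  HaltsWith⇒Computes {x} (t , h , e) with firstHalt (start P , x) t h
  ... | t₀ , t₀≤t , first@(h₀ , _) =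
    t₀ , subst (HaltsAt P x t₀) (trans (cong proj₂ (sym (steps-after-halt t₀ t _ t₀≤t h₀))) e) (FirstHalt⇒HaltsAt first)

  HaltsWith-backward : ∀ a c y → HaltsWith (steps a c) y → HaltsWith c y
  HaltsWith-backward a c y (t , h , e) =
    t ℕ.+ a , subst (Halted P) (sym (steps-+ t a c)) h , trans (cong proj₂ (steps-+ t a c)) e

  HaltsWith-forward : ∀ a c y → HaltsWith c y → HaltsWith (steps a c) y
  HaltsWith-forward a c y (t , h , e) = t , subst (Halted P) (sym later) h , trans (cong proj₂ later) e
    where
    later : steps t (steps a c) ≡ steps t c
    later = trans (sym (steps-+ t a c)) (trans (cong (λ k → steps k c) (ℕP.+-comm t a)) (steps-halted a t c h))

  Halts-backward : ∀ a c → Halts (steps a c) → Halts c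
  Halts-backward a c (t , h) = t ℕ.+ a , subst (Halted P) (sym (steps-+ t a c)) h

  Diverges-backward : ∀ a c → Diverges (steps a c) → Diverges c
  Diverges-backward a c diverges t h with ℕP.≤-total t a
  ... | inj₁ t≤a = diverges 0 (halted-mono t a c t≤a h)
  ... | inj₂ a≤t = diverges (t ∸ a) (subst (Halted P) (steps-∸ c a≤t) h)

  cycle⇒Diverges : ∀ p c → 1 ℕ.≤ p → steps p c ≡ c → ¬ Halted P c → Diverges c
  cycle⇒Diverges p c 1≤p cycle ¬h t = never (suc t) t ℕP.≤-refl
    where
    never : ∀ fuel t → t ℕ.< fuel → ¬ Halted P (steps t c)
    never (suc fuel) t t<fuel h with ℕP.<-≤-connex t p
    ... | inj₁ t<p = ¬h (subst (Halted P) cycle (halted-mono t p c (ℕP.<⇒≤ t<p) h))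
    ... | inj₂ p≤t = never fuel (t ∸ p) (ℕP.<-≤-trans (ℕP.∸-monoʳ-< 1≤p p≤t) (ℕP.≤-pred t<fuel))
                       (subst (Halted P) (trans (steps-∸ c p≤t) (cong (steps (t ∸ p)) cycle)) h)

  M : ℕ
  M = maxOver (size P) (λ l → constantOf (code P l))

  constantOf≤M : ∀ l → constantOf (code P l) ℕ.≤ M
  constantOf≤M = ≤-maxOver _ (λ l → constantOf (code P l))

  Large Small : Config P → Set
  Large c = M ℕ.< ∣ proj₂ c ∣
  Small c = ∣ proj₂ c ∣ ℕ.≤ M

  Large⇒≢0 : ∀ {c} → Large c → proj₂ c ≢ + 0
  Large⇒≢0 large = 0<∣i∣⇒i≢0 (ℕP.≤-<-trans ℕ.z≤n large)

  classify : ∀ c → (Large c × ¬ Halted P c) ⊎ (Small c ⊎ Halted P c)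
  classify c with M ℕP.<? ∣ proj₂ c ∣ | halted? c
  ... | yes large | no ¬h = inj₁ (large , ¬h)
  ... | _         | yes h = inj₂ (inj₂ h)
  ... | no ¬large | no _  = inj₂ (inj₁ (ℕP.≮⇒≥ ¬large))

  slopeAt : Config P → ℤ
  slopeAt c = slope (code P (proj₁ c))

  step-outward : ∀ c δ → Large c → Outward (proj₂ c) δ →
                 step P (displace c δ) ≡ displace (step P c) (slopeAt c * δ) × Outward (proj₂ (step P c)) (slopeAt c * δ)
  step-outward (l , r) δ large out rewrite step≡execute P l (r + δ) | step≡execute P l r =
    execute-outward (code P l) l r δ (constantOf≤M l) large out

  pathSlope : ℕ → Config P → ℤ
  pathSlope zero    c = + 1
  pathSlope (suc k) c = slopeAt (steps k c) * pathSlope k c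

  steps-outward : ∀ k c δ → (∀ s → s ℕ.< k → Large (steps s c)) → Outward (proj₂ c) δ →
                  steps k (displace c δ) ≡ displace (steps k c) (pathSlope k c * δ) ×
                  Outward (proj₂ (steps k c)) (pathSlope k c * δ)
  steps-outward zero c δ _ out = cong (displace c) (sym (ℤP.*-identityˡ δ)) , outward-1* out
  steps-outward (suc k) c δ large out with steps-outward k c δ (λ s s<k → large s (ℕP.m≤n⇒m≤1+n s<k)) out
  ... | eqₖ , outₖ with step-outward (steps k c) (pathSlope k c * δ) (large k ℕP.≤-refl) outₖ
  ... | eq , out′ =
    trans (cong (step P) eqₖ) (trans eq (cong (displace (step P (steps k c))) reassoc)) ,
    subst (Outward (proj₂ (step P (steps k c)))) reassoc out′
    where reassoc = sym (ℤP.*-assoc (slopeAt (steps k c)) (pathSlope k c) δ)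

  pathSlope-+ : ∀ a b c → pathSlope (a ℕ.+ b) c ≡ pathSlope a (steps b c) * pathSlope b c
  pathSlope-+ zero    b c = sym (ℤP.*-identityˡ _)
  pathSlope-+ (suc a) b c rewrite steps-+ a b c | pathSlope-+ a b c =
    sym (ℤP.*-assoc (slopeAt (steps a (steps b c))) (pathSlope a (steps b c)) (pathSlope b c))

  pathSlope-pow2 : ∀ t c → SignedPow2 (pathSlope t c)
  pathSlope-pow2 zero    c = inj₂ (0 , inj₁ refl)
  pathSlope-pow2 (suc t) c = slope-pow2 (code P (proj₁ (steps t c))) (pathSlope t c) (pathSlope-pow2 t c)

  driftBound : ℕ → ℕ
  driftBound zero    = 0
  driftBound (suc t) = (driftBound t ℕ.+ driftBound t) ℕ.+ M

  driftBound-mono : ∀ {t t′} → t ℕ.≤ t′ → driftBound t ℕ.≤ driftBound t′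
  driftBound-mono {zero}          _           = ℕ.z≤n
  driftBound-mono {suc t} {suc t′} (ℕ.s≤s t≤t′) =
    ℕP.+-monoˡ-≤ M (ℕP.+-mono-≤ (driftBound-mono t≤t′) (driftBound-mono t≤t′))

  drift≤driftBound : ∀ t c → ∣ proj₂ (steps t c) - pathSlope t c * proj₂ c ∣ ℕ.≤ driftBound t
  drift≤driftBound zero c = ℕP.≤-reflexive (cong ∣_∣ (cancel (proj₂ c)))
    where cancel : ∀ r → r - + 1 * r ≡ + 0
          cancel = solve-∀
  drift≤driftBound (suc t) c =
    subst (λ z → ∣ z ∣ ℕ.≤ driftBound (suc t)) (sym one-more-step)
      (ℕP.≤-trans (execute-drift (code P l) l v w M (constantOf≤M l))
                  (ℕP.+-monoˡ-≤ M (ℕP.+-mono-≤ (drift≤driftBound t c) (drift≤driftBound t c))))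
    where
    l = proj₁ (steps t c)
    v = proj₂ (steps t c)
    w = pathSlope t c * proj₂ c
    one-more-step : proj₂ (steps (suc t) c) - pathSlope (suc t) c * proj₂ c ≡ proj₂ (execute (code P l) l v) - slope (code P l) * w
    one-more-step = cong₂ _-_ (cong proj₂ (step≡execute P l v)) (ℤP.*-assoc (slope (code P l)) (pathSlope t c) (proj₂ c))

  Settles : Config P → Set
  Settles c = Halts c ⊎ Diverges c ⊎ Σ ℕ (λ t → Small (steps t c))

  Settles-backward : ∀ a c → Settles (steps a c) → Settles c
  Settles-backward a c (inj₁ h)               = inj₁ (Halts-backward a c h)
  Settles-backward a c (inj₂ (inj₁ d))        = inj₂ (inj₁ (Diverges-backward a c d))
  Settles-backward a c (inj₂ (inj₂ (t , s))) = inj₂ (inj₂ (t ℕ.+ a , subst Small (sym (steps-+ t a c)) s))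

  -- Every pass through the cycle adds a further outward displacement, so the
  -- run repeats the same non-halting labels forever.
  growingCycle⇒Diverges : ∀ c p D → 1 ℕ.≤ p → (∀ s → s ℕ.< p → Large (steps s c) × ¬ Halted P (steps s c)) →
                          steps p c ≡ displace c D → Outward (proj₂ c) D → Diverges c
  growingCycle⇒Diverges c p D 1≤p pass cycle outD t h =
    never (suc t) t (+ 0) ℕP.≤-refl (outward-0 (proj₂ c)) (subst (λ z → Halted P (steps t z)) (sym (displace-0 c)) h)
    where
    r≢0 : proj₂ c ≢ + 0
    r≢0 = Large⇒≢0 {c} (proj₁ (pass 0 1≤p))
    never : ∀ fuel t δ → t ℕ.< fuel → Outward (proj₂ c) δ → ¬ Halted P (steps t (displace c δ))
    never (suc fuel) t δ t<fuel outδ h with ℕP.<-≤-connex t p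
    ... | inj₁ t<p = proj₂ (pass t t<p)
                       (subst (Halted P) (proj₁ (steps-outward t c δ (λ s s<t → proj₁ (pass s (ℕP.<-trans s<t t<p))) outδ)) h)
    ... | inj₂ p≤t = never fuel (t ∸ p) (D + pathSlope p c * δ) (ℕP.<-≤-trans (ℕP.∸-monoʳ-< 1≤p p≤t) (ℕP.≤-pred t<fuel))
                       (outward-+ r≢0 outD (outward-backward r≢0 outD (subst (λ z → Outward (proj₂ z) (pathSlope p c * δ)) cycle (proj₂ sim))))
                       (subst (Halted P) after-pass h)
      where
      sim = steps-outward p c δ (λ s s<p → proj₁ (pass s s<p)) outδ
      after-pass : steps t (displace c δ) ≡ steps (t ∸ p) (displace c (D + pathSlope p c * δ))
      after-pass = trans (steps-∸ (displace c δ) p≤t)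
                     (cong (steps (t ∸ p)) (trans (proj₁ sim)
                       (trans (cong (λ z → displace z (pathSlope p c * δ)) cycle) (displace-displace c D _))))

  -- Here the cycle pulls x towards 0: a pass from x displaced outwards by δ returns to x,
  -- so a pass from x lands at a configuration of strictly smaller absolute value,
  -- unless the path slope vanishes and x lies on a loop.
  shrinkingCycle⇒Settles : ∀ fuel x δ p → ∣ proj₂ x ∣ ℕ.< fuel → 1 ℕ.≤ p → Outward (proj₂ x) δ → δ ≢ + 0 →
                           steps p (displace x δ) ≡ x → Settles x
  shrinkingCycle⇒Settles (suc fuel) x δ p ∣x∣<fuel 1≤p outδ δ≢0 back with searchFirst (λ s → classify (steps s x)) p
  ... | inj₂ (s , _ , _ , inj₁ small) = inj₂ (inj₂ (s , small))
  ... | inj₂ (s , _ , _ , inj₂ h)     = inj₁ (s , h)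
  ... | inj₁ pass with steps-outward p x δ (λ s s<p → proj₁ (pass s s<p)) outδ
  ...   | sim , out′ with pathSlope p x * δ ℤP.≟ + 0
  ...     | yes δ′≡0 = inj₂ (inj₁ (cycle⇒Diverges p x 1≤p (sym x≡xₚ) (proj₂ (pass 0 1≤p))))
    where
    x≡xₚ : x ≡ steps p x
    x≡xₚ = trans (sym back) (trans sim (trans (cong (displace (steps p x)) δ′≡0) (displace-0 _)))
  ...     | no δ′≢0 =
    Settles-backward p x (shrinkingCycle⇒Settles fuel xₚ (pathSlope p x * δ) p ∣xₚ∣<fuel 1≤p out′ δ′≢0 (cong (steps p) (sym x≡)))
    where
    xₚ = steps p x
    x≡ : x ≡ displace xₚ (pathSlope p x * δ)
    x≡ = trans (sym back) sim
    ∣xₚ∣<fuel : ∣ proj₂ xₚ ∣ ℕ.< fuel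
    ∣xₚ∣<fuel = ℕP.<-≤-trans (subst (λ z → ∣ proj₂ xₚ ∣ ℕ.< ∣ z ∣) (sym (cong proj₂ x≡)) (outward⇒∣r∣<∣r+e∣ out′ δ′≢0))
                             (ℕP.≤-pred ∣x∣<fuel)

  N : ℕ
  N = size P ℕ.* 2

  labelSign : Config P → Fin N
  labelSign c = combine (proj₁ c) (signBit (proj₂ c))

  labelSign-injective : ∀ c c′ → labelSign c ≡ labelSign c′ → proj₁ c ≡ proj₁ c′ × signBit (proj₂ c) ≡ signBit (proj₂ c′)
  labelSign-injective c c′ same = cong proj₁ split , cong proj₂ split
    where
    split = trans (sym (FP.remQuot-combine (proj₁ c) (signBit (proj₂ c))))
                  (trans (cong (remQuot 2) same) (FP.remQuot-combine (proj₁ c′) (signBit (proj₂ c′))))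

  -- X exceeds the drift of any run over N steps plus every constant of P: a run from
  -- |r| ≥ X whose path slope is still nonzero is large for the first N steps.
  X : ℕ
  X = suc ((driftBound N ℕ.+ driftBound N) ℕ.+ M)

  -- A repeated label and sign among large configurations closes a cycle whose
  -- displacement D is either outward (growing) or inward (shrinking).
  repeat⇒Settles : ∀ c a b → a ℕ.< b → b ℕ.≤ N →
                   (∀ s → s ℕ.< suc N → Large (steps s c) × ¬ Halted P (steps s c)) →
                   labelSign (steps a c) ≡ labelSign (steps b c) → Settles c
  repeat⇒Settles c a b a<b b≤N pass same = by-direction (outward? (proj₂ cₐ) D)
    where
    cₐ = steps a c
    c_b = steps b c
    D = proj₂ c_b - proj₂ cₐ
    p = b ∸ a
    1≤p = ℕP.m<n⇒0<n∸m a<b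
    same-label = labelSign-injective cₐ c_b same
    cₐ→c_b : steps p cₐ ≡ c_b
    cₐ→c_b = trans (sym (steps-+ p a c)) (cong (λ k → steps k c) (ℕP.m∸n+n≡m (ℕP.<⇒≤ a<b)))
    c_b≡ : c_b ≡ displace cₐ D
    c_b≡ = cong₂ _,_ (sym (proj₁ same-label)) (sym (restore (proj₂ c_b) (proj₂ cₐ)))
      where restore : ∀ x y → y + (x - y) ≡ x
            restore = solve-∀
    cₐ≡ : displace c_b (- D) ≡ cₐ
    cₐ≡ = cong₂ _,_ (sym (proj₁ same-label)) (restore (proj₂ c_b) (proj₂ cₐ))
      where restore : ∀ x y → x + - (x - y) ≡ y
            restore = solve-∀
    pass′ : ∀ s → s ℕ.< p → Large (steps s cₐ) × ¬ Halted P (steps s cₐ)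
    pass′ s s<p = subst (λ z → Large z × ¬ Halted P z) (steps-+ s a c)
      (pass (s ℕ.+ a) (ℕP.<-≤-trans (ℕP.<-≤-trans (subst (s ℕ.+ a ℕ.<_) (ℕP.m∸n+n≡m (ℕP.<⇒≤ a<b)) (ℕP.+-monoˡ-< a s<p)) b≤N)
                                    (ℕP.n≤1+n N)))
    by-direction : Dec (Outward (proj₂ cₐ) D) → Settles c
    by-direction (yes outD) =
      inj₂ (inj₁ (Diverges-backward a c (growingCycle⇒Diverges cₐ p D 1≤p pass′ (trans cₐ→c_b c_b≡) outD)))
    by-direction (no ¬outD) =
      Settles-backward b c (shrinkingCycle⇒Settles (suc ∣ proj₂ c_b ∣) c_b (- D) p (ℕP.n<1+n _) 1≤p
        (¬outward⇒outward-neg (proj₂ cₐ) (proj₂ c_b) D (proj₂ same-label) ¬outD) -D≢0 (trans (cong (steps p) cₐ≡) cₐ→c_b))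
      where
      -D≢0 : - D ≢ + 0
      -D≢0 -D≡0 = ¬outD (subst (Outward (proj₂ cₐ)) (sym (trans (sym (ℤP.neg-involutive D)) (cong -_ -D≡0))) (outward-0 (proj₂ cₐ)))

  settles : ∀ c → Settles c
  settles c with searchFirst (λ s → classify (steps s c)) (suc N)
  ... | inj₂ (s , _ , _ , inj₁ small) = inj₂ (inj₂ (s , small))
  ... | inj₂ (s , _ , _ , inj₂ h)     = inj₁ (s , h)
  ... | inj₁ pass with FP.pigeonhole (ℕP.n<1+n N) (λ i → labelSign (steps (toℕ i) c))
  ...   | i , j , i<j , same = repeat⇒Settles c (toℕ i) (toℕ j) i<j (ℕP.≤-pred (FP.toℕ<n j)) pass same

  -- Deciding halting

  Decided : Config P → Set
  Decided c = Halts c ⊎ Diverges c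

  ReturnsSmall : Config P → Set
  ReturnsSmall c = Σ ℕ λ t → 1 ℕ.≤ t × Small (steps t c) × ¬ Halted P c

  decided-or-returns : ∀ c → Decided c ⊎ ReturnsSmall c
  decided-or-returns c with halted? c
  ... | yes h = inj₁ (inj₁ (0 , h))
  ... | no ¬h with settles (step P c)
  ...   | inj₁ h               = inj₁ (inj₁ (Halts-backward 1 c h))
  ...   | inj₂ (inj₁ d)        = inj₁ (inj₂ (Diverges-backward 1 c d))
  ...   | inj₂ (inj₂ (t , sm)) = inj₂ (suc t , ℕ.s≤s ℕ.z≤n , subst Small (sym (steps-suc t c)) sm , ¬h)

  -- The next small configuration on the run (c itself once c is decided).
  nextSmallOf : ∀ c → Decided c ⊎ ReturnsSmall c → Config P
  nextSmallOf c (inj₁ _)       = c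
  nextSmallOf c (inj₂ (t , _)) = steps t c

  nextSmall : Config P → Config P
  nextSmall c = nextSmallOf c (decided-or-returns c)

  NextSmall : Config P → Set
  NextSmall c = Σ ℕ λ t → 1 ℕ.≤ t × Small (steps t c) × ¬ Halted P c × nextSmall c ≡ steps t c

  decided-or-next : ∀ c → Decided c ⊎ NextSmall c
  decided-or-next c = remember (decided-or-returns c) refl
    where
    remember : (m : Decided c ⊎ ReturnsSmall c) → decided-or-returns c ≡ m → Decided c ⊎ NextSmall c
    remember (inj₁ d)                      _ = inj₁ d
    remember (inj₂ (t , 1≤t , small , ¬h)) e = inj₂ (t , 1≤t , small , ¬h , cong (nextSmallOf c) e)

  smallOrbit : Config P → ℕ → Config P
  smallOrbit s zero    = s
  smallOrbit s (suc k) = nextSmall (smallOrbit s k)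

  smallOrbit-steps : ∀ s a d → (∀ k → a ℕ.≤ k → k ℕ.< a ℕ.+ d → NextSmall (smallOrbit s k)) →
                     Σ ℕ λ t → d ℕ.≤ t × steps t (smallOrbit s a) ≡ smallOrbit s (a ℕ.+ d)
  smallOrbit-steps s a zero _ = 0 , ℕ.z≤n , cong (smallOrbit s) (sym (ℕP.+-identityʳ a))
  smallOrbit-steps s a (suc d) next
    with smallOrbit-steps s a d (λ k a≤k k<a+d → next k a≤k (ℕP.<-≤-trans k<a+d (ℕP.+-monoʳ-≤ a (ℕP.n≤1+n d))))
  ... | T , d≤T , reach with next (a ℕ.+ d) (ℕP.m≤m+n a d) (subst (a ℕ.+ d ℕ.<_) (sym (ℕP.+-suc a d)) (ℕP.n<1+n _))
  ...   | t , 1≤t , _ , _ , is-next =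
    t ℕ.+ T , ℕP.+-mono-≤ 1≤t d≤T ,
    trans (steps-+ t T (smallOrbit s a))
          (trans (cong (steps t) reach) (trans (sym is-next) (cong (smallOrbit s) (sym (ℕP.+-suc a d)))))

  firstDecided : ∀ s K → (Σ ℕ λ k → k ℕ.≤ K × (∀ k′ → k′ ℕ.< k → NextSmall (smallOrbit s k′)) × Decided (smallOrbit s k))
                         ⊎ (∀ k → k ℕ.≤ K → NextSmall (smallOrbit s k))
  firstDecided s zero with decided-or-next (smallOrbit s 0)
  ... | inj₁ d    = inj₁ (0 , ℕ.z≤n , (λ k′ ()) , d)
  ... | inj₂ next = inj₂ λ { zero _ → next }
  firstDecided s (suc K) with firstDecided s K
  ... | inj₁ (k , k≤K , before , d) = inj₁ (k , ℕP.m≤n⇒m≤1+n k≤K , before , d)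
  ... | inj₂ upto with decided-or-next (smallOrbit s (suc K))
  ...   | inj₁ d    = inj₁ (suc K , ℕP.≤-refl , (λ k′ k′<1+K → upto k′ (ℕP.≤-pred k′<1+K)) , d)
  ...   | inj₂ next = inj₂ λ k k≤1+K → extend k (ℕP.m≤n⇒m<n∨m≡n k≤1+K)
    where
    extend : ∀ k → k ℕ.< suc K ⊎ k ≡ suc K → NextSmall (smallOrbit s k)
    extend k (inj₁ k<1+K) = upto k (ℕP.≤-pred k<1+K)
    extend k (inj₂ refl)  = next

  smallCount : ℕ
  smallCount = size P ℕ.* suc (M ℕ.+ M)

  encodeSmall : Config P → Fin smallCount
  encodeSmall c = combine (proj₁ c) (encodeℤ M (proj₂ c))

  encodeSmall-injective : ∀ c c′ → Small c → Small c′ → encodeSmall c ≡ encodeSmall c′ → c ≡ c′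
  encodeSmall-injective c c′ small small′ same =
    cong₂ _,_ (cong proj₁ split)
              (trans (sym (decode-encode M (proj₂ c) small)) (trans (cong (decodeℤ M) (cong proj₂ split)) (decode-encode M (proj₂ c′) small′)))
    where
    split = trans (sym (FP.remQuot-combine (proj₁ c) (encodeℤ M (proj₂ c))))
                  (trans (cong (remQuot (suc (M ℕ.+ M))) same) (FP.remQuot-combine (proj₁ c′) (encodeℤ M (proj₂ c′))))

  smallOrbit-small : ∀ s → Small s → (∀ k → k ℕ.≤ smallCount → NextSmall (smallOrbit s k)) →
                     ∀ k → k ℕ.≤ smallCount → Small (smallOrbit s k)
  smallOrbit-small s small next zero    _ = small
  smallOrbit-small s small next (suc k) 1+k≤ with next k (ℕP.<⇒≤ 1+k≤)
  ... | t , _ , smallₜ , _ , is-next = subst Small (sym is-next) smallₜ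

  -- The small configurations met along the run lie in a finite set: either one of
  -- them is decided, or two coincide and the run is caught in a loop.
  decide-small : ∀ s → Small s → Decided s
  decide-small s small with firstDecided s smallCount
  ... | inj₁ (k , _ , before , d) with smallOrbit-steps s 0 k (λ k′ _ k′<k → before k′ k′<k)
  ...   | t , _ , reach = transfer d
    where
    transfer : Decided (smallOrbit s k) → Decided s
    transfer (inj₁ h) = inj₁ (Halts-backward t s (subst Halts (sym reach) h))
    transfer (inj₂ d) = inj₂ (Diverges-backward t s (subst Diverges (sym reach) d))
  decide-small s small | inj₂ next with FP.pigeonhole (ℕP.n<1+n smallCount) (λ i → encodeSmall (smallOrbit s (toℕ i)))
  ... | i , j , i<j , same = inj₂ (Diverges-backward t₀ s (subst Diverges (sym reach) loops))
    where
    a = toℕ i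
    b = toℕ j
    b≤ = ℕP.≤-pred (FP.toℕ<n j)
    a≤ = ℕP.<⇒≤ (ℕP.<-≤-trans i<j b≤)
    orbitₐ≡orbit_b : smallOrbit s a ≡ smallOrbit s b
    orbitₐ≡orbit_b = encodeSmall-injective _ _ (smallOrbit-small s small next a a≤) (smallOrbit-small s small next b b≤) same
    around = smallOrbit-steps s a (b ∸ a)
               (λ k _ k< → next k (ℕP.≤-trans (ℕP.<⇒≤ (subst (k ℕ.<_) (ℕP.m+[n∸m]≡n (ℕP.<⇒≤ i<j)) k<)) b≤))
    loop : steps (proj₁ around) (smallOrbit s a) ≡ smallOrbit s a
    loop = trans (proj₂ (proj₂ around)) (trans (cong (smallOrbit s) (ℕP.m+[n∸m]≡n (ℕP.<⇒≤ i<j))) (sym orbitₐ≡orbit_b))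
    loops : Diverges (smallOrbit s a)
    loops = cycle⇒Diverges (proj₁ around) (smallOrbit s a) (ℕP.≤-trans (ℕP.m<n⇒0<n∸m i<j) (proj₁ (proj₂ around))) loop
              (proj₁ (proj₂ (proj₂ (proj₂ (next a a≤)))))
    start-to-a = smallOrbit-steps s 0 a (λ k _ k< → next k (ℕP.≤-trans (ℕP.<⇒≤ k<) a≤))
    t₀ = proj₁ start-to-a
    reach : steps t₀ s ≡ smallOrbit s a
    reach = proj₂ (proj₂ start-to-a)

  decide : ∀ c → Decided c
  decide c with settles c
  ... | inj₁ h               = inj₁ h
  ... | inj₂ (inj₁ d)        = inj₂ d
  ... | inj₂ (inj₂ (t , sm)) with decide-small (steps t c) sm
  ...   | inj₁ h = inj₁ (Halts-backward t c h)
  ...   | inj₂ d = inj₂ (Diverges-backward t c d)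

  haltTime : Config P → ℕ
  haltTime c = [ proj₁ , (λ _ → 0) ]′ (decide c)

  halted-haltTime : ∀ c → Halts c → Halted P (steps (haltTime c) c)
  halted-haltTime c h with decide c
  ... | inj₁ (t , hₜ) = hₜ
  ... | inj₂ d        = ⊥-elim (d (proj₁ h) (proj₂ h))

  timeBound : ℕ → ℕ
  timeBound W = maxOver (size P) (λ l → maxOver (suc (W ℕ.+ W)) (λ i → haltTime (l , decodeℤ W i)))

  timeBound-halts : ∀ W c → ∣ proj₂ c ∣ ℕ.≤ W → Halts c → Σ ℕ λ t → t ℕ.≤ timeBound W × Halted P (steps t c)
  timeBound-halts W c ∣r∣≤W h = haltTime c , bound , halted-haltTime c h
    where
    decoded : (proj₁ c , decodeℤ W (encodeℤ W (proj₂ c))) ≡ c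
    decoded = cong (proj₁ c ,_) (decode-encode W (proj₂ c) ∣r∣≤W)
    bound : haltTime c ℕ.≤ timeBound W
    bound = subst (λ z → haltTime z ℕ.≤ timeBound W) decoded
      (ℕP.≤-trans (≤-maxOver (suc (W ℕ.+ W)) (λ i → haltTime (proj₁ c , decodeℤ W i)) (encodeℤ W (proj₂ c)))
                  (≤-maxOver (size P) (λ l → maxOver (suc (W ℕ.+ W)) (λ i → haltTime (l , decodeℤ W i))) (proj₁ c)))

  -- Automata for finitely many inputs

  outputGraph : ∀ c → Decided c → ℤ → ℤ → Bool
  outputGraph c (inj₁ (t , _)) = affineGraph (+ 0) (proj₂ (steps t c))
  outputGraph c (inj₂ _)       = λ _ _ → false

  outputGraph-recognisable : ∀ c d → Recognisable (outputGraph c d)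
  outputGraph-recognisable c (inj₁ (t , _)) = Recognisable-affineGraph (+ 0) (proj₂ (steps t c))
  outputGraph-recognisable c (inj₂ _)       = Recognisable-false

  0*a+v≡v : ∀ a v → + 0 * a + v ≡ v
  0*a+v≡v = solve-∀

  outputGraph-sound : ∀ c d x y → outputGraph c d x y ≡ true → HaltsWith c y
  outputGraph-sound c (inj₁ (t , h)) x y e = t , h , sym (trans (isYes-witness (y ℤP.≟ _) e) (0*a+v≡v (+ ∣ x ∣) _))

  outputGraph-complete : ∀ c d x y → HaltsWith c y → outputGraph c d x y ≡ true
  outputGraph-complete c (inj₁ (t , h)) x y ends =
    isYes-true (y ℤP.≟ _) (trans (sym (HaltsWith-functional (t , h , refl) ends)) (sym (0*a+v≡v (+ ∣ x ∣) _)))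
  outputGraph-complete c (inj₂ d) x y (t , h , _) = ⊥-elim (d t h)

  tableEntry : ℤ → ℤ → ℤ → Bool
  tableEntry x₀ x y = inputIs x₀ x y ∧ outputGraph (start P , x₀) (decide (start P , x₀)) x y

  tableEntry-recognisable : ∀ x₀ → Recognisable (tableEntry x₀)
  tableEntry-recognisable x₀ =
    Recognisable-∧ (Recognisable-inputIs x₀) (outputGraph-recognisable (start P , x₀) (decide (start P , x₀)))

  tableEntry-sound : ∀ x₀ x y → tableEntry x₀ x y ≡ true → Computes P x y
  tableEntry-sound x₀ x y e with ∧-elim {inputIs x₀ x y} e
  ... | isInput , isOutput with isYes-witness (x ℤP.≟ x₀) isInput
  ... | refl = HaltsWith⇒Computes (outputGraph-sound (start P , x) (decide (start P , x)) x y isOutput)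

  tableEntry-complete : ∀ x y → Computes P x y → tableEntry x x y ≡ true
  tableEntry-complete x y computes =
    ∧-intro (isYes-true (x ℤP.≟ x) refl) (outputGraph-complete (start P , x) (decide (start P , x)) x y (Computes⇒HaltsWith computes))

  table : ℕ → ℤ → ℤ → Bool
  table X x y = anyBelow X (λ k → tableEntry (+ k) x y) ∨ anyBelow X (λ k → tableEntry -[1+ k ] x y)

  table-recognisable : ∀ X → Recognisable (table X)
  table-recognisable X = Recognisable-∨ (Recognisable-anyBelow X (λ k → tableEntry (+ k)) (λ k → tableEntry-recognisable (+ k)))
                                        (Recognisable-anyBelow X (λ k → tableEntry -[1+ k ]) (λ k → tableEntry-recognisable -[1+ k ]))

  table-sound : ∀ X x y → table X x y ≡ true → Computes P x y
  table-sound X x y e with ∨-elim {anyBelow X (λ k → tableEntry (+ k) x y)} e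
  ... | inj₁ e₊ = let (k , _ , entry) = anyBelow-elim X (λ k → tableEntry (+ k) x y) e₊ in tableEntry-sound (+ k) x y entry
  ... | inj₂ e₋ = let (k , _ , entry) = anyBelow-elim X (λ k → tableEntry -[1+ k ] x y) e₋ in tableEntry-sound -[1+ k ] x y entry

  table-complete : ∀ X x y → ∣ x ∣ ℕ.< X → Computes P x y → table X x y ≡ true
  table-complete X (+ n) y n<X computes =
    ∨-introˡ (anyBelow-intro X (λ k → tableEntry (+ k) (+ n) y) n n<X (tableEntry-complete (+ n) y computes))
  table-complete X -[1+ n ] y 1+n<X computes =
    ∨-introʳ {anyBelow X (λ k → tableEntry (+ k) -[1+ n ] y)}
      (anyBelow-intro X (λ k → tableEntry -[1+ k ] -[1+ n ] y) n (ℕP.<-trans ℕP.≤-refl 1+n<X) (tableEntry-complete -[1+ n ] y computes))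


-- One side of the input range: x = σ u with u ≥ X, compared with the base run from σ X.

module Side (P : Program) (σ : ℤ) (σ±1 : IsUnit σ) where
  open Machine P

  input : ℕ → Config P
  input u = start P , σ * + u

  base : Config P
  base = input X

  offset : ℕ → ℤ
  offset u = σ * + (u ∸ X)

  σu≡σX+offset : ∀ u → X ℕ.≤ u → σ * + u ≡ σ * + X + offset u
  σu≡σX+offset u X≤u = trans (cong (λ k → σ * + k) (sym (ℕP.m+[n∸m]≡n X≤u))) (ℤP.*-distribˡ-+ σ (+ X) (+ (u ∸ X)))

  input≡displace-base : ∀ u → X ℕ.≤ u → input u ≡ displace base (offset u)
  input≡displace-base u X≤u = cong (start P ,_) (σu≡σX+offset u X≤u)

  baseSlope : ℕ → ℤ
  baseSlope t = pathSlope t base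

  baseReg : ℕ → ℤ
  baseReg t = proj₂ (steps t base)

  σX : ℤ
  σX = σ * + X

  baseDrift : ℕ → ℤ
  baseDrift t = baseReg t - baseSlope t * σX

  ∣baseDrift∣≤ : ∀ t → t ℕ.≤ N → ∣ baseDrift t ∣ ℕ.≤ driftBound N
  ∣baseDrift∣≤ t t≤N = ℕP.≤-trans (drift≤driftBound t base) (driftBound-mono t≤N)

  ∣σ*n∣ : ∀ n → ∣ σ * + n ∣ ≡ n
  ∣σ*n∣ = ∣s*n∣≡n σ±1

  n≤∣F*σ*n∣ : ∀ F n → F ≢ + 0 → n ℕ.≤ ∣ F * (σ * + n) ∣
  n≤∣F*σ*n∣ F n F≢0 = subst (n ℕ.≤_) (sym (trans (ℤP.∣i*j∣≡∣i∣*∣j∣ F (σ * + n)) (cong (∣ F ∣ ℕ.*_) (∣σ*n∣ n))))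
                       (ℕP.≤-trans (ℕP.≤-reflexive (sym (ℕP.*-identityˡ n))) (ℕP.*-monoˡ-≤ n (i≢0⇒1≤∣i∣ F≢0)))

  ∣a∣≤∣r-a∣+∣r∣ : ∀ a r → ∣ a ∣ ℕ.≤ ∣ r - a ∣ ℕ.+ ∣ r ∣
  ∣a∣≤∣r-a∣+∣r∣ a r = subst (λ z → ∣ z ∣ ℕ.≤ ∣ r - a ∣ ℕ.+ ∣ r ∣) (cancel a r)
    (subst (λ k → ∣ (a - r) + r ∣ ℕ.≤ k ℕ.+ ∣ r ∣) (ℤP.∣i-j∣≡∣j-i∣ a r) (ℤP.∣i+j∣≤∣i∣+∣j∣ (a - r) r))
    where cancel : ∀ a r → (a - r) + r ≡ a
          cancel = solve-∀

  -- |slope · σX| ≥ X, while the drift and the small register together stay below X.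
  Large-base : ∀ t → t ℕ.≤ N → baseSlope t ≢ + 0 → Large (steps t base)
  Large-base t t≤N slope≢0 = ℕP.≰⇒> λ ∣r∣≤M →
    ℕP.<-irrefl refl (ℕP.<-≤-trans (ℕP.≤-<-trans (ℕP.+-mono-≤ (∣baseDrift∣≤ t t≤N) ∣r∣≤M) below-X) X≤)
    where
    X≤ : X ℕ.≤ ∣ baseDrift t ∣ ℕ.+ ∣ baseReg t ∣
    X≤ = ℕP.≤-trans (n≤∣F*σ*n∣ (baseSlope t) X slope≢0) (∣a∣≤∣r-a∣+∣r∣ (baseSlope t * σX) (baseReg t))
    below-X : driftBound N ℕ.+ M ℕ.< X
    below-X = ℕ.s≤s (ℕP.+-monoˡ-≤ M (ℕP.m≤m+n (driftBound N) (driftBound N)))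

  TimeProfile : Set
  TimeProfile = Σ ℕ λ C → Σ ℕ λ d₀ → 1 ℕ.≤ d₀ × (∀ u → X ℕ.≤ u →
     (Σ ℕ λ t → t ℕ.≤ C × Halted P (steps t (input u)))
     ⊎ ((∀ t → Halted P (steps t (input u)) → 2 ^ bits u ℕ.≤ d₀ ℕ.* t) ×
        Σ ℕ (λ t → t ℕ.≤ d₀ ℕ.* 2 ^ bits u × Halted P (steps t (input u))))
     ⊎ Diverges (input u))

  Periodic : Set
  Periodic = Σ ℕ λ H → 1 ℕ.≤ H × (∀ u → X ℕ.≤ u → SameOutcome (input u) (input (u ℕ.+ H))) × TimeProfile

  Affine : Set
  Affine = Σ ℕ λ t → Σ ℤ λ F → Σ ℤ λ β → (Σ ℕ λ e → F ≡ + (2 ^ e) ⊎ F ≡ - + (2 ^ e)) ×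
     (∀ u → X ℕ.≤ u → Halted P (steps t (input u)) × proj₂ (steps t (input u)) ≡ F * (σ * + u) + β)

  steps-input : ∀ t → (∀ s → s ℕ.< t → Large (steps s base)) → ∀ u → X ℕ.≤ u →
                steps t (input u) ≡ displace (steps t base) (baseSlope t * offset u) × Outward (baseReg t) (baseSlope t * offset u)
  steps-input t large u X≤u = trans (cong (steps t) (input≡displace-base u X≤u)) (proj₁ sim) , proj₂ sim
    where sim = steps-outward t base (offset u) large (outward-s*m-s*n σ±1 X (u ∸ X))

  -- Once the slope vanishes all inputs u ≥ X reach the same configuration.
  merge⇒Periodic : ∀ t → (∀ s → s ℕ.< t → Large (steps s base)) → baseSlope t ≡ + 0 → Periodic
  merge⇒Periodic t large slope≡0 = 1 , ℕP.≤-refl , periodic , timing (decide merged)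
    where
    merged = steps t base
    merges : ∀ u → X ℕ.≤ u → steps t (input u) ≡ merged
    merges u X≤u = trans (proj₁ (steps-input t large u X≤u)) (trans (cong (λ z → displace merged (z * offset u)) slope≡0) (displace-0 merged))
    transfer : ∀ u u′ → X ℕ.≤ u → X ℕ.≤ u′ → ∀ y → HaltsWith (input u) y → HaltsWith (input u′) y
    transfer u u′ X≤u X≤u′ y ends =
      HaltsWith-backward t (input u′) y (subst (λ z → HaltsWith z y) (sym (merges u′ X≤u′))
        (subst (λ z → HaltsWith z y) (merges u X≤u) (HaltsWith-forward t _ y ends)))
    periodic : ∀ u → X ℕ.≤ u → SameOutcome (input u) (input (u ℕ.+ 1))
    periodic u X≤u y = transfer (u ℕ.+ 1) u X≤u+1 X≤u y , transfer u (u ℕ.+ 1) X≤u X≤u+1 y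
      where X≤u+1 = ℕP.≤-trans X≤u (ℕP.m≤m+n u 1)
    timing : Decided merged → TimeProfile
    timing (inj₁ (t′ , h)) = t′ ℕ.+ t , 1 , ℕP.≤-refl , λ u X≤u → inj₁ (t′ ℕ.+ t , ℕP.≤-refl ,
      subst (Halted P) (sym (trans (steps-+ t′ t (input u)) (cong (steps t′) (merges u X≤u)))) h)
    timing (inj₂ d) = 0 , 1 , ℕP.≤-refl , λ u X≤u → inj₂ (inj₂ (Diverges-backward t (input u) (subst Diverges (sym (merges u X≤u)) d)))

  halt⇒Affine : ∀ t → (∀ s → s ℕ.< t → Large (steps s base)) → baseSlope t ≢ + 0 → Halted P (steps t base) → Affine
  halt⇒Affine t large slope≢0 h = t , baseSlope t , baseReg t - baseSlope t * σX , pow2 (pathSlope-pow2 t base) , λ u X≤u →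
    subst (Halted P) (sym (proj₁ (steps-input t large u X≤u))) h ,
    trans (cong proj₂ (proj₁ (steps-input t large u X≤u))) (affine (baseReg t) (baseSlope t) σX (offset u) (σ * + u) (σu≡σX+offset u X≤u))
    where
    pow2 : SignedPow2 (baseSlope t) → Σ ℕ λ e → baseSlope t ≡ + (2 ^ e) ⊎ baseSlope t ≡ - + (2 ^ e)
    pow2 (inj₁ slope≡0) = ⊥-elim (slope≢0 slope≡0)
    pow2 (inj₂ ±2^e)    = ±2^e
    affine : ∀ r F a d x → x ≡ a + d → r + F * d ≡ F * x + (r - F * a)
    affine r F a d x refl = regroup r F a d
      where regroup : ∀ r F a d → r + F * d ≡ F * (a + d) + (r - F * a)
            regroup = solve-∀

  Large-displace : ∀ {c e} → Large c → Outward (proj₂ c) e → Large (displace c e)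
  Large-displace large out = ℕP.<-≤-trans large (outward⇒∣r∣≤∣r+e∣ out)

  -- The base run stays large and running for N + 1 steps, so some label and sign
  -- repeat at steps i < j: a cycle of length p with slope G and displacement D.
  module BaseCycle (i j : ℕ) (i<j : i ℕ.< j) (j≤N : j ℕ.≤ N)
           (quiet : ∀ t → t ℕ.< suc N → baseSlope t ≢ + 0 × ¬ Halted P (steps t base))
           (same : labelSign (steps i base) ≡ labelSign (steps j base)) where

    large : ∀ t → t ℕ.≤ N → Large (steps t base)
    large t t≤N = Large-base t t≤N (proj₁ (quiet t (ℕ.s≤s t≤N)))

    large-before : ∀ t → t ℕ.≤ N → ∀ s → s ℕ.< t → Large (steps s base)
    large-before t t≤N s s<t = large s (ℕP.≤-trans (ℕP.<⇒≤ s<t) t≤N)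

    i≤N : i ℕ.≤ N
    i≤N = ℕP.≤-trans (ℕP.<⇒≤ i<j) j≤N

    ci cj : Config P
    ci = steps i base
    cj = steps j base

    p : ℕ
    p = j ∸ i

    1≤p : 1 ℕ.≤ p
    1≤p = ℕP.m<n⇒0<n∸m i<j

    G D : ℤ
    G = pathSlope p ci
    D = baseReg j - baseReg i

    same-label = labelSign-injective ci cj same

    p+i≡j : p ℕ.+ i ≡ j
    p+i≡j = ℕP.m∸n+n≡m (ℕP.<⇒≤ i<j)

    cᵢ→cⱼ : steps p ci ≡ cj
    cᵢ→cⱼ = trans (sym (steps-+ p i base)) (cong (λ k → steps k base) p+i≡j)

    cj≡ : cj ≡ displace ci D
    cj≡ = cong₂ _,_ (sym (proj₁ same-label)) (sym (restore (baseReg j) (baseReg i)))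
      where restore : ∀ x y → y + (x - y) ≡ x
            restore = solve-∀

    pass : ∀ s → s ℕ.< p → Large (steps s ci) × ¬ Halted P (steps s ci)
    pass s s<p = subst (λ z → Large z × ¬ Halted P z) (steps-+ s i base)
                   (large (s ℕ.+ i) (ℕP.<⇒≤ si<j') , proj₂ (quiet (s ℕ.+ i) (ℕ.s≤s (ℕP.<⇒≤ si<j'))))
      where
      si<j : s ℕ.+ i ℕ.< j
      si<j = subst (s ℕ.+ i ℕ.<_) p+i≡j (ℕP.+-monoˡ-< i s<p)
      si<j' : s ℕ.+ i ℕ.< N
      si<j' = ℕP.<-≤-trans si<j j≤N

    pass-large : ∀ s → s ℕ.< p → Large (steps s ci)
    pass-large s s<p = proj₁ (pass s s<p)

    slopeⱼ≡G*slopeᵢ : baseSlope j ≡ G * baseSlope i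
    slopeⱼ≡G*slopeᵢ = trans (cong (λ k → pathSlope k base) (sym p+i≡j)) (pathSlope-+ p i base)

    rᵢ≢0 : baseReg i ≢ + 0
    rᵢ≢0 = Large⇒≢0 {ci} (large i i≤N)
    rⱼ≢0 : baseReg j ≢ + 0
    rⱼ≢0 = Large⇒≢0 {cj} (large j j≤N)

    slopeᵢ≢0 : baseSlope i ≢ + 0
    slopeᵢ≢0 = proj₁ (quiet i (ℕ.s≤s i≤N))
    slopeⱼ≢0 : baseSlope j ≢ + 0
    slopeⱼ≢0 = proj₁ (quiet j (ℕ.s≤s j≤N))

    G≢0 : G ≢ + 0
    G≢0 G≡0 = slopeⱼ≢0 (trans slopeⱼ≡G*slopeᵢ (cong (_* baseSlope i) G≡0))

    unitOffset : ℤ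
    unitOffset = baseSlope i * (σ * + 1)

    outward-unitOffset : Outward (baseReg i) unitOffset
    outward-unitOffset = proj₂ (steps-outward i base (σ * + 1) (large-before i i≤N) (outward-s*m-s*n σ±1 X 1))

    unitOffset≢0 : unitOffset ≢ + 0
    unitOffset≢0 ≡0 = ℕP.<-irrefl refl (ℕP.<-≤-trans (ℕ.s≤s ℕ.z≤n) (subst (λ w → 1 ℕ.≤ ∣ w ∣) ≡0 (n≤∣F*σ*n∣ (baseSlope i) 1 slopeᵢ≢0)))

    -- Going once round the cycle maps an outward offset to an outward one, so G > 0.
    1≤G : + 1 ≤ G
    1≤G = outward-*⇒1≤ G rᵢ≢0 outward-unitOffset unitOffset≢0 outward-G*unitOffset G≢0
      where
      outward-G*unitOffset : Outward (baseReg i) (G * unitOffset)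
      outward-G*unitOffset = outward-signBit (baseReg i) (baseReg j) (G * unitOffset) (proj₂ same-label) rⱼ≢0
        (subst (λ z → Outward (proj₂ z) (G * unitOffset)) cᵢ→cⱼ (proj₂ (steps-outward p ci unitOffset pass-large outward-unitOffset)))

    0≤G-1 : + 0 ≤ G - + 1
    0≤G-1 = ℤP.i≤j⇒0≤j-i 1≤G

    -- From input u the cycle is entered displaced by δ, and one pass displaces it
    -- further by D + (G - 1) δ, which is again outward.
    growing⇒Diverges : Outward (baseReg i) D → ∀ u → X ℕ.≤ u → Diverges (input u)
    growing⇒Diverges outD u X≤u =
      Diverges-backward i (input u) (subst Diverges (sym entry) (growingCycle⇒Diverges cᵤ p Dᵤ 1≤p passᵤ one-pass outDᵤ))
      where
      follow = steps-input i (large-before i i≤N) u X≤u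
      δ = baseSlope i * offset u
      entry : steps i (input u) ≡ displace ci δ
      entry = proj₁ follow
      outδ : Outward (baseReg i) δ
      outδ = proj₂ follow
      cᵤ = displace ci δ
      Dᵤ = D + (G - + 1) * δ
      passᵤ : ∀ s → s ℕ.< p → Large (steps s cᵤ) × ¬ Halted P (steps s cᵤ)
      passᵤ s s<p = subst (λ z → Large z × ¬ Halted P z) (sym (proj₁ sim))
                      (Large-displace {steps s ci} (pass-large s s<p) (proj₂ sim) , proj₂ (pass s s<p))
        where sim = steps-outward s ci δ (λ s′ s′<s → pass-large s′ (ℕP.<-trans s′<s s<p)) outδ
      regroup : ∀ r D G f → (r + D) + G * f ≡ (r + f) + (D + (G - + 1) * f)
      regroup = solve-∀
      one-pass : steps p cᵤ ≡ displace cᵤ Dᵤ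
      one-pass = trans (proj₁ (steps-outward p ci δ pass-large outδ))
                   (trans (cong (λ z → displace z (G * δ)) (trans cᵢ→cⱼ cj≡)) (cong (proj₁ ci ,_) (regroup (baseReg i) D G δ)))
      outDᵤ : Outward (proj₂ cᵤ) Dᵤ
      outDᵤ = outward-forward rᵢ≢0 outδ (outward-+ rᵢ≢0 outD (outward-scale (G - + 1) 0≤G-1 outδ))

    -- If G ≥ 2, then D = (G - 1) slopeᵢ σX + (driftⱼ - driftᵢ), whose first term is
    -- outward and dominates the second by the choice of X; so D would be outward.
    inward⇒G≡1 : ¬ Outward (baseReg i) D → G ≡ + 1
    inward⇒G≡1 ¬outD with G ℤP.≟ + 1
    ... | yes G≡1 = G≡1
    ... | no G≢1 = ⊥-elim (¬outD (subst (Outward (baseReg i)) (sym D≡) (outward-+-small outward-main ∣drift∣<∣main∣)))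
      where
      main = (G - + 1) * (baseSlope i * σX)
      regroup : ∀ rj ri G F a → rj - ri ≡ (G - + 1) * (F * a) + ((rj - (G * F) * a) - (ri - F * a))
      regroup = solve-∀
      D≡ : D ≡ main + (baseDrift j - baseDrift i)
      D≡ = trans (regroup (baseReg j) (baseReg i) G (baseSlope i) σX)
                 (cong (λ z → main + ((baseReg j - z * σX) - baseDrift i)) (sym slopeⱼ≡G*slopeᵢ))
      outward-main : Outward (baseReg i) main
      outward-main = outward-scale (G - + 1) 0≤G-1 (proj₂ (steps-outward i base σX (large-before i i≤N) (outward-s*m-s*n σ±1 X X)))
      G-1≢0 : G - + 1 ≢ + 0
      G-1≢0 ≡0 = G≢1 (trans (sym (cancel G)) (cong (_+ + 1) ≡0))
        where cancel : ∀ G → (G - + 1) + + 1 ≡ G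
              cancel = solve-∀
      X≤∣main∣ : X ℕ.≤ ∣ main ∣
      X≤∣main∣ = subst (X ℕ.≤_) (sym (ℤP.∣i*j∣≡∣i∣*∣j∣ (G - + 1) (baseSlope i * σX)))
                   (ℕP.≤-trans (ℕP.≤-trans (n≤∣F*σ*n∣ (baseSlope i) X slopeᵢ≢0) (ℕP.≤-reflexive (sym (ℕP.*-identityˡ _))))
                               (ℕP.*-monoˡ-≤ ∣ baseSlope i * σX ∣ (i≢0⇒1≤∣i∣ G-1≢0)))
      ∣drift∣<∣main∣ : ∣ baseDrift j - baseDrift i ∣ ℕ.< ∣ main ∣
      ∣drift∣<∣main∣ = ℕP.<-≤-trans (ℕP.≤-<-trans (ℤP.∣i-j∣≤∣i∣+∣j∣ (baseDrift j) (baseDrift i))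
                         (ℕP.≤-<-trans (ℕP.+-mono-≤ (∣baseDrift∣≤ j j≤N) (∣baseDrift∣≤ i i≤N))
                           (ℕ.s≤s (ℕP.m≤m+n (driftBound N ℕ.+ driftBound N) M)))) X≤∣main∣

    -- Here G = 1 and D = -s d points inwards: a pass at offset s e from cᵢ returns to
    -- offset s (e - d).  Input u enters at offset s q (u - X), so inputs u and u + d
    -- behave alike, and input u needs about q (u - X) / d passes: linear in u.
    module Shrinking (¬outD : ¬ Outward (baseReg i) D) where
      G≡1 : G ≡ + 1
      G≡1 = inward⇒G≡1 ¬outD

      s : ℤ
      s = proj₁ (signOf (baseReg i))
      sign-s : SignOf (baseReg i) s
      sign-s = proj₂ (signOf (baseReg i))

      d : ℕ
      d = ∣ D ∣
      D≡-s*d : D ≡ - (s * + d)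
      D≡-s*d = proj₁ (¬outward⇒≡-s*∣D∣ sign-s ¬outD)
      1≤d : 1 ℕ.≤ d
      1≤d = proj₂ (¬outward⇒≡-s*∣D∣ sign-s ¬outD)

      q : ℕ
      q = ∣ baseSlope i ∣
      1≤q : 1 ℕ.≤ q
      1≤q = i≢0⇒1≤∣i∣ slopeᵢ≢0

      unitOffset≡s*q : unitOffset ≡ s * + q
      unitOffset≡s*q = trans (outward⇒≡s*∣e∣ rᵢ≢0 sign-s outward-unitOffset)
        (cong (λ k → s * + k) (trans (ℤP.∣i*j∣≡∣i∣*∣j∣ (baseSlope i) (σ * + 1)) (trans (cong (q ℕ.*_) (∣σ*n∣ 1)) (ℕP.*-identityʳ q))))

      entry-offset : ∀ u → baseSlope i * offset u ≡ s * + (q ℕ.* (u ∸ X))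
      entry-offset u = begin
        baseSlope i * (σ * + (u ∸ X))      ≡⟨ regroup (baseSlope i) σ (+ (u ∸ X)) ⟩
        unitOffset * + (u ∸ X)             ≡⟨ cong (_* + (u ∸ X)) unitOffset≡s*q ⟩
        s * + q * + (u ∸ X)                ≡⟨ ℤP.*-assoc s (+ q) (+ (u ∸ X)) ⟩
        s * (+ q * + (u ∸ X))              ≡⟨ cong (s *_) (sym (ℤP.pos-* q (u ∸ X))) ⟩
        s * + (q ℕ.* (u ∸ X))              ∎
        where
        open ≡-Reasoning
        regroup : ∀ F σ K → F * (σ * K) ≡ (F * (σ * + 1)) * K
        regroup = solve-∀

      at-offset : ℕ → Config P
      at-offset e = displace ci (s * + e)

      one-pass : ∀ e → steps p (at-offset e) ≡ displace ci (s * + e + D)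
      one-pass e = begin
        steps p (displace ci (s * + e))            ≡⟨ proj₁ (steps-outward p ci (s * + e) pass-large (outward-s*n e sign-s)) ⟩
        displace (steps p ci) (G * (s * + e))      ≡⟨ cong₂ displace cᵢ→cⱼ (trans (cong (_* (s * + e)) G≡1) (ℤP.*-identityˡ _)) ⟩
        displace cj (s * + e)                      ≡⟨ cong (λ z → displace z (s * + e)) cj≡ ⟩
        displace (displace ci D) (s * + e)         ≡⟨ displace-displace ci D (s * + e) ⟩
        displace ci (D + s * + e)                  ≡⟨ cong (displace ci) (ℤP.+-comm D (s * + e)) ⟩
        displace ci (s * + e + D)                  ∎
        where open ≡-Reasoning

      s*e+D≡s*[e∸d] : ∀ e → d ℕ.≤ e → s * + e + D ≡ s * + (e ∸ d)
      s*e+D≡s*[e∸d] e d≤e = trans (cong (λ z → s * + e + z) D≡-s*d) (s*m-s*n≡s*[m∸n] s e d d≤e)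

      one-pass-∸ : ∀ e → d ℕ.≤ e → steps p (at-offset e) ≡ at-offset (e ∸ d)
      one-pass-∸ e d≤e = trans (one-pass e) (cong (displace ci) (s*e+D≡s*[e∸d] e d≤e))

      running-during-pass : ∀ e t → t ℕ.< p → ¬ Halted P (steps t (at-offset e))
      running-during-pass e t t<p h = proj₂ (pass t t<p)
        (subst (Halted P) (proj₁ (steps-outward t ci (s * + e) (λ x x<t → pass-large x (ℕP.<-trans x<t t<p)) (outward-s*n e sign-s))) h)

      passes : ∀ k e → steps (k ℕ.* p) (at-offset (e ℕ.+ k ℕ.* d)) ≡ at-offset e
      passes zero e = cong at-offset (ℕP.+-identityʳ e)
      passes (suc k) e = begin
        steps (p ℕ.+ k ℕ.* p) (at-offset e′)      ≡⟨ cong (λ z → steps z (at-offset e′)) (ℕP.+-comm p (k ℕ.* p)) ⟩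
        steps (k ℕ.* p ℕ.+ p) (at-offset e′)      ≡⟨ steps-+ (k ℕ.* p) p (at-offset e′) ⟩
        steps (k ℕ.* p) (steps p (at-offset e′))  ≡⟨ cong (steps (k ℕ.* p)) (one-pass-∸ e′ d≤e′) ⟩
        steps (k ℕ.* p) (at-offset (e′ ∸ d))      ≡⟨ cong (λ z → steps (k ℕ.* p) (at-offset z)) e′∸d ⟩
        steps (k ℕ.* p) (at-offset (e ℕ.+ k ℕ.* d)) ≡⟨ passes k e ⟩
        at-offset e                               ∎
        where
        open ≡-Reasoning
        e′ = e ℕ.+ suc k ℕ.* d
        d≤e′ : d ℕ.≤ e′
        d≤e′ = ℕP.≤-trans (ℕP.m≤m+n d (k ℕ.* d)) (ℕP.m≤n+m (d ℕ.+ k ℕ.* d) e)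
        e′∸d : e′ ∸ d ≡ e ℕ.+ k ℕ.* d
        e′∸d = trans (cong (_∸ d) (trans (sym (ℕP.+-assoc e d (k ℕ.* d))) (trans (cong (ℕ._+ k ℕ.* d) (ℕP.+-comm e d)) (ℕP.+-assoc d e (k ℕ.* d)))))
                     (ℕP.m+n∸m≡n d (e ℕ.+ k ℕ.* d))

      at-cycle : ∀ u → X ℕ.≤ u → steps i (input u) ≡ at-offset (q ℕ.* (u ∸ X))
      at-cycle u X≤u = trans (proj₁ (steps-input i (large-before i i≤N) u X≤u)) (cong (displace ci) (entry-offset u))

      shift-by-d : ∀ u → X ℕ.≤ u → steps (q ℕ.* p) (steps i (input (u ℕ.+ d))) ≡ steps i (input u)
      shift-by-d u X≤u =
        trans (cong (steps (q ℕ.* p)) (trans (at-cycle (u ℕ.+ d) X≤u+d) (cong at-offset more)))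
              (trans (passes q (q ℕ.* (u ∸ X))) (sym (at-cycle u X≤u)))
        where
        X≤u+d = ℕP.≤-trans X≤u (ℕP.m≤m+n u d)
        more : q ℕ.* ((u ℕ.+ d) ∸ X) ≡ q ℕ.* (u ∸ X) ℕ.+ q ℕ.* d
        more = trans (cong (q ℕ.*_) (ℕP.+-∸-comm d X≤u)) (ℕP.*-distribˡ-+ q (u ∸ X) d)

      periodic : ∀ u → X ℕ.≤ u → SameOutcome (input u) (input (u ℕ.+ d))
      periodic u X≤u y =
        (λ e → HaltsWith-backward i (input u) y
                 (subst (λ z → HaltsWith z y) (shift-by-d u X≤u) (HaltsWith-forward (q ℕ.* p) _ y (HaltsWith-forward i _ y e)))) ,
        (λ e → HaltsWith-backward i (input (u ℕ.+ d)) y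
                 (HaltsWith-backward (q ℕ.* p) _ y (subst (λ z → HaltsWith z y) (sym (shift-by-d u X≤u)) (HaltsWith-forward i _ y e))))

      W₀ : ℕ
      W₀ = ∣ baseReg i ∣ ℕ.+ (d ℕ.+ d)

      T₀ : ℕ
      T₀ = timeBound W₀

      after-pass : ∀ e t → p ℕ.≤ t → d ℕ.≤ e → steps t (at-offset e) ≡ steps (t ∸ p) (at-offset (e ∸ d))
      after-pass e t p≤t d≤e = trans (steps-∸ (at-offset e) p≤t) (cong (steps (t ∸ p)) (one-pass-∸ e d≤e))

      time-lower : ∀ fuel e → e ℕ.< fuel → ∀ t → Halted P (steps t (at-offset e)) → e ℕ.≤ d ℕ.* suc t
      time-lower (suc fuel) e e<fuel t h with e ℕP.<? d
      ... | yes e<d = ℕP.≤-trans (ℕP.<⇒≤ e<d) (ℕP.m≤m*n d (suc t))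
      ... | no e≮d with ℕP.<-≤-connex t p
      ...   | inj₁ t<p = ⊥-elim (running-during-pass e t t<p h)
      ...   | inj₂ p≤t = e∸d≤d*[1+t∸p]⇒e≤d*[1+t] d e t p 1≤p p≤t d≤e
                           (time-lower fuel (e ∸ d) (ℕP.<-≤-trans (ℕP.∸-monoʳ-< 1≤d d≤e) (ℕP.≤-pred e<fuel)) (t ∸ p)
                             (subst (Halted P) (after-pass e t p≤t d≤e) h))
        where d≤e = ℕP.≮⇒≥ e≮d

      -- Once the offset drops below d, the next pass lands at |r| ≤ W₀, from where
      -- halting takes at most T₀ steps.
      time-upper : ∀ fuel e → e ℕ.< fuel → Halts (at-offset e) →
                   Σ ℕ λ t → t ℕ.≤ p ℕ.* suc e ℕ.+ T₀ × Halted P (steps t (at-offset e))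
      time-upper (suc fuel) e e<fuel halts with e ℕP.<? d
      ... | yes e<d = t′ ℕ.+ p , t≤T⇒t+p≤p*[1+e]+T p e t′ T₀ t′≤ ,
                      subst (Halted P) (sym (trans (steps-+ t′ p (at-offset e)) (cong (steps t′) (one-pass e)))) h′
        where
        landing = displace ci (s * + e + D)
        halts′ : Halts landing
        halts′ = subst Halts (one-pass e) (HaltsWith⇒Halts (HaltsWith-forward p (at-offset e) _ (Halts⇒HaltsWith halts)))
        ∣landing∣≤W₀ : ∣ proj₂ landing ∣ ℕ.≤ W₀
        ∣landing∣≤W₀ = ℕP.≤-trans (ℤP.∣i+j∣≤∣i∣+∣j∣ (baseReg i) (s * + e + D))
                         (ℕP.+-monoʳ-≤ ∣ baseReg i ∣ (ℕP.≤-trans (ℤP.∣i+j∣≤∣i∣+∣j∣ (s * + e) D)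
                           (ℕP.+-monoˡ-≤ d (ℕP.≤-trans (ℕP.≤-reflexive (∣s*n∣≡n (SignOf⇒IsUnit sign-s) e)) (ℕP.<⇒≤ e<d)))))
        bounded = timeBound-halts W₀ landing ∣landing∣≤W₀ halts′
        t′ = proj₁ bounded
        t′≤ = proj₁ (proj₂ bounded)
        h′ = proj₂ (proj₂ bounded)
      ... | no e≮d = t′ ℕ.+ p , t≤p*[1+e∸d]+T⇒t+p≤p*[1+e]+T p e d t′ T₀ 1≤d d≤e t′≤ ,
                     subst (Halted P) (sym (trans (cong (λ k → steps k (at-offset e)) (ℕP.+-comm t′ p)) pass-first)) h′
        where
        d≤e = ℕP.≮⇒≥ e≮d
        recursive = time-upper fuel (e ∸ d) (ℕP.<-≤-trans (ℕP.∸-monoʳ-< 1≤d d≤e) (ℕP.≤-pred e<fuel))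
          (subst Halts (one-pass-∸ e d≤e) (HaltsWith⇒Halts (HaltsWith-forward p (at-offset e) _ (Halts⇒HaltsWith halts))))
        t′ = proj₁ recursive
        t′≤ = proj₁ (proj₂ recursive)
        h′ = proj₂ (proj₂ recursive)
        pass-first : steps (p ℕ.+ t′) (at-offset e) ≡ steps t′ (at-offset (e ∸ d))
        pass-first = trans (after-pass e (p ℕ.+ t′) (ℕP.m≤m+n p t′) d≤e) (cong (λ k → steps k _) (ℕP.m+n∸m≡n p t′))

      i≤haltingTime : ∀ u → X ℕ.≤ u → ∀ T → Halted P (steps T (input u)) → i ℕ.≤ T
      i≤haltingTime u X≤u T h = ℕP.≮⇒≥ λ T<i → proj₂ (quiet T (ℕ.s≤s (ℕP.≤-trans (ℕP.<⇒≤ T<i) i≤N)))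
        (subst (Halted P) (proj₁ (steps-input T (large-before T (ℕP.≤-trans (ℕP.<⇒≤ T<i) i≤N)) u X≤u)) h)

      offset≤d*time : ∀ u → X ℕ.≤ u → ∀ T → Halted P (steps T (input u)) → u ∸ X ℕ.≤ d ℕ.* suc T
      offset≤d*time u X≤u T h =
        ℕP.≤-trans (ℕP.≤-trans (ℕP.≤-reflexive (sym (ℕP.*-identityˡ (u ∸ X)))) (ℕP.*-monoˡ-≤ (u ∸ X) 1≤q))
          (ℕP.≤-trans (time-lower (suc (q ℕ.* (u ∸ X))) (q ℕ.* (u ∸ X)) ℕP.≤-refl (T ∸ i) h′)
                      (ℕP.*-monoʳ-≤ d (ℕ.s≤s (ℕP.m∸n≤m T i))))
        where
        h′ : Halted P (steps (T ∸ i) (at-offset (q ℕ.* (u ∸ X))))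
        h′ = subst (Halted P) (trans (steps-∸ (input u) (i≤haltingTime u X≤u T h)) (cong (steps (T ∸ i)) (at-cycle u X≤u))) h

      time≤linear : ∀ u → X ℕ.≤ u → Halts (input u) →
                    Σ ℕ λ t → t ℕ.≤ i ℕ.+ (p ℕ.* suc (q ℕ.* (u ∸ X)) ℕ.+ T₀) × Halted P (steps t (input u))
      time≤linear u X≤u halts =
        t′ ℕ.+ i , subst (ℕ._≤ i ℕ.+ (p ℕ.* suc (q ℕ.* (u ∸ X)) ℕ.+ T₀)) (ℕP.+-comm i t′) (ℕP.+-monoʳ-≤ i t′≤) ,
        subst (Halted P) (sym (trans (steps-+ t′ i (input u)) (cong (steps t′) (at-cycle u X≤u)))) h′
        where
        halts′ : Halts (at-offset (q ℕ.* (u ∸ X)))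
        halts′ = subst Halts (at-cycle u X≤u) (HaltsWith⇒Halts (HaltsWith-forward i (input u) _ (Halts⇒HaltsWith halts)))
        bounded = time-upper (suc (q ℕ.* (u ∸ X))) (q ℕ.* (u ∸ X)) ℕP.≤-refl halts′
        t′ = proj₁ bounded
        t′≤ = proj₁ (proj₂ bounded)
        h′ = proj₂ (proj₂ bounded)

      -- Below Θ₀ the linear bound is a constant C₀; from Θ₀ on, the offset u - X is
      -- at least u / 2, so the time is within the factor d₀ of u, hence of 2 ^ bits u.
      Θ₀ : ℕ
      Θ₀ = (X ℕ.+ d) ℕ.+ (X ℕ.+ d)

      C₀ : ℕ
      C₀ = i ℕ.+ (p ℕ.* suc (q ℕ.* Θ₀) ℕ.+ T₀)

      K₀ : ℕ
      K₀ = i ℕ.+ (p ℕ.+ (p ℕ.* q ℕ.+ T₀))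

      d₀ : ℕ
      d₀ = ((d ℕ.+ d) ℕ.+ (d ℕ.+ d)) ℕ.+ K₀

      1≤d₀ : 1 ℕ.≤ d₀
      1≤d₀ = ℕP.≤-trans 1≤d (ℕP.≤-trans (ℕP.m≤m+n d d) (ℕP.≤-trans (ℕP.m≤m+n (d ℕ.+ d) (d ℕ.+ d)) (ℕP.m≤m+n _ K₀)))

      exponential-lower : ∀ u → X ℕ.≤ u → Θ₀ ℕ.≤ u → ∀ T → Halted P (steps T (input u)) → 2 ^ bits u ℕ.≤ d₀ ℕ.* T
      exponential-lower u X≤u Θ₀≤u T h =
        ℕP.≤-trans (2^bits≤2*n u 1≤u)
          (ℕP.≤-trans (ℕP.*-monoʳ-≤ 2 u≤2dT)
            (ℕP.≤-trans (ℕP.≤-reflexive (four-d d T)) (ℕP.*-monoˡ-≤ T (ℕP.m≤m+n ((d ℕ.+ d) ℕ.+ (d ℕ.+ d)) K₀))))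
        where
        four-d : ∀ d T → 2 ℕ.* (d ℕ.* T ℕ.+ d ℕ.* T) ≡ ((d ℕ.+ d) ℕ.+ (d ℕ.+ d)) ℕ.* T
        four-d = ℕSolver.solve-∀
        regroup : ∀ X d T → X ℕ.+ d ℕ.* suc T ≡ (X ℕ.+ d) ℕ.+ d ℕ.* T
        regroup = ℕSolver.solve-∀
        1≤u : 1 ℕ.≤ u
        1≤u = ℕP.≤-trans (ℕ.s≤s ℕ.z≤n) X≤u
        u≤2dT : u ℕ.≤ d ℕ.* T ℕ.+ d ℕ.* T
        u≤2dT = a+a≤u≤a+b⇒u≤b+b (X ℕ.+ d) u (d ℕ.* T) Θ₀≤u
                  (ℕP.≤-trans (ℕP.m≤n+m∸n u X) (ℕP.≤-trans (ℕP.+-monoʳ-≤ X (offset≤d*time u X≤u T h)) (ℕP.≤-reflexive (regroup X d T))))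

      exponential-upper : ∀ u t → X ℕ.≤ u → t ℕ.≤ i ℕ.+ (p ℕ.* suc (q ℕ.* (u ∸ X)) ℕ.+ T₀) → t ℕ.≤ d₀ ℕ.* 2 ^ bits u
      exponential-upper u t X≤u t≤ =
        ℕP.≤-trans t≤
          (ℕP.≤-trans (ℕP.+-monoʳ-≤ i (ℕP.+-monoˡ-≤ T₀ (ℕP.*-monoʳ-≤ p (ℕ.s≤s (ℕP.*-monoʳ-≤ q (ℕP.m∸n≤m u X))))))
            (ℕP.≤-trans (i+[p*[1+q*u]+T]≤K*u i p q u T₀ (ℕP.≤-trans (ℕ.s≤s ℕ.z≤n) X≤u))
              (ℕP.*-mono-≤ (ℕP.m≤n+m K₀ ((d ℕ.+ d) ℕ.+ (d ℕ.+ d))) (ℕP.<⇒≤ (n<2^bits u)))))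

      constant-upper : ∀ u t → u ℕ.< Θ₀ → t ℕ.≤ i ℕ.+ (p ℕ.* suc (q ℕ.* (u ∸ X)) ℕ.+ T₀) → t ℕ.≤ C₀
      constant-upper u t u<Θ₀ t≤ =
        ℕP.≤-trans t≤ (ℕP.+-monoʳ-≤ i (ℕP.+-monoˡ-≤ T₀ (ℕP.*-monoʳ-≤ p (ℕ.s≤s (ℕP.*-monoʳ-≤ q (ℕP.≤-trans (ℕP.m∸n≤m u X) (ℕP.<⇒≤ u<Θ₀)))))))

      Timing : ℕ → Set
      Timing u = (Σ ℕ λ t → t ℕ.≤ C₀ × Halted P (steps t (input u)))
        ⊎ ((∀ t → Halted P (steps t (input u)) → 2 ^ bits u ℕ.≤ d₀ ℕ.* t) ×
           Σ ℕ (λ t → t ℕ.≤ d₀ ℕ.* 2 ^ bits u × Halted P (steps t (input u))))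
        ⊎ Diverges (input u)

      timing : ∀ u → X ℕ.≤ u → Decided (input u) → Timing u
      timing u X≤u (inj₂ d)     = inj₂ (inj₂ d)
      timing u X≤u (inj₁ halts) = by-size (time≤linear u X≤u halts) (u ℕP.<? Θ₀)
        where
        by-size : (Σ ℕ λ t → t ℕ.≤ i ℕ.+ (p ℕ.* suc (q ℕ.* (u ∸ X)) ℕ.+ T₀) × Halted P (steps t (input u))) → Dec (u ℕ.< Θ₀) → Timing u
        by-size (t , t≤ , h) (yes u<Θ₀) = inj₁ (t , constant-upper u t u<Θ₀ t≤ , h)
        by-size (t , t≤ , h) (no u≮Θ₀)  = inj₂ (inj₁ (exponential-lower u X≤u (ℕP.≮⇒≥ u≮Θ₀) , t , exponential-upper u t X≤u t≤ , h))

      timeProfile : TimeProfile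
      timeProfile = C₀ , d₀ , 1≤d₀ , λ u X≤u → timing u X≤u (decide (input u))

      shrinking⇒Periodic : Periodic
      shrinking⇒Periodic = d , 1≤d , periodic , timeProfile

    cycle⇒Periodic : Periodic
    cycle⇒Periodic with outward? (baseReg i) D
    ... | yes outD = 1 , ℕP.≤-refl , (λ u X≤u y → (λ e → ⊥-elim (no-output (u ℕ.+ 1) (ℕP.≤-trans X≤u (ℕP.m≤m+n u 1)) e)) ,
                                                  (λ e → ⊥-elim (no-output u X≤u e))) ,
                     0 , 1 , ℕP.≤-refl , (λ u X≤u → inj₂ (inj₂ (growing⇒Diverges outD u X≤u)))
      where
      no-output : ∀ u → X ℕ.≤ u → ∀ {y} → ¬ HaltsWith (input u) y
      no-output u X≤u (t , h , _) = growing⇒Diverges outD u X≤u t h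
    ... | no ¬outD = Shrinking.shrinking⇒Periodic ¬outD

  baseEvent : ∀ t → (baseSlope t ≢ + 0 × ¬ Halted P (steps t base)) ⊎ (baseSlope t ≡ + 0 ⊎ Halted P (steps t base))
  baseEvent t with baseSlope t ℤP.≟ + 0 | halted? (steps t base)
  ... | yes slope≡0 | _      = inj₂ (inj₁ slope≡0)
  ... | no _        | yes h  = inj₂ (inj₂ h)
  ... | no slope≢0  | no ¬h = inj₁ (slope≢0 , ¬h)

  -- Within the first N steps of the base run the slope vanishes, or the run halts,
  -- or (neither happening) some label and sign repeat.
  shape : Periodic ⊎ Affine
  shape with searchFirst baseEvent (suc N)
  ... | inj₁ quiet with FP.pigeonhole (ℕP.n<1+n N) (λ k → labelSign (steps (toℕ k) base))
  ...   | i , j , i<j , same = inj₁ (BaseCycle.cycle⇒Periodic (toℕ i) (toℕ j) i<j (ℕP.≤-pred (FP.toℕ<n j)) quiet same)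
  shape | inj₂ (t , t<1+N , before , event) = by-event event (baseSlope t ℤP.≟ + 0)
    where
    large : ∀ s → s ℕ.< t → Large (steps s base)
    large s s<t = Large-base s (ℕP.≤-trans (ℕP.<⇒≤ s<t) (ℕP.≤-pred t<1+N)) (proj₁ (before s s<t))
    by-event : (baseSlope t ≡ + 0 ⊎ Halted P (steps t base)) → Dec (baseSlope t ≡ + 0) → Periodic ⊎ Affine
    by-event _          (yes slope≡0) = inj₁ (merge⇒Periodic t large slope≡0)
    by-event (inj₁ slope≡0) (no slope≢0) = ⊥-elim (slope≢0 slope≡0)
    by-event (inj₂ h)       (no slope≢0) = inj₂ (halt⇒Affine t large slope≢0 h)

  periodOf : Periodic ⊎ Affine → ℕ
  periodOf (inj₁ (H , _)) = H
  periodOf (inj₂ _)       = 1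

  1≤periodOf : ∀ R → 1 ℕ.≤ periodOf R
  1≤periodOf (inj₁ (H , 1≤H , _)) = 1≤H
  1≤periodOf (inj₂ _)             = ℕ.s≤s ℕ.z≤n

  period : ℕ
  period = periodOf shape

  1≤period : 1 ℕ.≤ period
  1≤period = 1≤periodOf shape

  SameOutcome⇒SameValue : ∀ x x′ → SameOutcome (start P , x) (start P , x′) → SameValue P x x′
  SameOutcome⇒SameValue x x′ same with decide (start P , x)
  ... | inj₁ h = inj₂ (_ , HaltsWith⇒Computes ends , HaltsWith⇒Computes (proj₂ (same _) ends))
    where ends = Halts⇒HaltsWith h
  ... | inj₂ d = inj₁ ((λ (y , c) → no-output (Computes⇒HaltsWith c)) , (λ (y , c) → no-output (proj₁ (same y) (Computes⇒HaltsWith c))))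
    where no-output : ∀ {y} → ¬ HaltsWith (start P , x) y
          no-output (t , h , _) = d t h

  periodic-multiple : ∀ H → (∀ u → X ℕ.≤ u → SameOutcome (input u) (input (u ℕ.+ H))) →
                      ∀ m u → X ℕ.≤ u → SameOutcome (input u) (input (u ℕ.+ m ℕ.* H))
  periodic-multiple H periodic zero u X≤u y =
    subst (λ k → HaltsWith (input k) y) (ℕP.+-identityʳ u) , subst (λ k → HaltsWith (input k) y) (sym (ℕP.+-identityʳ u))
  periodic-multiple H periodic (suc m) u X≤u y =
    (λ e → proj₁ (periodic u X≤u y) (proj₁ (periodic-multiple H periodic m (u ℕ.+ H) X≤u+H y) (subst (λ k → HaltsWith (input k) y) regroup e))) ,
    (λ e → subst (λ k → HaltsWith (input k) y) (sym regroup) (proj₂ (periodic-multiple H periodic m (u ℕ.+ H) X≤u+H y) (proj₂ (periodic u X≤u y) e)))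
    where
    X≤u+H = ℕP.≤-trans X≤u (ℕP.m≤m+n u H)
    regroup : u ℕ.+ suc m ℕ.* H ≡ u ℕ.+ H ℕ.+ m ℕ.* H
    regroup = sym (ℕP.+-assoc u H (m ℕ.* H))

  periodic-residue : ∀ H′ → (∀ u → X ℕ.≤ u → SameOutcome (input u) (input (u ℕ.+ suc H′))) →
                     ∀ a b → X ℕ.≤ a → X ℕ.≤ b → a % suc H′ ≡ b % suc H′ → ∀ y → HaltsWith (input a) y → HaltsWith (input b) y
  periodic-residue H′ periodic a b X≤a X≤b a≡b y ends with ℕP.≤-total a b
  ... | inj₁ a≤b = subst (λ k → HaltsWith (input k) y) (sym (≡-mod⇒≡+* a b (suc H′) a≤b a≡b))
                     (proj₂ (periodic-multiple (suc H′) periodic (b / suc H′ ∸ a / suc H′) a X≤a y) ends)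
  ... | inj₂ b≤a = proj₁ (periodic-multiple (suc H′) periodic (a / suc H′ ∸ b / suc H′) b X≤b y)
                     (subst (λ k → HaltsWith (input k) y) (≡-mod⇒≡+* b a (suc H′) b≤a (sym a≡b)) ends)

  Parametrises : (ℤ → Set) → Set
  Parametrises R = ∀ x → R x → Σ ℕ λ u → X ℕ.≤ u × x ≡ σ * + u

  toHaltsAt : ∀ x t → Halted P (steps t (start P , x)) →
              Σ ℕ λ t₀ → t₀ ℕ.≤ t × Σ ℤ λ y → HaltsAt P x t₀ y × FirstHalt (start P , x) t₀
  toHaltsAt x t h with firstHalt (start P , x) t h
  ... | t₀ , t₀≤t , first = t₀ , t₀≤t , _ , FirstHalt⇒HaltsAt first , first

  constExpOrDiverge : TimeProfile → (R : ℤ → Set) → Parametrises R → ConstExpOrDiverge P R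
  constExpOrDiverge (C , d₀ , 1≤d₀ , timing) R param = C , d₀ , 1≤d₀ , at
    where
    at : ∀ x → R x → _
    at x Rx with param x Rx
    ... | u , X≤u , refl with timing u X≤u
    ...   | inj₁ (t , t≤C , h) = let (t₀ , t₀≤t , y , halts , _) = toHaltsAt _ t h in inj₁ (t₀ , ℕP.≤-trans t₀≤t t≤C , y , halts)
    ...   | inj₂ (inj₁ (lower , t , t≤ , h)) =
      let (t₀ , t₀≤t , y , halts , (h₀ , _)) = toHaltsAt _ t h in
      inj₂ (inj₁ (t₀ , subst (λ k → 2 ^ suc ⌊log₂ k ⌋ ℕ.≤ d₀ ℕ.* t₀) (sym (∣σ*n∣ u)) (lower t₀ h₀) ,
                       subst (λ k → t₀ ℕ.≤ d₀ ℕ.* 2 ^ suc ⌊log₂ k ⌋) (sym (∣σ*n∣ u)) (ℕP.≤-trans t₀≤t t≤) , y , halts))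
    ...   | inj₂ (inj₂ d) = inj₂ (inj₂ λ (y , c) → let (t , h , _) = Computes⇒HaltsWith c in d t h)

  behaviour : (R : Periodic ⊎ Affine) (Rg : ℤ → Set) (shift : ℤ → ℤ) → Parametrises Rg → (m : ℕ) →
              (∀ u → shift (σ * + u) ≡ σ * + (u ℕ.+ m ℕ.* periodOf R)) →
              Σ ℕ λ e → Σ ℤ λ j → Behaviour P Rg shift (+ (2 ^ e)) j
  behaviour (inj₁ (H , _ , periodic , timing)) Rg shift param m shifts =
    0 , + 0 , inj₁ (same , constExpOrDiverge timing Rg param)
    where
    same : ∀ x → Rg x → SameValue P x (shift x)
    same x Rx with param x Rx
    ... | u , X≤u , refl = SameOutcome⇒SameValue _ _
      (subst (λ z → SameOutcome (input u) (start P , z)) (sym (shifts u)) (periodic-multiple H periodic m u X≤u))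
  behaviour (inj₂ (t , F , β , (e , ±2^e) , affine)) Rg shift param m shifts = e , β , by-sign ±2^e
    where
    constant : ConstantTime P Rg
    constant = t , λ x Rx →
      let (u , X≤u , x≡) = param x Rx
          (t₀ , t₀≤t , y , halts , _) = toHaltsAt x t (subst (λ z → Halted P (steps t (start P , z))) (sym x≡) (proj₁ (affine u X≤u)))
      in t₀ , t₀≤t , y , halts
    computes : ∀ x → Rg x → Computes P x (F * x + β)
    computes x Rx with param x Rx
    ... | u , X≤u , refl = HaltsWith⇒Computes (t , proj₁ (affine u X≤u) , proj₂ (affine u X≤u))
    by-sign : F ≡ + (2 ^ e) ⊎ F ≡ - + (2 ^ e) → Behaviour P Rg shift (+ (2 ^ e)) β
    by-sign (inj₁ refl) = inj₂ (inj₁ (computes , constant))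
    by-sign (inj₂ refl) = inj₂ (inj₂ (computes , constant))

  -- The graph of the computed function beyond X on this side, read off a residue
  -- table of one period (periodic case) or from the affine formula.
  rule : Periodic ⊎ Affine → ℤ → ℤ → Bool
  rule (inj₁ (zero , () , _))
  rule (inj₁ (suc H′ , _ , _ , _)) x y = anyBelow (suc H′) λ ρ →
    ⌊ ∣ x ∣ % suc H′ ℕP.≟ (X ℕ.+ ρ) % suc H′ ⌋ ∧ outputGraph (input (X ℕ.+ ρ)) (decide (input (X ℕ.+ ρ))) x y
  rule (inj₂ (t , F , β , _)) x y = affineGraph (F * σ) β x y

  rule-recognisable : ∀ R → Recognisable (rule R)
  rule-recognisable (inj₁ (zero , () , _))
  rule-recognisable (inj₁ (suc H′ , _ , _ , _)) = Recognisable-anyBelow (suc H′) _ λ ρ →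
    Recognisable-∧ (Recognisable-residue (suc H′) ((X ℕ.+ ρ) % suc H′)) (outputGraph-recognisable (input (X ℕ.+ ρ)) (decide (input (X ℕ.+ ρ))))
  rule-recognisable (inj₂ (t , F , β , _)) = Recognisable-affineGraph (F * σ) β

  rule-sound : ∀ R x y → X ℕ.≤ ∣ x ∣ → x ≡ σ * + ∣ x ∣ → rule R x y ≡ true → Computes P x y
  rule-sound (inj₁ (zero , () , _))
  rule-sound (inj₁ (suc H′ , _ , periodic , _)) x y X≤∣x∣ x≡ e with anyBelow-elim (suc H′) _ e
  ... | ρ , _ , eρ with ∧-elim {⌊ ∣ x ∣ % suc H′ ℕP.≟ (X ℕ.+ ρ) % suc H′ ⌋} eρ
  ... | same-residue , output = subst (λ z → Computes P z y) (sym x≡)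
    (HaltsWith⇒Computes (periodic-residue H′ periodic (X ℕ.+ ρ) ∣ x ∣ (ℕP.m≤m+n X ρ) X≤∣x∣ (sym (isYes-witness (_ ℕP.≟ _) same-residue)) y
                          (outputGraph-sound (input (X ℕ.+ ρ)) (decide (input (X ℕ.+ ρ))) x y output)))
  rule-sound (inj₂ (t , F , β , _ , affine)) x y X≤∣x∣ x≡ e =
    subst (λ z → Computes P z y) (sym x≡) (HaltsWith⇒Computes (t , proj₁ (affine ∣ x ∣ X≤∣x∣) , trans (proj₂ (affine ∣ x ∣ X≤∣x∣))
      (trans (cong (_+ β) (sym (ℤP.*-assoc F σ (+ ∣ x ∣)))) (sym (isYes-witness (y ℤP.≟ _) e)))))

  rule-complete : ∀ R x y → X ℕ.≤ ∣ x ∣ → x ≡ σ * + ∣ x ∣ → Computes P x y → rule R x y ≡ true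
  rule-complete (inj₁ (zero , () , _))
  rule-complete (inj₁ (suc H′ , _ , periodic , _)) x y X≤∣x∣ x≡ c =
    anyBelow-intro (suc H′) _ ρ (DM.m%n<n (∣ x ∣ ∸ X) (suc H′))
      (∧-intro (isYes-true (_ ℕP.≟ _) same-residue)
               (outputGraph-complete (input (X ℕ.+ ρ)) (decide (input (X ℕ.+ ρ))) x y
                 (periodic-residue H′ periodic ∣ x ∣ (X ℕ.+ ρ) X≤∣x∣ (ℕP.m≤m+n X ρ) same-residue y ends)))
    where
    ρ = (∣ x ∣ ∸ X) % suc H′
    same-residue : ∣ x ∣ % suc H′ ≡ (X ℕ.+ ρ) % suc H′
    same-residue = trans (cong (_% suc H′) (sym (ℕP.m+[n∸m]≡n X≤∣x∣))) (sym ([m+n%k]%k≡[m+n]%k X (∣ x ∣ ∸ X) (suc H′)))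
    ends : HaltsWith (input ∣ x ∣) y
    ends = subst (λ z → HaltsWith (start P , z) y) x≡ (Computes⇒HaltsWith c)
  rule-complete (inj₂ (t , F , β , _ , affine)) x y X≤∣x∣ x≡ c =
    isYes-true (y ℤP.≟ _)
      (trans (HaltsWith-functional (subst (λ z → HaltsWith (start P , z) y) x≡ (Computes⇒HaltsWith c)) (t , proj₁ (affine ∣ x ∣ X≤∣x∣) , refl))
             (trans (proj₂ (affine ∣ x ∣ X≤∣x∣)) (cong (_+ β) (sym (ℤP.*-assoc F σ (+ ∣ x ∣))))))

  graph : ℤ → ℤ → Bool
  graph x y = (sideBit σ±1 x ∧ ⌊ X ℕP.≤? ∣ x ∣ ⌋) ∧ rule shape x y

  graph-recognisable : Recognisable graph
  graph-recognisable = Recognisable-∧ (Recognisable-∧ (Recognisable-sideBit σ±1) (Recognisable-≥ˣ X)) (rule-recognisable shape)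

  graph-sound : ∀ x y → graph x y ≡ true → Computes P x y
  graph-sound x y e with ∧-elim {sideBit σ±1 x ∧ ⌊ X ℕP.≤? ∣ x ∣ ⌋} e
  ... | in-range , follows-rule with ∧-elim {sideBit σ±1 x} in-range
  ... | on-side , beyond = rule-sound shape x y (isYes-witness (X ℕP.≤? ∣ x ∣) beyond) (sideBit-sound σ σ±1 x on-side) follows-rule

  graph-complete : ∀ x y → X ℕ.≤ ∣ x ∣ → sideBit σ±1 x ≡ true → Computes P x y → graph x y ≡ true
  graph-complete x y X≤∣x∣ on-side c =
    ∧-intro (∧-intro on-side (isYes-true (X ℕP.≤? ∣ x ∣) X≤∣x∣)) (rule-complete shape x y X≤∣x∣ (sideBit-sound σ σ±1 x on-side) c)

module Above (P : Program) = Side P (+ 1) (inj₁ refl)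
module Below (P : Program) = Side P (- + 1) (inj₂ refl)

computes-automatic : ∀ P → Automatic (Computes P)
computes-automatic P = 0 , proj₁ recognised , λ m x y ∣x∣< ∣y∣< →
  (λ accepted → sound x y (trans (sym (proj₂ recognised m x y ∣x∣< ∣y∣<)) accepted)) ,
  (λ c → trans (proj₂ recognised m x y ∣x∣< ∣y∣<) (complete x y c))
  where
  open Machine P
  graph : ℤ → ℤ → Bool
  graph x y = table X x y ∨ (Above.graph P x y ∨ Below.graph P x y)
  recognised : Recognisable graph
  recognised = Recognisable-∨ (table-recognisable X) (Recognisable-∨ (Above.graph-recognisable P) (Below.graph-recognisable P))
  sound : ∀ x y → graph x y ≡ true → Computes P x y
  sound x y e with ∨-elim {table X x y} e
  ... | inj₁ small = table-sound X x y small
  ... | inj₂ large with ∨-elim {Above.graph P x y} large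
  ...   | inj₁ above = Above.graph-sound P x y above
  ...   | inj₂ below = Below.graph-sound P x y below
  complete : ∀ x y → Computes P x y → graph x y ≡ true
  complete x y c with ∣ x ∣ ℕP.<? X
  ... | yes ∣x∣<X = ∨-introˡ (table-complete X x y ∣x∣<X c)
  complete (+ n) y c | no ∣x∣≮X =
    ∨-introʳ {table X (+ n) y} (∨-introˡ (Above.graph-complete P (+ n) y (ℕP.≮⇒≥ ∣x∣≮X) refl c))
  complete -[1+ n ] y c | no ∣x∣≮X =
    ∨-introʳ {table X -[1+ n ] y} (∨-introʳ {Above.graph P -[1+ n ] y} (Below.graph-complete P -[1+ n ] y (ℕP.≮⇒≥ ∣x∣≮X) refl c))

behaviour-above : ∀ P m → Σ ℕ λ e → Σ ℤ λ j →
                  Behaviour P (λ x → + Machine.X P ≤ x) (λ x → x + + (Above.period P ℕ.* m)) (+ (2 ^ e)) j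
behaviour-above P m = Above.behaviour P (Above.shape P) _ _ parametrise m shifts
  where
  parametrise : Above.Parametrises P (λ x → + Machine.X P ≤ x)
  parametrise (+ u) (+≤+ X≤u) = u , X≤u , sym (ℤP.*-identityˡ (+ u))
  shifts : ∀ u → + 1 * + u + + (Above.period P ℕ.* m) ≡ + 1 * + (u ℕ.+ m ℕ.* Above.period P)
  shifts u = trans (cong₂ _+_ (ℤP.*-identityˡ (+ u)) (cong +_ (ℕP.*-comm (Above.period P) m))) (sym (ℤP.*-identityˡ _))

behaviour-below : ∀ P m → Σ ℕ λ e → Σ ℤ λ j →
                  Behaviour P (λ x → x ≤ - + Machine.X P) (λ x → x - + (m ℕ.* Below.period P)) (+ (2 ^ e)) j
behaviour-below P m = Below.behaviour P (Below.shape P) _ _ parametrise m (λ u → shifts (+ u) _)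
  where
  parametrise : Below.Parametrises P (λ x → x ≤ - + Machine.X P)
  parametrise -[1+ n ] (-≤- X≤n) = suc n , ℕ.s≤s X≤n , sym (ℤP.-1*i≡-i (+ suc n))
  shifts : ∀ a b → - + 1 * a - b ≡ - + 1 * (a + b)
  shifts = solve-∀

theorem17 : (P : Program) →
    Automatic (Computes P) ×
    (Σ ℤ λ k → Σ ℤ λ h → Σ ℕ λ e → Σ ℤ λ j → Σ ℕ λ e' → Σ ℤ λ j' →
    (+ 0 < k) × (+ 0 < h) ×
    Behaviour P (λ x → k ≤ x) (λ x → x + h) (+ (2 ^ e)) j ×
    Behaviour P (λ x → x ≤ - k) (λ x → x - h) (+ (2 ^ e')) j')
theorem17 P =
  computes-automatic P ,
  (+ Machine.X P , + (H₊ ℕ.* H₋) , proj₁ above , proj₁ (proj₂ above) , proj₁ below , proj₁ (proj₂ below) ,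
   +<+ (ℕ.s≤s ℕ.z≤n) , +<+ (ℕP.*-mono-≤ (Above.1≤period P) (Below.1≤period P)) ,
   proj₂ (proj₂ above) , proj₂ (proj₂ below))
  where
  H₊ = Above.period P
  H₋ = Below.period P
  above = behaviour-above P H₋
  below = behaviour-below P H₊
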